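{- For every $m\in\{0\}\cup\mathbb N$, the set $\mathcal R_Q=\{p\in\mathcal P^{\circ\bullet}\mid Z(\{p\})\leq Q\}$ is a category of two-colored partitions (a) if $Q=(\mathbb N,\mathbb Z,m\mathbb Z,m\mathbb Z,m\mathbb Z,\mathbb Z)$, or (b) if $Q=(\{1,2\},\pm\{0,1,2\},2m\mathbb Z,m+2m\mathbb Z,2m\mathbb Z,\mathbb Z)$.
   Context: A two-colored partition $p$ consists of a lower row $R_L$ and an upper row $R_U$ (disjoint, possibly empty, finite totally ordered sets), a decomposition of $P_p=R_L\cup R_U$ into disjoint nonempty blocks, and a coloring of each point by $\circ$ or $\bullet$; $\mathcal P^{\circ\bullet}$ is the set of all such. Orientation: the cyclic order on $P_p$ agreeing with the order of $R_L$ on $R_L$, with the reverse order of $R_U$ on $R_U$, with the maximum of $R_U$ succeeding the maximum of $R_L$ and the minimum of $R_L$ succeeding the minimum of $R_U$; intervals $]\alpha,\beta[_p$, $]\alpha,\beta]_p$ for distinct $\alpha,\beta$ refer to this cyclic order. Normalized color: color for lower points, inverse color for upper points. $\sigma_p(S)$: number of normalized-white minus number of normalized-black points of $S$; $\Sigma(p)=\sigma_p(P_p)$. Color distance: $\delta_p(\alpha,\alpha)=\Sigma(p)$; for $\alpha\ne\beta$, $\delta_p(\alpha,\beta)=\sigma_p(]\alpha,\beta[_p)$ if their normalized colors differ and $\sigma_p(]\alpha,\beta]_p)$ if they agree. Blocks $B\neq B'$ cross if there are pairwise distinct $\alpha,\beta\in B$, $\alpha',\beta'\in B'$ appearing in the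 cyclic order in the order $\alpha,\alpha',\beta,\beta'$. For a set $\mathcal S$ of partitions: $F(\mathcal S)=\{|B|: p\in\mathcal S, B$ block of $p\}$; $V(\mathcal S)=\{\sigma_p(B): p\in\mathcal S,B$ block of $p\}$; $\Sigma(\mathcal S)=\{\Sigma(p):p\in\mathcal S\}$; $L(\mathcal S)$ (resp. $K(\mathcal S)$) is the set of $\delta_p(\alpha_1,\alpha_2)$ over $p\in\mathcal S$, blocks $B$ of $p$, $\alpha_1\neq\alpha_2\in B$ with $]\alpha_1,\alpha_2[_p\cap B=\emptyset$ and $\sigma_p(\{\alpha_1,\alpha_2\})\neq0$ (resp. $=0$); $X(\mathcal S)$ is the set of $\delta_p(\alpha_1,\alpha_2)$ over $p\in\mathcal S$, crossing blocks $B_1,B_2$ of $p$, $\alpha_1\in B_1,\alpha_2\in B_2$. $Z=(F,V,\Sigma,L,K,X)$ and $\leq$ is componentwise inclusion. $\pm S=S\cup(-S)$; $m+2m\mathbb Z=\{m+2mz:z\in\mathbb Z\}$; $\mathbb N=\{1,2,\dots\}$. Category: A set $\mathcal C\subseteq\mathcal P^{\circ\bullet}$ is a category if it contains the empty partition, the two partitions with one lower and one upper point of the same color ($\circ$ or $\bullet$) forming one block, and the two partitions without upper points having two lower points colored $\bullet\circ$ resp. $\circ\bullet$ forming one block, and is closed under: tensor product (append the rows of the second partition to the right of those of the first); involution (exchange upper and lower rows); and composition $pp'$ of pairs $(p,p')$ where the upper row of $p$ and lower row of $p'$ have equal length and equal colors rank by rank, defined by taking the lower row of $p$ and the upper row of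 $p'$ as rows, identifying the upper row of $p$ with the lower row of $p'$, and letting the blocks be the nonempty intersections with the new point set of the classes of the equivalence relation generated by the blocks of $p$ and of $p'$. -}

module Defs where

open import Data.Bool using (Bool; true; false; if_then_else_; _∧_; _∨_; T)
open import Data.Nat as ℕ using (ℕ; zero; suc; _∸_; _<ᵇ_; _≤ᵇ_; _≡ᵇ_)
open import Data.Integer as ℤ using (ℤ; +_; 0ℤ; 1ℤ; -1ℤ; ∣_∣)
open import Data.Fin using (Fin; toℕ; splitAt)
open import Data.Fin.Properties using () renaming (_≟_ to _≟F_)
open import Data.List using (List; map; _++_; foldr; allFin)
open import Data.Sum using (_⊎_; inj₁; inj₂; [_,_]; swap)
open import Data.Sum.Properties using (≡-dec)
open import Data.Product using (Σ; ∃; _×_; _,_)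
open import Data.Unit using (⊤)
open import Data.Empty using (⊥)
open import Function.Bundles using (_⇔_)
open import Relation.Nullary using (¬_)
open import Relation.Nullary.Decidable using (⌊_⌋)
open import Relation.Binary.PropositionalEquality using (_≡_; _≢_)
open import Relation.Binary.Construct.Closure.Equivalence using (EqClosure)

data Color : Set where
  white black : Color   -- white = ∘, black = •

invert : Color → Color
invert white = black
invert black = white

eqCol : Color → Color → Bool
eqCol white white = true
eqCol black black = true
eqCol _     _     = false

-- Blocks are given by a labelling of the points: two points lie in the
-- same block iff they carry the same label (blocks are the nonempty
-- label classes).  A partition in the paper's sense is a labelled
-- partition up to relabelling; all notions below are relabelling-invariant.

Pt : ℕ → ℕ → Set
Pt k l = Fin k ⊎ Fin l

record Part (k l : ℕ) : Set where
  field
    lowerCol : Fin k → Color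
    upperCol : Fin l → Color
    label    : Pt k l → ℕ
open Part public

allPts : (k l : ℕ) → List (Pt k l)
allPts k l = map inj₁ (allFin k) ++ map inj₂ (allFin l)

eqPt : ∀ {k l} → Pt k l → Pt k l → Bool
eqPt x y = ⌊ ≡-dec _≟F_ _≟F_ x y ⌋

-- Position on the cycle 0 .. k+l-1: lower points in their order, then the
-- upper points in reverse order (so max R_L is followed by max R_U, and
-- min R_L follows min R_U cyclically).
pos : ∀ {k l} → Pt k l → ℕ
pos {k} {l} (inj₁ i) = toℕ i
pos {k} {l} (inj₂ j) = k ℕ.+ (l ∸ suc (toℕ j))

cdist : ∀ {k l} → Pt k l → Pt k l → ℕ
cdist {k} {l} α γ =
  if pos α ≤ᵇ pos γ then pos γ ∸ pos α else (pos γ ℕ.+ (k ℕ.+ l)) ∸ pos α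

inOpen : ∀ {k l} → Pt k l → Pt k l → Pt k l → Bool
inOpen α β γ = (0 <ᵇ cdist α γ) ∧ (cdist α γ <ᵇ cdist α β)

inHalf : ∀ {k l} → Pt k l → Pt k l → Pt k l → Bool
inHalf α β γ = (0 <ᵇ cdist α γ) ∧ (cdist α γ ≤ᵇ cdist α β)

module _ {k l : ℕ} (p : Part k l) where

  ncol : Pt k l → Color
  ncol (inj₁ i) = lowerCol p i
  ncol (inj₂ j) = invert (upperCol p j)

  weight : Pt k l → ℤ
  weight x with ncol x
  ... | white = 1ℤ
  ... | black = -1ℤ

  σ : (Pt k l → Bool) → ℤ
  σ S = foldr (λ x acc → (if S x then weight x else 0ℤ) ℤ.+ acc) 0ℤ (allPts k l)

  card : (Pt k l → Bool) → ℕ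
  card S = foldr (λ x acc → if S x then suc acc else acc) 0 (allPts k l)

  Σp : ℤ
  Σp = σ (λ _ → true)

  block : Pt k l → (Pt k l → Bool)
  block x y = label p y ≡ᵇ label p x

  pair : Pt k l → Pt k l → (Pt k l → Bool)
  pair a b y = eqPt y a ∨ eqPt y b

  δ : Pt k l → Pt k l → ℤ
  δ α β = if eqPt α β then Σp
          else (if eqCol (ncol α) (ncol β) then σ (inHalf α β) else σ (inOpen α β))

  Crosses : Pt k l → Pt k l → Set
  Crosses a₁ a₂ =
    label p a₁ ≢ label p a₂ ×
    Σ (Pt k l) λ α → Σ (Pt k l) λ β → Σ (Pt k l) λ α' → Σ (Pt k l) λ β' →
      label p α ≡ label p a₁ × label p β ≡ label p a₁ ×
      label p α' ≡ label p a₂ × label p β' ≡ label p a₂ ×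
      α ≢ β × α ≢ α' × α ≢ β' × β ≢ α' × β ≢ β' × α' ≢ β' ×
      T (inOpen α β α') × T (inOpen β α β')

record Sextuple : Set₁ where
  field
    QF : ℕ → Set
    QV : ℤ → Set
    QΣ : ℤ → Set
    QL : ℤ → Set
    QK : ℤ → Set
    QX : ℤ → Set
open Sextuple public

record Z≤ (Q : Sextuple) {k l : ℕ} (p : Part k l) : Set where
  field
    zF : ∀ x → QF Q (card p (block p x))
    zV : ∀ x → QV Q (σ p (block p x))
    zΣ : QΣ Q (Σp p)
    zL : ∀ a₁ a₂ → a₁ ≢ a₂ → label p a₁ ≡ label p a₂ →
         (∀ γ → label p γ ≡ label p a₁ → ¬ T (inOpen a₁ a₂ γ)) →
         σ p (pair p a₁ a₂) ≢ 0ℤ → QL Q (δ p a₁ a₂)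
    zK : ∀ a₁ a₂ → a₁ ≢ a₂ → label p a₁ ≡ label p a₂ →
         (∀ γ → label p γ ≡ label p a₁ → ¬ T (inOpen a₁ a₂ γ)) →
         σ p (pair p a₁ a₂) ≡ 0ℤ → QK Q (δ p a₁ a₂)
    zX : ∀ a₁ a₂ → Crosses p a₁ a₂ → QX Q (δ p a₁ a₂)

R : Sextuple → ∀ {k l} → Part k l → Set
R Q p = Z≤ Q p

-- Operations, stated relationally (all labelled representatives).

IsTensor : ∀ {k₁ l₁ k₂ l₂} → Part k₁ l₁ → Part k₂ l₂ →
           Part (k₁ ℕ.+ k₂) (l₁ ℕ.+ l₂) → Set
IsTensor {k₁} {l₁} {k₂} {l₂} p p' q =
  (∀ i → lowerCol q i ≡ [ lowerCol p , lowerCol p' ] (splitAt k₁ i)) ×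
  (∀ j → upperCol q j ≡ [ upperCol p , upperCol p' ] (splitAt l₁ j)) ×
  (∀ x y → (label q x ≡ label q y) ⇔ Same (split x) (split y))
  where
  split : Pt (k₁ ℕ.+ k₂) (l₁ ℕ.+ l₂) → Pt k₁ l₁ ⊎ Pt k₂ l₂
  split (inj₁ i) = [ (λ a → inj₁ (inj₁ a)) , (λ b → inj₂ (inj₁ b)) ] (splitAt k₁ i)
  split (inj₂ j) = [ (λ a → inj₁ (inj₂ a)) , (λ b → inj₂ (inj₂ b)) ] (splitAt l₁ j)
  Same : Pt k₁ l₁ ⊎ Pt k₂ l₂ → Pt k₁ l₁ ⊎ Pt k₂ l₂ → Set
  Same (inj₁ a) (inj₁ b) = label p a ≡ label p b
  Same (inj₂ a) (inj₂ b) = label p' a ≡ label p' b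
  Same _ _ = ⊥

IsInvolution : ∀ {k l} → Part k l → Part l k → Set
IsInvolution p q =
  (∀ i → lowerCol q i ≡ upperCol p i) ×
  (∀ j → upperCol q j ≡ lowerCol p j) ×
  (∀ x y → (label q x ≡ label q y) ⇔ (label p (swap x) ≡ label p (swap y)))

CPt : ℕ → ℕ → ℕ → Set
CPt k n l = Fin k ⊎ (Fin n ⊎ Fin l)

fromP : ∀ {k n l} → Pt k n → CPt k n l
fromP (inj₁ i) = inj₁ i
fromP (inj₂ j) = inj₂ (inj₁ j)

fromP' : ∀ {k n l} → Pt n l → CPt k n l
fromP' (inj₁ j) = inj₂ (inj₁ j)
fromP' (inj₂ j) = inj₂ (inj₂ j)

fromQ : ∀ {k n l} → Pt k l → CPt k n l
fromQ (inj₁ i) = inj₁ i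
fromQ (inj₂ j) = inj₂ (inj₂ j)

CEdge : ∀ {k n l} → Part k n → Part n l → CPt k n l → CPt k n l → Set
CEdge {k} {n} {l} p p' x y =
  (Σ (Pt k n) λ a → Σ (Pt k n) λ b →
     x ≡ fromP a × y ≡ fromP b × label p a ≡ label p b) ⊎
  (Σ (Pt n l) λ a → Σ (Pt n l) λ b →
     x ≡ fromP' a × y ≡ fromP' b × label p' a ≡ label p' b)

Composable : ∀ {k n l} → Part k n → Part n l → Set
Composable p p' = ∀ j → upperCol p j ≡ lowerCol p' j

IsComposition : ∀ {k n l} → Part k n → Part n l → Part k l → Set
IsComposition {k} {n} {l} p p' q =
  (∀ i → lowerCol q i ≡ lowerCol p i) ×
  (∀ j → upperCol q j ≡ upperCol p' j) ×
  (∀ x y → (label q x ≡ label q y) ⇔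
           EqClosure (CEdge p p') (fromQ {k} {n} {l} x) (fromQ y))

OneBlock : ∀ {k l} → Part k l → Set
OneBlock {k} {l} q = ∀ (x y : Pt k l) → label q x ≡ label q y

record IsCategory (C : ∀ {k l} → Part k l → Set) : Set where
  field
    hasEmpty  : ∀ (q : Part 0 0) → C q
    hasId     : ∀ (c : Color) (q : Part 1 1) →
                (∀ i → lowerCol q i ≡ c) → (∀ j → upperCol q j ≡ c) →
                OneBlock q → C q
    hasPairBW : ∀ (q : Part 2 0) →
                lowerCol q Data.Fin.zero ≡ black →
                lowerCol q (Data.Fin.suc Data.Fin.zero) ≡ white →
                OneBlock q → C q
    hasPairWB : ∀ (q : Part 2 0) →
                lowerCol q Data.Fin.zero ≡ white →
                lowerCol q (Data.Fin.suc Data.Fin.zero) ≡ black →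
                OneBlock q → C q
    tensor    : ∀ {k₁ l₁ k₂ l₂} (p : Part k₁ l₁) (p' : Part k₂ l₂) q →
                C p → C p' → IsTensor p p' q → C q
    involution : ∀ {k l} (p : Part k l) (q : Part l k) →
                C p → IsInvolution p q → C q
    composition : ∀ {k n l} (p : Part k n) (p' : Part n l) (q : Part k l) →
                C p → C p' → Composable p p' → IsComposition p p' q → C q

mult : ℕ → ℤ → Set
mult m x = ∃ λ (z : ℤ) → x ≡ (+ m) ℤ.* z

Qa : ℕ → Sextuple
Qa m = record
  { QF = λ n → 1 ℕ.≤ n          -- ℕ = {1,2,...}
  ; QV = λ _ → ⊤
  ; QΣ = mult m
  ; QL = mult m
  ; QK = mult m
  ; QX = λ _ → ⊤
  }

Qb : ℕ → Sextuple
Qb m = record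
  { QF = λ n → (n ≡ 1) ⊎ (n ≡ 2)
  ; QV = λ x → ∣ x ∣ ℕ.≤ 2
  ; QΣ = mult (2 ℕ.* m)
  ; QL = λ x → ∃ λ (z : ℤ) → x ≡ (+ m) ℤ.+ (+ (2 ℕ.* m)) ℤ.* z
  ; QK = mult (2 ℕ.* m)
  ; QX = λ _ → ⊤
  }

{-# OPTIONS --safe #-}

-- The colour distance is governed by a height function.  With the prefix
-- sums C(t) = σ of the points at cyclic positions ≤ t, put
-- h(x) = C(pos x) - [x normalised white]; then for α ≠ β
--   δ(α, β) = h(β) - h(α) + [β precedes α] Σ(p).
-- Hence, once Σ(p) ∈ mℤ, the conditions on L and K in (a) say that h is
-- constant modulo m on each block, and in (b), where blocks have at most two
-- points, that h(y) - h(x) ≡ m [x, y of equal normalised colour] modulo 2m.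
-- These characterisations hold for the generators and are transported
-- along tensor product, involution and composition, under which h changes
-- by explicit multiples of Σ.  For composition in (b), a block of the
-- composite is traced by applying the partner involutions of the two
-- factors alternately; every step moves the height by m modulo 2m up to
-- colour and row changes, and a parity count along this walk gives both the
-- congruence and the bound of two points per block.

module Submission where

open import Defs
import Algebra.Properties.CommutativeMonoid.Sum as MonoidSum
open import Data.Bool using (Bool; true; false; if_then_else_; _∧_; _∨_; not; T)
open import Data.Bool.Properties using (∧-identityʳ; ∧-zeroʳ)
open import Data.Unit using (tt)
open import Data.Empty using (⊥; ⊥-elim)
open import Data.Nat as ℕ using (ℕ; zero; suc; z≤n; s≤s; _<ᵇ_; _≤ᵇ_; _≡ᵇ_; _∸_)
  renaming (_+_ to _+ₙ_; _*_ to _*ₙ_; _≤_ to _≤ₙ_; _<_ to _<ₙ_)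
import Data.Nat.Properties as ℕP
import Data.Nat.Tactic.RingSolver as ℕSolver
open import Data.Integer as ℤ using (ℤ; +_; 0ℤ; 1ℤ; -1ℤ; ∣_∣; _+_; _-_; -_; _*_)
import Data.Integer.Properties as ℤP
open import Data.Integer.Tactic.RingSolver using (solve-∀)
open import Data.Fin as Fin using (Fin; toℕ; splitAt; _↑ˡ_; _↑ʳ_)
import Data.Fin.Properties as FinP
open import Data.List using (List; []; _∷_; map; _++_; foldr; allFin; tabulate)
open import Data.Sum using (_⊎_; inj₁; inj₂; swap; [_,_])
open import Data.Sum.Properties using (≡-dec; inj₁-injective; inj₂-injective; swap-involutive)
open import Function using (_∘_)
open import Data.Product using (∃; _×_; _,_; proj₁; proj₂)
open import Function.Bundles using (Equivalence; _⇔_; mk⇔)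
open import Relation.Nullary using (¬_; Dec; yes; no)
open import Relation.Binary.PropositionalEquality hiding ([_])
open import Relation.Binary.Definitions using (tri<; tri≈; tri>)
open import Relation.Binary.Construct.Closure.ReflexiveTransitive using (ε; _◅_)
open import Relation.Binary.Construct.Closure.Symmetric using (SymClosure; fwd; bwd)
open import Relation.Binary.Construct.Closure.Equivalence using (EqClosure)

open MonoidSum ℤP.+-0-commutativeMonoid using (sum; sum-cong-≗; ∑-distrib-+; sum-replicate-zero)

T⇒≡true : ∀ {b} → T b → b ≡ true
T⇒≡true {true} _ = refl

≡true⇒T : ∀ {b} → b ≡ true → T b
≡true⇒T refl = tt

¬T⇒≡false : ∀ {b} → ¬ T b → b ≡ false
¬T⇒≡false {true}  ¬t = ⊥-elim (¬t tt)
¬T⇒≡false {false} _  = refl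

≡false⇒¬T : ∀ {b} → b ≡ false → ¬ T b
≡false⇒¬T refl ()

T-injective : ∀ {b c : Bool} → (T b → T c) → (T c → T b) → b ≡ c
T-injective {true}  {true}  _ _ = refl
T-injective {true}  {false} f _ = ⊥-elim (f tt)
T-injective {false} {true}  _ g = ⊥-elim (g tt)
T-injective {false} {false} _ _ = refl

T-∧-intro : ∀ {b c} → T b → T c → T (b ∧ c)
T-∧-intro {true} _ t = t

T-∧-proj₁ : ∀ {b c} → T (b ∧ c) → T b
T-∧-proj₁ {true} _ = tt

T-∧-proj₂ : ∀ {b c} → T (b ∧ c) → T c
T-∧-proj₂ {true} t = t

T-∨-inj₁ : ∀ {b c} → T b → T (b ∨ c)
T-∨-inj₁ {true} _ = tt

T-∨-inj₂ : ∀ {b c} → T c → T (b ∨ c)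
T-∨-inj₂ {true}  _ = tt
T-∨-inj₂ {false} t = t

T-∨-elim : ∀ {b c} → T (b ∨ c) → T b ⊎ T c
T-∨-elim {true}  _ = inj₁ tt
T-∨-elim {false} t = inj₂ t

<ᵇ-true : ∀ {a c} → a <ₙ c → (a <ᵇ c) ≡ true
<ᵇ-true a<c = T⇒≡true (ℕP.<⇒<ᵇ a<c)

<ᵇ-false : ∀ {a c} → c ≤ₙ a → (a <ᵇ c) ≡ false
<ᵇ-false {a} {c} c≤a = ¬T⇒≡false (λ t → ℕP.<⇒≱ (ℕP.<ᵇ⇒< a c t) c≤a)

≤ᵇ-true : ∀ {a c} → a ≤ₙ c → (a ≤ᵇ c) ≡ true
≤ᵇ-true a≤c = T⇒≡true (ℕP.≤⇒≤ᵇ a≤c)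

≤ᵇ-false : ∀ {a c} → c <ₙ a → (a ≤ᵇ c) ≡ false
≤ᵇ-false {a} {c} c<a = ¬T⇒≡false (λ t → ℕP.<⇒≱ c<a (ℕP.≤ᵇ⇒≤ a c t))

≡ᵇ-refl : ∀ a → (a ≡ᵇ a) ≡ true
≡ᵇ-refl a = T⇒≡true (ℕP.≡⇒≡ᵇ a a refl)

≡ᵇ-false : ∀ {a c} → a ≢ c → (a ≡ᵇ c) ≡ false
≡ᵇ-false {a} {c} a≢c = ¬T⇒≡false (λ t → a≢c (ℕP.≡ᵇ⇒≡ a c t))

≤ᵇ-+-cancelʳ : ∀ a b c → (a +ₙ c ≤ᵇ b +ₙ c) ≡ (a ≤ᵇ b)
≤ᵇ-+-cancelʳ a b c = T-injective (λ t → ℕP.≤⇒≤ᵇ (ℕP.+-cancelʳ-≤ c a b (ℕP.≤ᵇ⇒≤ _ _ t)))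
                                 (λ t → ℕP.≤⇒≤ᵇ (ℕP.+-monoˡ-≤ c (ℕP.≤ᵇ⇒≤ a b t)))

≤ᵇ-+-cancelˡ : ∀ a b c → (c +ₙ a ≤ᵇ c +ₙ b) ≡ (a ≤ᵇ b)
≤ᵇ-+-cancelˡ a b c = T-injective (λ t → ℕP.≤⇒≤ᵇ (ℕP.+-cancelˡ-≤ c a b (ℕP.≤ᵇ⇒≤ _ _ t)))
                                 (λ t → ℕP.≤⇒≤ᵇ (ℕP.+-monoʳ-≤ c (ℕP.≤ᵇ⇒≤ a b t)))

_≟ₚ_ : ∀ {k l} (x y : Pt k l) → Dec (x ≡ y)
_≟ₚ_ = ≡-dec Fin._≟_ Fin._≟_

eqPt-refl : ∀ {k l} (x : Pt k l) → eqPt x x ≡ true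
eqPt-refl x with x ≟ₚ x
... | yes _ = refl
... | no x≢x = ⊥-elim (x≢x refl)

eqPt-≢ : ∀ {k l} {x y : Pt k l} → x ≢ y → eqPt x y ≡ false
eqPt-≢ {x = x} {y} x≢y with x ≟ₚ y
... | yes x≡y = ⊥-elim (x≢y x≡y)
... | no _ = refl

T-not-eqPt⇒≢ : ∀ {k l} {x y : Pt k l} → T (not (eqPt x y)) → x ≢ y
T-not-eqPt⇒≢ {y = y} t refl rewrite eqPt-refl y = t

searchFin : ∀ n (P : Fin n → Bool) → (∃ λ i → T (P i)) ⊎ (∀ i → ¬ T (P i))
searchFin zero P = inj₂ (λ ())
searchFin (suc n) P with P Fin.zero in eq | searchFin n (λ i → P (Fin.suc i))
... | true  | _ = inj₁ (Fin.zero , ≡true⇒T eq)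
... | false | inj₁ (i , t) = inj₁ (Fin.suc i , t)
... | false | inj₂ none = inj₂ λ { Fin.zero → ≡false⇒¬T eq ; (Fin.suc i) → none i }

search : ∀ {k l} (P : Pt k l → Bool) → (∃ λ x → T (P x)) ⊎ (∀ x → ¬ T (P x))
search {k} {l} P with searchFin k (λ i → P (inj₁ i)) | searchFin l (λ j → P (inj₂ j))
... | inj₁ (i , t) | _ = inj₁ (inj₁ i , t)
... | inj₂ _ | inj₁ (j , t) = inj₁ (inj₂ j , t)
... | inj₂ none₁ | inj₂ none₂ = inj₂ λ { (inj₁ i) → none₁ i ; (inj₂ j) → none₂ j }

module Multiples (d : ℕ) where

  mult-0 : mult d 0ℤ
  mult-0 = 0ℤ , sym (ℤP.*-zeroʳ (+ d))

  mult-+ : ∀ {x y} → mult d x → mult d y → mult d (x + y)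
  mult-+ (z , refl) (w , refl) = z + w , sym (ℤP.*-distribˡ-+ (+ d) z w)

  mult-neg : ∀ {x} → mult d x → mult d (- x)
  mult-neg (z , refl) = - z , ℤP.neg-distribʳ-* (+ d) z

  mult-- : ∀ {x y} → mult d x → mult d y → mult d (x - y)
  mult-- mx my = mult-+ mx (mult-neg my)

  mult-resp : ∀ {x y} → x ≡ y → mult d x → mult d y
  mult-resp refl mx = mx

m*even : ∀ m t → mult (2 *ₙ m) (+ m * (+ 2 * t))
m*even m t = t , (begin
  + m * (+ 2 * t) ≡⟨ lemma (+ m) t ⟩
  + 2 * + m * t   ≡⟨ cong (_* t) (ℤP.pos-* 2 m) ⟨
  + (2 *ₙ m) * t  ∎)
  where
  open ≡-Reasoning
  lemma : ∀ a b → a * (+ 2 * b) ≡ + 2 * a * b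
  lemma = solve-∀

x≡y+z⇒z≡x-y : ∀ {x y z : ℤ} → x ≡ y + z → z ≡ x - y
x≡y+z⇒z≡x-y {y = y} {z} refl = lemma y z
  where
  lemma : ∀ y z → z ≡ y + z - y
  lemma = solve-∀

x≡y+z⇒y≡x-z : ∀ {x y z : ℤ} → x ≡ y + z → y ≡ x - z
x≡y+z⇒y≡x-z {y = y} {z} refl = lemma y z
  where
  lemma : ∀ y z → y ≡ y + z - z
  lemma = solve-∀

sum-neg : ∀ n (f : Fin n → ℤ) → sum (λ i → - f i) ≡ - sum f
sum-neg zero f = refl
sum-neg (suc n) f = trans (cong (_+_ (- f Fin.zero)) (sum-neg n (λ i → f (Fin.suc i))))
                          (sym (ℤP.neg-distrib-+ (f Fin.zero) _))

sum-↑ : ∀ m n (f : Fin (m +ₙ n) → ℤ) → sum f ≡ sum (λ i → f (i ↑ˡ n)) + sum (λ j → f (m ↑ʳ j))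
sum-↑ zero n f = sym (ℤP.+-identityˡ _)
sum-↑ (suc m) n f = trans (cong (_+_ (f Fin.zero)) (sum-↑ m n (λ i → f (Fin.suc i))))
                          (sym (ℤP.+-assoc (f Fin.zero) _ _))

sum-supportedAt : ∀ n (a : Fin n) (f : Fin n → ℤ) → (∀ i → i ≢ a → f i ≡ 0ℤ) → sum f ≡ f a
sum-supportedAt (suc n) Fin.zero f f0 = begin
  f Fin.zero + sum (λ i → f (Fin.suc i)) ≡⟨ cong (_+_ (f Fin.zero)) (sum-cong-≗ (λ i → f0 (Fin.suc i) λ ())) ⟩
  f Fin.zero + sum (λ (_ : Fin n) → 0ℤ)  ≡⟨ cong (_+_ (f Fin.zero)) (sum-replicate-zero n) ⟩
  f Fin.zero + 0ℤ                        ≡⟨ ℤP.+-identityʳ _ ⟩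
  f Fin.zero                             ∎
  where open ≡-Reasoning
sum-supportedAt (suc n) (Fin.suc a) f f0 = begin
  f Fin.zero + sum (λ i → f (Fin.suc i)) ≡⟨ cong (_+ sum (λ i → f (Fin.suc i))) (f0 Fin.zero λ ()) ⟩
  0ℤ + sum (λ i → f (Fin.suc i))         ≡⟨ ℤP.+-identityˡ _ ⟩
  sum (λ i → f (Fin.suc i))              ≡⟨ sum-supportedAt n a _ (λ i i≢a → f0 (Fin.suc i) (i≢a ∘ FinP.suc-injective)) ⟩
  f (Fin.suc a)                          ∎
  where open ≡-Reasoning

sumPt : ∀ k l → (Pt k l → ℤ) → ℤ
sumPt k l f = sum (λ i → f (inj₁ i)) + sum (λ j → f (inj₂ j))

module _ {k l : ℕ} where

  sumPt-cong : ∀ {f g : Pt k l → ℤ} → (∀ x → f x ≡ g x) → sumPt k l f ≡ sumPt k l g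
  sumPt-cong f≗g = cong₂ _+_ (sum-cong-≗ (λ i → f≗g (inj₁ i))) (sum-cong-≗ (λ j → f≗g (inj₂ j)))

  sumPt-distrib-+ : ∀ (f g : Pt k l → ℤ) → sumPt k l (λ x → f x + g x) ≡ sumPt k l f + sumPt k l g
  sumPt-distrib-+ f g = begin
    sum (λ i → f (inj₁ i) + g (inj₁ i)) + sum (λ j → f (inj₂ j) + g (inj₂ j))
      ≡⟨ cong₂ _+_ (∑-distrib-+ (λ i → f (inj₁ i)) (λ i → g (inj₁ i)))
                   (∑-distrib-+ (λ j → f (inj₂ j)) (λ j → g (inj₂ j))) ⟩
    (sum (λ i → f (inj₁ i)) + sum (λ i → g (inj₁ i))) + (sum (λ j → f (inj₂ j)) + sum (λ j → g (inj₂ j)))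
      ≡⟨ interchange (sum (λ i → f (inj₁ i))) (sum (λ i → g (inj₁ i))) (sum (λ j → f (inj₂ j))) (sum (λ j → g (inj₂ j))) ⟩
    sumPt k l f + sumPt k l g ∎
    where
    open ≡-Reasoning
    interchange : ∀ a b c d → (a + b) + (c + d) ≡ (a + c) + (b + d)
    interchange = solve-∀

  sumPt-neg : ∀ (f : Pt k l → ℤ) → sumPt k l (λ x → - f x) ≡ - sumPt k l f
  sumPt-neg f = trans (cong₂ _+_ (sum-neg k (λ i → f (inj₁ i))) (sum-neg l (λ j → f (inj₂ j))))
                      (sym (ℤP.neg-distrib-+ (sum (λ i → f (inj₁ i))) _))

  sumPt-zero : sumPt k l (λ _ → 0ℤ) ≡ 0ℤ
  sumPt-zero = cong₂ _+_ (sum-replicate-zero k) (sum-replicate-zero l)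

  sumPt-supportedAt : ∀ (a : Pt k l) (f : Pt k l → ℤ) → (∀ x → x ≢ a → f x ≡ 0ℤ) → sumPt k l f ≡ f a
  sumPt-supportedAt (inj₁ a) f f0 = begin
    sum (λ i → f (inj₁ i)) + sum (λ j → f (inj₂ j))
      ≡⟨ cong₂ _+_ (sum-supportedAt k a _ (λ i i≢a → f0 (inj₁ i) (i≢a ∘ inj₁-injective)))
                   (trans (sum-cong-≗ (λ j → f0 (inj₂ j) λ ())) (sum-replicate-zero l)) ⟩
    f (inj₁ a) + 0ℤ ≡⟨ ℤP.+-identityʳ _ ⟩
    f (inj₁ a) ∎
    where open ≡-Reasoning
  sumPt-supportedAt (inj₂ a) f f0 = begin
    sum (λ i → f (inj₁ i)) + sum (λ j → f (inj₂ j))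
      ≡⟨ cong₂ _+_ (trans (sum-cong-≗ (λ i → f0 (inj₁ i) λ ())) (sum-replicate-zero k))
                   (sum-supportedAt l a _ (λ j j≢a → f0 (inj₂ j) (j≢a ∘ inj₂-injective))) ⟩
    0ℤ + f (inj₂ a) ≡⟨ ℤP.+-identityˡ _ ⟩
    f (inj₂ a) ∎
    where open ≡-Reasoning

sumList : ∀ {A : Set} → (A → ℤ) → List A → ℤ
sumList f = foldr (λ x acc → f x + acc) 0ℤ

sumList-++ : ∀ {A : Set} (f : A → ℤ) xs ys → sumList f (xs ++ ys) ≡ sumList f xs + sumList f ys
sumList-++ f [] ys = sym (ℤP.+-identityˡ _)
sumList-++ f (x ∷ xs) ys = trans (cong (_+_ (f x)) (sumList-++ f xs ys)) (sym (ℤP.+-assoc (f x) _ _))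

sumList-map : ∀ {A B : Set} (f : B → ℤ) (g : A → B) xs → sumList f (map g xs) ≡ sumList (f ∘ g) xs
sumList-map f g [] = refl
sumList-map f g (x ∷ xs) = cong (_+_ (f (g x))) (sumList-map f g xs)

sumList-tabulate : ∀ {A : Set} n (f : A → ℤ) (g : Fin n → A) → sumList f (tabulate g) ≡ sum (f ∘ g)
sumList-tabulate zero f g = refl
sumList-tabulate (suc n) f g = cong (_+_ (f (g Fin.zero))) (sumList-tabulate n f (g ∘ Fin.suc))

sumList-allPts : ∀ k l (f : Pt k l → ℤ) → sumList f (allPts k l) ≡ sumPt k l f
sumList-allPts k l f = begin
  sumList f (map inj₁ (allFin k) ++ map inj₂ (allFin l))
    ≡⟨ sumList-++ f (map inj₁ (allFin k)) (map inj₂ (allFin l)) ⟩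
  sumList f (map inj₁ (allFin k)) + sumList f (map inj₂ (allFin l))
    ≡⟨ cong₂ _+_ (trans (sumList-map f inj₁ (allFin k)) (sumList-tabulate k (f ∘ inj₁) (λ i → i)))
                 (trans (sumList-map f inj₂ (allFin l)) (sumList-tabulate l (f ∘ inj₂) (λ j → j))) ⟩
  sumPt k l f ∎
  where open ≡-Reasoning

when : Bool → ℤ → ℤ
when b x = if b then x else 0ℤ

when-∨+when-∧ : ∀ b c x → when (b ∨ c) x + when (b ∧ c) x ≡ when b x + when c x
when-∨+when-∧ true  true  x = refl
when-∨+when-∧ true  false x = refl
when-∨+when-∧ false true  x = trans (ℤP.+-identityʳ x) (sym (ℤP.+-identityˡ x))
when-∨+when-∧ false false x = refl

when-neg : ∀ b x → when b (- x) ≡ - when b x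
when-neg true  x = refl
when-neg false x = refl

colourWeight : Color → ℤ
colourWeight white = 1ℤ
colourWeight black = -1ℤ

weight≡colourWeight : ∀ {k l} (p : Part k l) x → weight p x ≡ colourWeight (ncol p x)
weight≡colourWeight p x with ncol p x
... | white = refl
... | black = refl

module _ {k l : ℕ} (p : Part k l) where

  σ≡sumPt : ∀ S → σ p S ≡ sumPt k l (λ x → when (S x) (weight p x))
  σ≡sumPt S = sumList-allPts k l (λ x → when (S x) (weight p x))

  σ-cong : ∀ {S S′ : Pt k l → Bool} → (∀ x → S x ≡ S′ x) → σ p S ≡ σ p S′
  σ-cong {S} {S′} S≗S′ = begin
    σ p S                                    ≡⟨ σ≡sumPt S ⟩
    sumPt k l (λ x → when (S x) (weight p x))  ≡⟨ sumPt-cong (λ x → cong (λ b → when b (weight p x)) (S≗S′ x)) ⟩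
    sumPt k l (λ x → when (S′ x) (weight p x)) ≡⟨ σ≡sumPt S′ ⟨
    σ p S′                                   ∎
    where open ≡-Reasoning

  σ-∨+σ-∧ : ∀ S S′ → σ p (λ x → S x ∨ S′ x) + σ p (λ x → S x ∧ S′ x) ≡ σ p S + σ p S′
  σ-∨+σ-∧ S S′ = begin
    σ p S∨S′ + σ p S∧S′
      ≡⟨ cong₂ _+_ (σ≡sumPt S∨S′) (σ≡sumPt S∧S′) ⟩
    sumPt k l (λ x → when (S∨S′ x) (w x)) + sumPt k l (λ x → when (S∧S′ x) (w x))
      ≡⟨ sumPt-distrib-+ (λ x → when (S∨S′ x) (w x)) (λ x → when (S∧S′ x) (w x)) ⟨
    sumPt k l (λ x → when (S∨S′ x) (w x) + when (S∧S′ x) (w x))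
      ≡⟨ sumPt-cong (λ x → when-∨+when-∧ (S x) (S′ x) (w x)) ⟩
    sumPt k l (λ x → when (S x) (w x) + when (S′ x) (w x))
      ≡⟨ sumPt-distrib-+ (λ x → when (S x) (w x)) (λ x → when (S′ x) (w x)) ⟩
    sumPt k l (λ x → when (S x) (w x)) + sumPt k l (λ x → when (S′ x) (w x))
      ≡⟨ cong₂ _+_ (σ≡sumPt S) (σ≡sumPt S′) ⟨
    σ p S + σ p S′ ∎
    where
    open ≡-Reasoning
    w = weight p
    S∨S′ = λ x → S x ∨ S′ x
    S∧S′ = λ x → S x ∧ S′ x

  σ-∅ : σ p (λ _ → false) ≡ 0ℤ
  σ-∅ = trans (σ≡sumPt (λ _ → false)) (sumPt-zero {k} {l})

  σ-empty : ∀ S → (∀ x → ¬ T (S x)) → σ p S ≡ 0ℤ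
  σ-empty S none = trans (σ-cong (λ x → ¬T⇒≡false (none x))) σ-∅

  σ-disjoint-∪ : ∀ U S S′ → (∀ x → U x ≡ (S x ∨ S′ x)) → (∀ x → (S x ∧ S′ x) ≡ false) →
                 σ p U ≡ σ p S + σ p S′
  σ-disjoint-∪ U S S′ U≗S∪S′ disjoint = begin
    σ p U                                                 ≡⟨ σ-cong U≗S∪S′ ⟩
    σ p (λ x → S x ∨ S′ x)                                ≡⟨ ℤP.+-identityʳ _ ⟨
    σ p (λ x → S x ∨ S′ x) + 0ℤ                           ≡⟨ cong (_+_ (σ p (λ x → S x ∨ S′ x))) (trans (σ-cong disjoint) σ-∅) ⟨
    σ p (λ x → S x ∨ S′ x) + σ p (λ x → S x ∧ S′ x)       ≡⟨ σ-∨+σ-∧ S S′ ⟩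
    σ p S + σ p S′                                        ∎
    where open ≡-Reasoning

  σ-singleton : ∀ S a → S a ≡ true → (∀ x → x ≢ a → S x ≡ false) → σ p S ≡ weight p a
  σ-singleton S a Sa only-a = begin
    σ p S                                     ≡⟨ σ≡sumPt S ⟩
    sumPt k l (λ x → when (S x) (weight p x)) ≡⟨ sumPt-supportedAt a _ (λ x x≢a → cong (λ b → when b (weight p x)) (only-a x x≢a)) ⟩
    when (S a) (weight p a)                   ≡⟨ cong (λ b → when b (weight p a)) Sa ⟩
    weight p a                                ∎
    where open ≡-Reasoning

  σ-remove : ∀ S a → S a ≡ true → σ p S ≡ weight p a + σ p (λ x → S x ∧ not (eqPt x a))
  σ-remove S a Sa = trans (σ-disjoint-∪ S (λ x → eqPt x a) S∖a split disjoint)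
                          (cong (_+ σ p S∖a) (σ-singleton _ a (eqPt-refl a) (λ x → eqPt-≢)))
    where
    S∖a = λ x → S x ∧ not (eqPt x a)
    split : ∀ x → S x ≡ (eqPt x a ∨ S∖a x)
    split x with x ≟ₚ a
    ... | yes refl rewrite Sa = refl
    ... | no _ = sym (∧-identityʳ (S x))
    disjoint : ∀ x → (eqPt x a ∧ S∖a x) ≡ false
    disjoint x with eqPt x a
    ... | true  = ∧-zeroʳ (S x)
    ... | false = refl

  σ-pair : ∀ a b → a ≢ b → σ p (pair p a b) ≡ colourWeight (ncol p a) + colourWeight (ncol p b)
  σ-pair a b a≢b = trans (σ-disjoint-∪ _ (λ x → eqPt x a) (λ x → eqPt x b) (λ _ → refl) disjoint)
                         (cong₂ _+_ (trans (σ-singleton _ a (eqPt-refl a) (λ x → eqPt-≢)) (weight≡colourWeight p a))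
                                    (trans (σ-singleton _ b (eqPt-refl b) (λ x → eqPt-≢)) (weight≡colourWeight p b)))
    where
    disjoint : ∀ x → (eqPt x a ∧ eqPt x b) ≡ false
    disjoint x with x ≟ₚ a
    ... | yes refl rewrite eqPt-≢ a≢b = refl
    ... | no _ = refl

  σ-complement : ∀ S S′ → (∀ x → not (S x) ≡ S′ x) → σ p S ≡ Σp p - σ p S′
  σ-complement S S′ S′≗∁S = begin
    σ p S                        ≡⟨ lemma (σ p S) (σ p S′) ⟩
    (σ p S + σ p S′) - σ p S′    ≡⟨ cong (_- σ p S′) (σ-disjoint-∪ (λ _ → true) S S′ cover disjoint) ⟨
    Σp p - σ p S′                ∎
    where
    open ≡-Reasoning
    lemma : ∀ u v → u ≡ u + v - v
    lemma = solve-∀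
    cover : ∀ x → true ≡ (S x ∨ S′ x)
    cover x rewrite sym (S′≗∁S x) with S x
    ... | true  = refl
    ... | false = refl
    disjoint : ∀ x → (S x ∧ S′ x) ≡ false
    disjoint x rewrite sym (S′≗∁S x) with S x
    ... | true  = refl
    ... | false = refl

-- Upper points are coloured black so that every point is normalised white.
allWhite : ∀ {k l} → Part k l
allWhite = record { lowerCol = λ _ → white ; upperCol = λ _ → black ; label = λ _ → 0 }

weight-allWhite : ∀ {k l} (x : Pt k l) → weight allWhite x ≡ 1ℤ
weight-allWhite (inj₁ _) = refl
weight-allWhite (inj₂ _) = refl

card≡σ-allWhite : ∀ {k l} (p : Part k l) S → + card p S ≡ σ allWhite S
card≡σ-allWhite {k} {l} p S = begin
  + card p S                                       ≡⟨ count (allPts k l) ⟩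
  sumList (λ x → when (S x) 1ℤ) (allPts k l)        ≡⟨ sumList-allPts k l (λ x → when (S x) 1ℤ) ⟩
  sumPt k l (λ x → when (S x) 1ℤ)                   ≡⟨ sumPt-cong (λ x → cong (when (S x)) (weight-allWhite x)) ⟨
  sumPt k l (λ x → when (S x) (weight allWhite x))  ≡⟨ σ≡sumPt allWhite S ⟨
  σ allWhite S                                     ∎
  where
  open ≡-Reasoning
  count : ∀ xs → + foldr (λ x acc → if S x then suc acc else acc) 0 xs ≡ sumList (λ x → when (S x) 1ℤ) xs
  count [] = refl
  count (x ∷ xs) with S x
  ... | true  = cong (_+_ 1ℤ) (count xs)
  ... | false = trans (count xs) (sym (ℤP.+-identityˡ _))

pos<k+l : ∀ {k l} (x : Pt k l) → pos x <ₙ k +ₙ l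
pos<k+l {k} {l} (inj₁ i) = ℕP.<-≤-trans (FinP.toℕ<n i) (ℕP.m≤m+n k l)
pos<k+l {k} {l} (inj₂ j) = ℕP.+-monoʳ-< k (ℕP.∸-monoʳ-< {o = 0} (s≤s z≤n) (FinP.toℕ<n j))

pos-injective : ∀ {k l} (x y : Pt k l) → pos x ≡ pos y → x ≡ y
pos-injective {k} (inj₁ i) (inj₁ j) e = cong inj₁ (FinP.toℕ-injective e)
pos-injective {k} (inj₁ i) (inj₂ j) e = ⊥-elim (ℕP.<⇒≱ (FinP.toℕ<n i) (subst (k ≤ₙ_) (sym e) (ℕP.m≤m+n k _)))
pos-injective {k} (inj₂ i) (inj₁ j) e = ⊥-elim (ℕP.<⇒≱ (FinP.toℕ<n j) (subst (k ≤ₙ_) e (ℕP.m≤m+n k _)))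
pos-injective {k} {l} (inj₂ i) (inj₂ j) e =
  cong inj₂ (FinP.toℕ-injective (ℕP.suc-injective
    (ℕP.∸-cancelˡ-≡ (FinP.toℕ<n i) (FinP.toℕ<n j) (ℕP.+-cancelˡ-≡ k _ _ e))))

cyclicDistance : ℕ → ℕ → ℕ → ℕ
cyclicDistance N a c = if a ≤ᵇ c then c ∸ a else (c +ₙ N) ∸ a

cyclicDistance-≤ : ∀ N {a c} → a ≤ₙ c → cyclicDistance N a c +ₙ a ≡ c
cyclicDistance-≤ N a≤c rewrite ≤ᵇ-true a≤c = ℕP.m∸n+n≡m a≤c

cyclicDistance-> : ∀ N {a c} → c <ₙ a → a ≤ₙ N → cyclicDistance N a c +ₙ a ≡ c +ₙ N
cyclicDistance-> N {a} {c} c<a a≤N rewrite ≤ᵇ-false c<a = ℕP.m∸n+n≡m (ℕP.≤-trans a≤N (ℕP.m≤n+m N c))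

module CyclicIntervals (N a b c : ℕ) (a<N : a <ₙ N) (b<N : b <ₙ N) (c<N : c <ₙ N) where

  private
    x = cyclicDistance N a c
    y = cyclicDistance N a b

    x+a≡c : a ≤ₙ c → x +ₙ a ≡ c
    x+a≡c = cyclicDistance-≤ N

    x+a≡c+N : c <ₙ a → x +ₙ a ≡ c +ₙ N
    x+a≡c+N c<a = cyclicDistance-> N c<a (ℕP.<⇒≤ a<N)

    shift-< : ∀ {u v U V} → u +ₙ a ≡ U → v +ₙ a ≡ V → (u <ₙ v) → U <ₙ V
    shift-< refl refl = ℕP.+-monoˡ-< a
    shift-≤ : ∀ {u v U V} → u +ₙ a ≡ U → v +ₙ a ≡ V → (u ≤ₙ v) → U ≤ₙ V
    shift-≤ refl refl = ℕP.+-monoˡ-≤ a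
    unshift-< : ∀ {u v U V} → u +ₙ a ≡ U → v +ₙ a ≡ V → U <ₙ V → u <ₙ v
    unshift-< {u} {v} refl refl = ℕP.+-cancelʳ-< a u v
    unshift-≤ : ∀ {u v U V} → u +ₙ a ≡ U → v +ₙ a ≡ V → U ≤ₙ V → u ≤ₙ v
    unshift-≤ {u} {v} refl refl = ℕP.+-cancelʳ-≤ a u v

    x>0 : a <ₙ c → 0 <ₙ x
    x>0 a<c = unshift-< refl (x+a≡c (ℕP.<⇒≤ a<c)) a<c

    N≤c+N : ∀ c → N ≤ₙ c +ₙ N
    N≤c+N c = ℕP.m≤n+m N c

  open-< : a <ₙ b → ((0 <ᵇ x) ∧ (x <ᵇ y)) ≡ ((a <ᵇ c) ∧ (c <ᵇ b))
  open-< a<b = T-injective to from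
    where
    y+a≡b = cyclicDistance-≤ N (ℕP.<⇒≤ a<b)
    to : T ((0 <ᵇ x) ∧ (x <ᵇ y)) → T ((a <ᵇ c) ∧ (c <ᵇ b))
    to t with a ℕ.≤? c
    ... | yes a≤c = T-∧-intro (ℕP.<⇒<ᵇ (shift-< refl (x+a≡c a≤c) (ℕP.<ᵇ⇒< 0 x (T-∧-proj₁ t))))
                              (ℕP.<⇒<ᵇ (shift-< (x+a≡c a≤c) y+a≡b (ℕP.<ᵇ⇒< x y (T-∧-proj₂ t))))
    ... | no a≰c = ⊥-elim (ℕP.<⇒≱ b<N (ℕP.≤-trans (N≤c+N c)
                     (ℕP.<⇒≤ (shift-< (x+a≡c+N (ℕP.≰⇒> a≰c)) y+a≡b (ℕP.<ᵇ⇒< x y (T-∧-proj₂ t))))))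
    from : T ((a <ᵇ c) ∧ (c <ᵇ b)) → T ((0 <ᵇ x) ∧ (x <ᵇ y))
    from t = T-∧-intro (ℕP.<⇒<ᵇ (x>0 a<c)) (ℕP.<⇒<ᵇ (unshift-< (x+a≡c (ℕP.<⇒≤ a<c)) y+a≡b (ℕP.<ᵇ⇒< c b (T-∧-proj₂ t))))
      where a<c = ℕP.<ᵇ⇒< a c (T-∧-proj₁ t)

  half-< : a <ₙ b → ((0 <ᵇ x) ∧ (x ≤ᵇ y)) ≡ ((a <ᵇ c) ∧ (c ≤ᵇ b))
  half-< a<b = T-injective to from
    where
    y+a≡b = cyclicDistance-≤ N (ℕP.<⇒≤ a<b)
    to : T ((0 <ᵇ x) ∧ (x ≤ᵇ y)) → T ((a <ᵇ c) ∧ (c ≤ᵇ b))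
    to t with a ℕ.≤? c
    ... | yes a≤c = T-∧-intro (ℕP.<⇒<ᵇ (shift-< refl (x+a≡c a≤c) (ℕP.<ᵇ⇒< 0 x (T-∧-proj₁ t))))
                              (ℕP.≤⇒≤ᵇ (shift-≤ (x+a≡c a≤c) y+a≡b (ℕP.≤ᵇ⇒≤ x y (T-∧-proj₂ t))))
    ... | no a≰c = ⊥-elim (ℕP.<⇒≱ b<N (ℕP.≤-trans (N≤c+N c)
                     (shift-≤ (x+a≡c+N (ℕP.≰⇒> a≰c)) y+a≡b (ℕP.≤ᵇ⇒≤ x y (T-∧-proj₂ t)))))
    from : T ((a <ᵇ c) ∧ (c ≤ᵇ b)) → T ((0 <ᵇ x) ∧ (x ≤ᵇ y))
    from t = T-∧-intro (ℕP.<⇒<ᵇ (x>0 a<c)) (ℕP.≤⇒≤ᵇ (unshift-≤ (x+a≡c (ℕP.<⇒≤ a<c)) y+a≡b (ℕP.≤ᵇ⇒≤ c b (T-∧-proj₂ t))))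
      where a<c = ℕP.<ᵇ⇒< a c (T-∧-proj₁ t)

  open-> : b <ₙ a → ((0 <ᵇ x) ∧ (x <ᵇ y)) ≡ ((a <ᵇ c) ∨ (c <ᵇ b))
  open-> b<a = T-injective to from
    where
    y+a≡b+N = cyclicDistance-> N b<a (ℕP.<⇒≤ a<N)
    to : T ((0 <ᵇ x) ∧ (x <ᵇ y)) → T ((a <ᵇ c) ∨ (c <ᵇ b))
    to t with a ℕ.≤? c
    ... | yes a≤c = T-∨-inj₁ (ℕP.<⇒<ᵇ (shift-< refl (x+a≡c a≤c) (ℕP.<ᵇ⇒< 0 x (T-∧-proj₁ t))))
    ... | no a≰c = T-∨-inj₂ (ℕP.<⇒<ᵇ (ℕP.+-cancelʳ-< N c b
                     (shift-< (x+a≡c+N (ℕP.≰⇒> a≰c)) y+a≡b+N (ℕP.<ᵇ⇒< x y (T-∧-proj₂ t)))))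
    from : T ((a <ᵇ c) ∨ (c <ᵇ b)) → T ((0 <ᵇ x) ∧ (x <ᵇ y))
    from t with T-∨-elim t
    ... | inj₁ a<ᵇc = T-∧-intro (ℕP.<⇒<ᵇ (x>0 a<c))
                                (ℕP.<⇒<ᵇ (unshift-< (x+a≡c (ℕP.<⇒≤ a<c)) y+a≡b+N (ℕP.<-≤-trans c<N (N≤c+N b))))
      where a<c = ℕP.<ᵇ⇒< a c a<ᵇc
    ... | inj₂ c<ᵇb = T-∧-intro (ℕP.<⇒<ᵇ (unshift-< refl x+a≡c+N′ (ℕP.<-≤-trans a<N (N≤c+N c))))
                                (ℕP.<⇒<ᵇ (unshift-< x+a≡c+N′ y+a≡b+N (ℕP.+-monoˡ-< N c<b)))
      where
      c<b = ℕP.<ᵇ⇒< c b c<ᵇb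
      x+a≡c+N′ = x+a≡c+N (ℕP.<-trans c<b b<a)

  half-> : b <ₙ a → ((0 <ᵇ x) ∧ (x ≤ᵇ y)) ≡ ((a <ᵇ c) ∨ (c ≤ᵇ b))
  half-> b<a = T-injective to from
    where
    y+a≡b+N = cyclicDistance-> N b<a (ℕP.<⇒≤ a<N)
    to : T ((0 <ᵇ x) ∧ (x ≤ᵇ y)) → T ((a <ᵇ c) ∨ (c ≤ᵇ b))
    to t with a ℕ.≤? c
    ... | yes a≤c = T-∨-inj₁ (ℕP.<⇒<ᵇ (shift-< refl (x+a≡c a≤c) (ℕP.<ᵇ⇒< 0 x (T-∧-proj₁ t))))
    ... | no a≰c = T-∨-inj₂ (ℕP.≤⇒≤ᵇ (ℕP.+-cancelʳ-≤ N c b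
                     (shift-≤ (x+a≡c+N (ℕP.≰⇒> a≰c)) y+a≡b+N (ℕP.≤ᵇ⇒≤ x y (T-∧-proj₂ t)))))
    from : T ((a <ᵇ c) ∨ (c ≤ᵇ b)) → T ((0 <ᵇ x) ∧ (x ≤ᵇ y))
    from t with T-∨-elim t
    ... | inj₁ a<ᵇc = T-∧-intro (ℕP.<⇒<ᵇ (x>0 a<c))
                                (ℕP.≤⇒≤ᵇ (unshift-≤ (x+a≡c (ℕP.<⇒≤ a<c)) y+a≡b+N (ℕP.≤-trans (ℕP.<⇒≤ c<N) (N≤c+N b))))
      where a<c = ℕP.<ᵇ⇒< a c a<ᵇc
    ... | inj₂ c≤ᵇb = T-∧-intro (ℕP.<⇒<ᵇ (unshift-< refl x+a≡c+N′ (ℕP.<-≤-trans a<N (N≤c+N c))))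
                                (ℕP.≤⇒≤ᵇ (unshift-≤ x+a≡c+N′ y+a≡b+N (ℕP.+-monoˡ-≤ N c≤b)))
      where
      c≤b = ℕP.≤ᵇ⇒≤ c b c≤ᵇb
      x+a≡c+N′ = x+a≡c+N (ℕP.≤-<-trans c≤b b<a)

whiteIndicator : Color → ℤ
whiteIndicator white = 1ℤ
whiteIndicator black = 0ℤ

module _ {k l : ℕ} (p : Part k l) where

  prefix : ℕ → ℤ
  prefix t = σ p (λ γ → pos γ ≤ᵇ t)

  prefix< : ℕ → ℤ
  prefix< t = σ p (λ γ → pos γ <ᵇ t)

  -- Subtracting whiteIndicator reconciles the two cases of δ, which sums over
  -- ]α,β] for equal and over ]α,β[ for different normalised colours.
  height : Pt k l → ℤ
  height x = prefix (pos x) - whiteIndicator (ncol p x)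

  winding : Pt k l → Pt k l → ℤ
  winding α β = if pos β <ᵇ pos α then Σp p else 0ℤ

  prefix≡prefix<+weight : ∀ a → prefix (pos a) ≡ prefix< (pos a) + weight p a
  prefix≡prefix<+weight a =
    trans (σ-disjoint-∪ p _ (λ γ → pos γ <ᵇ pos a) (λ γ → pos γ ≡ᵇ pos a) split disjoint)
          (cong (_+_ (prefix< (pos a)))
                (σ-singleton p _ a (≡ᵇ-refl (pos a)) (λ x x≢a → ≡ᵇ-false (x≢a ∘ pos-injective x a))))
    where
    split : ∀ γ → (pos γ ≤ᵇ pos a) ≡ ((pos γ <ᵇ pos a) ∨ (pos γ ≡ᵇ pos a))
    split γ with ℕ.<-cmp (pos γ) (pos a)
    ... | tri< γ<a _ _ rewrite ≤ᵇ-true (ℕP.<⇒≤ γ<a) | <ᵇ-true γ<a = refl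
    ... | tri≈ _ γ≡a _ rewrite γ≡a | ≤ᵇ-true (ℕP.≤-refl {pos a}) | <ᵇ-false (ℕP.≤-refl {pos a}) | ≡ᵇ-refl (pos a) = refl
    ... | tri> _ _ γ>a rewrite ≤ᵇ-false γ>a | <ᵇ-false (ℕP.<⇒≤ γ>a) | ≡ᵇ-false (ℕP.>⇒≢ γ>a) = refl
    disjoint : ∀ γ → ((pos γ <ᵇ pos a) ∧ (pos γ ≡ᵇ pos a)) ≡ false
    disjoint γ with ℕ.<-cmp (pos γ) (pos a)
    ... | tri< γ<a _ _ rewrite <ᵇ-true γ<a | ≡ᵇ-false (ℕP.<⇒≢ γ<a) = refl
    ... | tri≈ _ γ≡a _ rewrite γ≡a | <ᵇ-false (ℕP.≤-refl {pos a}) = refl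
    ... | tri> _ _ γ>a rewrite <ᵇ-false (ℕP.<⇒≤ γ>a) = refl

  σ-]a,b] : ∀ a b → a ≤ₙ b → σ p (λ γ → (a <ᵇ pos γ) ∧ (pos γ ≤ᵇ b)) ≡ prefix b - prefix a
  σ-]a,b] a b a≤b = x≡y+z⇒z≡x-y (σ-disjoint-∪ p _ (λ γ → pos γ ≤ᵇ a) _ split disjoint)
    where
    split : ∀ γ → (pos γ ≤ᵇ b) ≡ ((pos γ ≤ᵇ a) ∨ ((a <ᵇ pos γ) ∧ (pos γ ≤ᵇ b)))
    split γ with pos γ ℕ.≤? a
    ... | yes γ≤a rewrite ≤ᵇ-true γ≤a | ≤ᵇ-true (ℕP.≤-trans γ≤a a≤b) = refl
    ... | no γ≰a rewrite ≤ᵇ-false (ℕP.≰⇒> γ≰a) | <ᵇ-true (ℕP.≰⇒> γ≰a) = refl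
    disjoint : ∀ γ → ((pos γ ≤ᵇ a) ∧ ((a <ᵇ pos γ) ∧ (pos γ ≤ᵇ b))) ≡ false
    disjoint γ with pos γ ℕ.≤? a
    ... | yes γ≤a rewrite ≤ᵇ-true γ≤a | <ᵇ-false γ≤a = refl
    ... | no γ≰a rewrite ≤ᵇ-false (ℕP.≰⇒> γ≰a) = refl

  σ-]a,b[ : ∀ a b → a <ₙ b → σ p (λ γ → (a <ᵇ pos γ) ∧ (pos γ <ᵇ b)) ≡ prefix< b - prefix a
  σ-]a,b[ a b a<b = x≡y+z⇒z≡x-y (σ-disjoint-∪ p _ (λ γ → pos γ ≤ᵇ a) _ split disjoint)
    where
    split : ∀ γ → (pos γ <ᵇ b) ≡ ((pos γ ≤ᵇ a) ∨ ((a <ᵇ pos γ) ∧ (pos γ <ᵇ b)))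
    split γ with pos γ ℕ.≤? a
    ... | yes γ≤a rewrite ≤ᵇ-true γ≤a | <ᵇ-true (ℕP.≤-<-trans γ≤a a<b) = refl
    ... | no γ≰a rewrite ≤ᵇ-false (ℕP.≰⇒> γ≰a) | <ᵇ-true (ℕP.≰⇒> γ≰a) = refl
    disjoint : ∀ γ → ((pos γ ≤ᵇ a) ∧ ((a <ᵇ pos γ) ∧ (pos γ <ᵇ b))) ≡ false
    disjoint γ with pos γ ℕ.≤? a
    ... | yes γ≤a rewrite ≤ᵇ-true γ≤a | <ᵇ-false γ≤a = refl
    ... | no γ≰a rewrite ≤ᵇ-false (ℕP.≰⇒> γ≰a) = refl

  σ-[b,a] : ∀ a b → b <ₙ a → σ p (λ γ → (b ≤ᵇ pos γ) ∧ (pos γ ≤ᵇ a)) ≡ prefix a - prefix< b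
  σ-[b,a] a b b<a = x≡y+z⇒z≡x-y (σ-disjoint-∪ p _ (λ γ → pos γ <ᵇ b) _ split disjoint)
    where
    split : ∀ γ → (pos γ ≤ᵇ a) ≡ ((pos γ <ᵇ b) ∨ ((b ≤ᵇ pos γ) ∧ (pos γ ≤ᵇ a)))
    split γ with pos γ ℕ.<? b
    ... | yes γ<b rewrite <ᵇ-true γ<b | ≤ᵇ-true (ℕP.<⇒≤ (ℕP.<-trans γ<b b<a)) = refl
    ... | no γ≮b rewrite <ᵇ-false (ℕP.≮⇒≥ γ≮b) | ≤ᵇ-true (ℕP.≮⇒≥ γ≮b) = refl
    disjoint : ∀ γ → ((pos γ <ᵇ b) ∧ ((b ≤ᵇ pos γ) ∧ (pos γ ≤ᵇ a))) ≡ false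
    disjoint γ with pos γ ℕ.<? b
    ... | yes γ<b rewrite <ᵇ-true γ<b | ≤ᵇ-false γ<b = refl
    ... | no γ≮b rewrite <ᵇ-false (ℕP.≮⇒≥ γ≮b) = refl

  σ-]a,b]-wrapped : ∀ a b → b <ₙ a → σ p (λ γ → (a <ᵇ pos γ) ∨ (pos γ ≤ᵇ b)) ≡ Σp p - (prefix a - prefix b)
  σ-]a,b]-wrapped a b b<a = trans (σ-complement p _ _ complement) (cong (_-_ (Σp p)) (σ-]a,b] b a (ℕP.<⇒≤ b<a)))
    where
    complement : ∀ γ → not ((a <ᵇ pos γ) ∨ (pos γ ≤ᵇ b)) ≡ ((b <ᵇ pos γ) ∧ (pos γ ≤ᵇ a))
    complement γ with pos γ ℕ.≤? b | pos γ ℕ.≤? a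
    ... | yes γ≤b | _ rewrite ≤ᵇ-true γ≤b | <ᵇ-false γ≤b | <ᵇ-false (ℕP.≤-trans γ≤b (ℕP.<⇒≤ b<a)) = refl
    ... | no γ≰b | yes γ≤a rewrite ≤ᵇ-false (ℕP.≰⇒> γ≰b) | <ᵇ-true (ℕP.≰⇒> γ≰b) | ≤ᵇ-true γ≤a | <ᵇ-false γ≤a = refl
    ... | no γ≰b | no γ≰a rewrite ≤ᵇ-false (ℕP.≰⇒> γ≰b) | <ᵇ-true (ℕP.≰⇒> γ≰b) | ≤ᵇ-false (ℕP.≰⇒> γ≰a) | <ᵇ-true (ℕP.≰⇒> γ≰a) = refl

  σ-]a,b[-wrapped : ∀ a b → b <ₙ a → σ p (λ γ → (a <ᵇ pos γ) ∨ (pos γ <ᵇ b)) ≡ Σp p - (prefix a - prefix< b)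
  σ-]a,b[-wrapped a b b<a = trans (σ-complement p _ _ complement) (cong (_-_ (Σp p)) (σ-[b,a] a b b<a))
    where
    complement : ∀ γ → not ((a <ᵇ pos γ) ∨ (pos γ <ᵇ b)) ≡ ((b ≤ᵇ pos γ) ∧ (pos γ ≤ᵇ a))
    complement γ with pos γ ℕ.<? b | pos γ ℕ.≤? a
    ... | yes γ<b | _ rewrite <ᵇ-true γ<b | ≤ᵇ-false γ<b | <ᵇ-false (ℕP.<⇒≤ (ℕP.<-trans γ<b b<a)) = refl
    ... | no γ≮b | yes γ≤a rewrite <ᵇ-false (ℕP.≮⇒≥ γ≮b) | ≤ᵇ-true (ℕP.≮⇒≥ γ≮b) | ≤ᵇ-true γ≤a | <ᵇ-false γ≤a = refl
    ... | no γ≮b | no γ≰a rewrite <ᵇ-false (ℕP.≮⇒≥ γ≮b) | ≤ᵇ-true (ℕP.≮⇒≥ γ≮b) | ≤ᵇ-false (ℕP.≰⇒> γ≰a) | <ᵇ-true (ℕP.≰⇒> γ≰a) = refl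

  private
    wrap-lemma : ∀ s x y → s - (x - y) ≡ y - x + s
    wrap-lemma = solve-∀

  σ-inHalf : ∀ α β → α ≢ β → σ p (inHalf α β) ≡ prefix (pos β) - prefix (pos α) + winding α β
  σ-inHalf α β α≢β with ℕ.<-cmp (pos α) (pos β)
  ... | tri< α<β _ _ rewrite <ᵇ-false (ℕP.<⇒≤ α<β) =
    trans (σ-cong p (λ γ → CyclicIntervals.half-< _ _ _ (pos γ) (pos<k+l α) (pos<k+l β) (pos<k+l γ) α<β))
          (trans (σ-]a,b] (pos α) (pos β) (ℕP.<⇒≤ α<β)) (sym (ℤP.+-identityʳ _)))
  ... | tri≈ _ α≡β _ = ⊥-elim (α≢β (pos-injective α β α≡β))
  ... | tri> _ _ α>β rewrite <ᵇ-true α>β =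
    trans (σ-cong p (λ γ → CyclicIntervals.half-> _ _ _ (pos γ) (pos<k+l α) (pos<k+l β) (pos<k+l γ) α>β))
          (trans (σ-]a,b]-wrapped (pos α) (pos β) α>β) (wrap-lemma (Σp p) (prefix (pos α)) (prefix (pos β))))

  σ-inOpen : ∀ α β → α ≢ β → σ p (inOpen α β) ≡ prefix< (pos β) - prefix (pos α) + winding α β
  σ-inOpen α β α≢β with ℕ.<-cmp (pos α) (pos β)
  ... | tri< α<β _ _ rewrite <ᵇ-false (ℕP.<⇒≤ α<β) =
    trans (σ-cong p (λ γ → CyclicIntervals.open-< _ _ _ (pos γ) (pos<k+l α) (pos<k+l β) (pos<k+l γ) α<β))
          (trans (σ-]a,b[ (pos α) (pos β) α<β) (sym (ℤP.+-identityʳ _)))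
  ... | tri≈ _ α≡β _ = ⊥-elim (α≢β (pos-injective α β α≡β))
  ... | tri> _ _ α>β rewrite <ᵇ-true α>β =
    trans (σ-cong p (λ γ → CyclicIntervals.open-> _ _ _ (pos γ) (pos<k+l α) (pos<k+l β) (pos<k+l γ) α>β))
          (trans (σ-]a,b[-wrapped (pos α) (pos β) α>β) (wrap-lemma (Σp p) (prefix (pos α)) (prefix< (pos β))))

private
  colour-cases : ∀ (ca cb : Color) (X Y Ca Cb Cb< W : ℤ) →
                 X ≡ Cb - Ca + W → Y ≡ Cb< - Ca + W → Cb ≡ Cb< + colourWeight cb →
                 (if eqCol ca cb then X else Y) ≡ (Cb - whiteIndicator cb) - (Ca - whiteIndicator ca) + W
  colour-cases white white _ _ Ca Cb _ W refl _ _ = lemma Ca Cb W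
    where
    lemma : ∀ a b w → b - a + w ≡ (b - 1ℤ) - (a - 1ℤ) + w
    lemma = solve-∀
  colour-cases black black _ _ Ca Cb _ W refl _ _ = lemma Ca Cb W
    where
    lemma : ∀ a b w → b - a + w ≡ (b - 0ℤ) - (a - 0ℤ) + w
    lemma = solve-∀
  colour-cases white black _ _ Ca _ Cb< W _ refl refl = lemma Ca Cb< W
    where
    lemma : ∀ a b w → b - a + w ≡ (b + -1ℤ - 0ℤ) - (a - 1ℤ) + w
    lemma = solve-∀
  colour-cases black white _ _ Ca _ Cb< W _ refl refl = lemma Ca Cb< W
    where
    lemma : ∀ a b w → b - a + w ≡ (b + 1ℤ - 1ℤ) - (a - 0ℤ) + w
    lemma = solve-∀

δ≡height-difference : ∀ {k l} (p : Part k l) α β → α ≢ β →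
                      δ p α β ≡ height p β - height p α + winding p α β
δ≡height-difference p α β α≢β rewrite eqPt-≢ α≢β =
  colour-cases (ncol p α) (ncol p β) _ _ (prefix p (pos α)) (prefix p (pos β)) (prefix< p (pos β)) (winding p α β)
    (σ-inHalf p α β α≢β) (σ-inOpen p α β α≢β)
    (trans (prefix≡prefix<+weight p β) (cong (_+_ (prefix< p (pos β))) (weight≡colourWeight p β)))

mult-winding : ∀ {k l} (p : Part k l) d → mult d (Σp p) → ∀ α β → mult d (winding p α β)
mult-winding p d d∣Σ α β with pos β <ᵇ pos α
... | true  = d∣Σ
... | false = Multiples.mult-0 d

cdist-refl : ∀ {k l} (x : Pt k l) → cdist x x ≡ 0
cdist-refl x rewrite ≤ᵇ-true (ℕP.≤-refl {pos x}) = ℕP.n∸n≡0 (pos x)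

inOpen⇒< : ∀ {k l} (x y γ : Pt k l) → T (inOpen x y γ) → 0 <ₙ cdist x γ × cdist x γ <ₙ cdist x y
inOpen⇒< x y γ t = ℕP.<ᵇ⇒< 0 _ (T-∧-proj₁ {0 <ᵇ cdist x γ} t) , ℕP.<ᵇ⇒< _ _ (T-∧-proj₂ {0 <ᵇ cdist x γ} t)

inOpen⇒≢left : ∀ {k l} (x y γ : Pt k l) → T (inOpen x y γ) → γ ≢ x
inOpen⇒≢left x y γ t refl = ℕP.<-irrefl (sym (cdist-refl x)) (proj₁ (inOpen⇒< x y γ t))

inOpen⇒≢right : ∀ {k l} (x y γ : Pt k l) → T (inOpen x y γ) → γ ≢ y
inOpen⇒≢right x y γ t refl = ℕP.<-irrefl refl (proj₂ (inOpen⇒< x y γ t))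

private
  ≡+0 : ∀ {u v} → u ≡ v → u ≡ v +ₙ 0
  ≡+0 {v = v} e = trans e (sym (ℕP.+-identityʳ v))

  shrinks : ∀ {x y z a c Z v} → 0 <ₙ x → z +ₙ c ≡ Z → x +ₙ a ≡ c +ₙ v → y +ₙ a ≡ Z +ₙ v → z <ₙ y
  shrinks {x} {y} {z} {a} {c} {Z} {v} x>0 e₁ e₂ e₃ =
    subst (z <ₙ_) z+x≡y (subst (_<ₙ z +ₙ x) (ℕP.+-identityʳ z) (ℕP.+-monoʳ-< z x>0))
    where
    open ≡-Reasoning
    z+x≡y : z +ₙ x ≡ y
    z+x≡y = ℕP.+-cancelʳ-≡ a _ _ (begin
      z +ₙ x +ₙ a   ≡⟨ ℕP.+-assoc z x a ⟩
      z +ₙ (x +ₙ a) ≡⟨ cong (z +ₙ_) e₂ ⟩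
      z +ₙ (c +ₙ v) ≡⟨ ℕP.+-assoc z c v ⟨
      z +ₙ c +ₙ v   ≡⟨ cong (_+ₙ v) e₁ ⟩
      Z +ₙ v        ≡⟨ e₃ ⟨
      y +ₙ a        ∎)

cyclicDistance-shrinks : ∀ N a b c → a <ₙ N → b <ₙ N → c <ₙ N →
                         0 <ₙ cyclicDistance N a c → cyclicDistance N a c <ₙ cyclicDistance N a b →
                         cyclicDistance N c b <ₙ cyclicDistance N a b
cyclicDistance-shrinks N a b c a<N b<N c<N x>0 x<y with a ℕ.≤? c | c ℕ.≤? b | a ℕ.≤? b
... | yes a≤c | yes c≤b | _ =
  shrinks x>0 (cyclicDistance-≤ N c≤b) (≡+0 (cyclicDistance-≤ N a≤c)) (≡+0 (cyclicDistance-≤ N (ℕP.≤-trans a≤c c≤b)))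
... | yes a≤c | no c≰b | yes a≤b =
  ⊥-elim (ℕP.<⇒≱ (ℕP.≰⇒> c≰b) (ℕP.<⇒≤ (subst₂ _<ₙ_ (cyclicDistance-≤ N a≤c) (cyclicDistance-≤ N a≤b) (ℕP.+-monoˡ-< a x<y))))
... | yes a≤c | no c≰b | no a≰b =
  shrinks x>0 (cyclicDistance-> N (ℕP.≰⇒> c≰b) (ℕP.<⇒≤ c<N)) (≡+0 (cyclicDistance-≤ N a≤c)) (≡+0 (cyclicDistance-> N (ℕP.≰⇒> a≰b) (ℕP.<⇒≤ a<N)))
... | no a≰c | yes c≤b | yes a≤b =
  ⊥-elim (ℕP.<⇒≱ b<N (ℕP.≤-trans (ℕP.m≤n+m N c) (ℕP.<⇒≤
    (subst₂ _<ₙ_ (cyclicDistance-> N (ℕP.≰⇒> a≰c) (ℕP.<⇒≤ a<N)) (cyclicDistance-≤ N a≤b) (ℕP.+-monoˡ-< a x<y)))))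
... | no a≰c | yes c≤b | no a≰b =
  shrinks x>0 (cyclicDistance-≤ N c≤b) (cyclicDistance-> N (ℕP.≰⇒> a≰c) (ℕP.<⇒≤ a<N)) (cyclicDistance-> N (ℕP.≰⇒> a≰b) (ℕP.<⇒≤ a<N))
... | no a≰c | no c≰b | yes a≤b =
  ⊥-elim (ℕP.<-irrefl refl (ℕP.<-trans (ℕP.≰⇒> c≰b) (ℕP.<-≤-trans (ℕP.≰⇒> a≰c) a≤b)))
... | no a≰c | no c≰b | no a≰b =
  ⊥-elim (ℕP.<⇒≱ (ℕP.≰⇒> c≰b) (ℕP.+-cancelʳ-≤ N c b (ℕP.<⇒≤
    (subst₂ _<ₙ_ (cyclicDistance-> N (ℕP.≰⇒> a≰c) (ℕP.<⇒≤ a<N)) (cyclicDistance-> N (ℕP.≰⇒> a≰b) (ℕP.<⇒≤ a<N)) (ℕP.+-monoˡ-< a x<y)))))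

block-refl : ∀ {k l} (p : Part k l) x → block p x x ≡ true
block-refl p x = ≡ᵇ-refl (label p x)

block-≡ : ∀ {k l} (p : Part k l) {x y} → label p x ≡ label p y → block p x y ≡ true
block-≡ p {y = y} e rewrite e = ≡ᵇ-refl (label p y)

card-remove : ∀ {k l} (p : Part k l) S a → S a ≡ true → + card p S ≡ 1ℤ + + card p (λ x → S x ∧ not (eqPt x a))
card-remove p S a Sa = begin
  + card p S                                        ≡⟨ card≡σ-allWhite p S ⟩
  σ allWhite S                                      ≡⟨ σ-remove allWhite S a Sa ⟩
  weight allWhite a + σ allWhite S∖a                ≡⟨ cong₂ _+_ (weight-allWhite a) (sym (card≡σ-allWhite p S∖a)) ⟩
  1ℤ + + card p S∖a                                 ∎
  where
  open ≡-Reasoning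
  S∖a = λ x → S x ∧ not (eqPt x a)

card-nonempty : ∀ {k l} (p : Part k l) S a → S a ≡ true → 1 ≤ₙ card p S
card-nonempty p S a Sa with card p S | card-remove p S a Sa
... | suc _ | _ = s≤s z≤n

module _ {k l : ℕ} (p : Part k l) (d : ℕ) (f : Pt k l → ℤ) where
  open Multiples d

  Consecutive : Pt k l → Pt k l → Set
  Consecutive a b = a ≢ b × label p a ≡ label p b × (∀ γ → label p γ ≡ label p a → ¬ T (inOpen a b γ))

  block-congruence : (∀ a b → Consecutive a b → mult d (f b - f a)) →
                     ∀ x y → label p x ≡ label p y → mult d (f y - f x)
  block-congruence step x y = go (suc (cdist x y)) x y (ℕP.n<1+n _)
    where
    go : ∀ n x y → cdist x y <ₙ n → label p x ≡ label p y → mult d (f y - f x)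
    go (suc n) x y <n x~y with x ≟ₚ y | search (λ γ → (label p γ ≡ᵇ label p x) ∧ inOpen x y γ)
    ... | yes refl | _ = mult-resp (sym (ℤP.+-inverseʳ (f x))) mult-0
    ... | no x≢y | inj₂ none = step x y (x≢y , x~y , λ γ γ~x γ∈ → none γ (T-∧-intro (ℕP.≡⇒≡ᵇ _ _ γ~x) γ∈))
    ... | no x≢y | inj₁ (γ , t) = mult-resp (telescope (f x) (f γ) (f y)) (mult-+ (go n γ y γy<n (trans γ~x x~y)) (go n x γ xγ<n (sym γ~x)))
      where
      γ~x = ℕP.≡ᵇ⇒≡ _ _ (T-∧-proj₁ {label p γ ≡ᵇ label p x} t)
      γ∈ = inOpen⇒< x y γ (T-∧-proj₂ {label p γ ≡ᵇ label p x} t)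
      xγ<xy = proj₂ γ∈
      xγ<n = ℕP.<-≤-trans xγ<xy (ℕP.≤-pred <n)
      γy<n = ℕP.<-≤-trans (cyclicDistance-shrinks (k +ₙ l) (pos x) (pos y) (pos γ) (pos<k+l x) (pos<k+l y) (pos<k+l γ)
                             (proj₁ γ∈) xγ<xy) (ℕP.≤-pred <n)
      telescope : ∀ a b c → c - b + (b - a) ≡ c - a
      telescope = solve-∀

record Balanced (m : ℕ) {k l : ℕ} (p : Part k l) : Set where
  field
    Σ-mult      : mult m (Σp p)
    height-mult : ∀ x y → label p x ≡ label p y → mult m (height p y - height p x)

module _ (m : ℕ) {k l : ℕ} (p : Part k l) where
  open Multiples m

  private
    δ-mult⇔height-mult : mult m (Σp p) → ∀ α β → α ≢ β → mult m (δ p α β) ⇔ mult m (height p β - height p α)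
    δ-mult⇔height-mult m∣Σ α β α≢β = mk⇔
      (λ m∣δ → mult-resp (lemma _ _) (mult-- (mult-resp δ≡ m∣δ) (mult-winding p m m∣Σ α β)))
      (λ m∣h → mult-resp (sym δ≡) (mult-+ m∣h (mult-winding p m m∣Σ α β)))
      where
      δ≡ = δ≡height-difference p α β α≢β
      lemma : ∀ u w → u + w - w ≡ u
      lemma = solve-∀

  Balanced⇒R : Balanced m p → R (Qa m) p
  Balanced⇒R bal = record
    { zF = λ x → card-nonempty p (block p x) x (block-refl p x)
    ; zV = λ _ → tt
    ; zΣ = Σ-mult
    ; zL = λ a₁ a₂ a₁≢a₂ a₁~a₂ _ _ → Equivalence.from (δ-mult⇔height-mult Σ-mult a₁ a₂ a₁≢a₂) (height-mult a₁ a₂ a₁~a₂)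
    ; zK = λ a₁ a₂ a₁≢a₂ a₁~a₂ _ _ → Equivalence.from (δ-mult⇔height-mult Σ-mult a₁ a₂ a₁≢a₂) (height-mult a₁ a₂ a₁~a₂)
    ; zX = λ _ _ _ → tt
    }
    where open Balanced bal

  R⇒Balanced : R (Qa m) p → Balanced m p
  R⇒Balanced r = record
    { Σ-mult = zΣ
    ; height-mult = block-congruence p m (height p) consecutive
    }
    where
    open Z≤ r
    consecutive : ∀ a b → Consecutive p m (height p) a b → mult m (height p b - height p a)
    consecutive a b (a≢b , a~b , gap) with σ p (pair p a b) ℤ.≟ 0ℤ
    ... | yes σ≡0 = Equivalence.to (δ-mult⇔height-mult zΣ a b a≢b) (zK a b a≢b a~b gap σ≡0)
    ... | no σ≢0 = Equivalence.to (δ-mult⇔height-mult zΣ a b a≢b) (zL a b a≢b a~b gap σ≢0)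

invert-involutive : ∀ c → invert (invert c) ≡ c
invert-involutive white = refl
invert-involutive black = refl

colourWeight-invert : ∀ c → colourWeight (invert c) ≡ - colourWeight c
colourWeight-invert white = refl
colourWeight-invert black = refl

eqCol-invert : ∀ a b → eqCol (invert a) (invert b) ≡ eqCol a b
eqCol-invert white white = refl
eqCol-invert white black = refl
eqCol-invert black white = refl
eqCol-invert black black = refl

pos-swap : ∀ {k l} (x : Pt k l) → pos (swap x) +ₙ suc (pos x) ≡ l +ₙ k
pos-swap {k} {l} (inj₁ i) = trans (ℕP.+-assoc l (k ∸ suc (toℕ i)) (suc (toℕ i))) (cong (l +ₙ_) (ℕP.m∸n+n≡m (FinP.toℕ<n i)))
pos-swap {k} {l} (inj₂ j) = trans (lemma (toℕ j) k (l ∸ suc (toℕ j))) (cong (_+ₙ k) (ℕP.m∸n+n≡m (FinP.toℕ<n j)))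
  where
  lemma : ∀ a b c → a +ₙ suc (b +ₙ c) ≡ c +ₙ suc a +ₙ b
  lemma = ℕSolver.solve-∀

pos-swap′ : ∀ {k l} (x : Pt k l) → pos x +ₙ suc (pos (swap x)) ≡ k +ₙ l
pos-swap′ x = subst (λ z → pos z +ₙ suc (pos (swap x)) ≡ _) (swap-involutive x) (pos-swap (swap x))

module Involution {k l : ℕ} (p : Part k l) (q : Part l k) (inv : IsInvolution p q) where

  ncol-q : ∀ x → ncol q x ≡ invert (ncol p (swap x))
  ncol-q (inj₁ i) = trans (proj₁ inv i) (sym (invert-involutive _))
  ncol-q (inj₂ j) = cong invert (proj₁ (proj₂ inv) j)

  label-q : ∀ x y → label q x ≡ label q y → label p (swap x) ≡ label p (swap y)
  label-q x y = Equivalence.to (proj₂ (proj₂ inv) x y)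

  weight-q : ∀ x → weight q x ≡ - weight p (swap x)
  weight-q x = begin
    weight q x                          ≡⟨ weight≡colourWeight q x ⟩
    colourWeight (ncol q x)             ≡⟨ cong colourWeight (ncol-q x) ⟩
    colourWeight (invert (ncol p (swap x))) ≡⟨ colourWeight-invert _ ⟩
    - colourWeight (ncol p (swap x))    ≡⟨ cong -_ (weight≡colourWeight p (swap x)) ⟨
    - weight p (swap x)                 ∎
    where open ≡-Reasoning

  σ-q : ∀ S → σ q S ≡ - σ p (S ∘ swap)
  σ-q S = begin
    σ q S                                                     ≡⟨ σ≡sumPt q S ⟩
    sumPt l k (λ x → when (S x) (weight q x))                 ≡⟨ sumPt-cong (λ x → cong (when (S x)) (weight-q x)) ⟩
    sumPt l k (λ x → when (S x) (- weight p (swap x)))        ≡⟨ sumPt-cong (λ x → when-neg (S x) (weight p (swap x))) ⟩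
    sumPt l k (λ x → - when (S x) (weight p (swap x)))        ≡⟨ sumPt-neg (λ x → when (S x) (weight p (swap x))) ⟩
    - sumPt l k (λ x → when (S x) (weight p (swap x)))
      ≡⟨ cong -_ (ℤP.+-comm (sum (λ j → when (S (inj₁ j)) (weight p (inj₂ j)))) (sum (λ i → when (S (inj₂ i)) (weight p (inj₁ i))))) ⟩
    - sumPt k l (λ y → when (S (swap y)) (weight p y))        ≡⟨ cong -_ (σ≡sumPt p (S ∘ swap)) ⟨
    - σ p (S ∘ swap)                                          ∎
    where open ≡-Reasoning

  Σp-q : Σp q ≡ - Σp p
  Σp-q = σ-q (λ _ → true)

  -- Reading the cycle of q backwards turns the prefix up to x into the
  -- complement of the strict prefix up to swap x in p.
  prefix-q : ∀ x → prefix q (pos x) ≡ - (Σp p - (prefix p (pos (swap x)) - weight p (swap x)))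
  prefix-q x = begin
    prefix q (pos x)                                        ≡⟨ σ-q (λ γ → pos γ ≤ᵇ pos x) ⟩
    - σ p (λ y → pos (swap y) ≤ᵇ pos x)                     ≡⟨ cong -_ (σ-cong p reverse) ⟩
    - σ p (λ y → pos (swap x) ≤ᵇ pos y)                     ≡⟨ cong -_ (σ-complement p _ (λ y → pos y <ᵇ pos (swap x)) not-≤) ⟩
    - (Σp p - prefix< p (pos (swap x)))                     ≡⟨ cong (λ u → - (Σp p - u)) (x≡y+z⇒y≡x-z (prefix≡prefix<+weight p (swap x))) ⟩
    - (Σp p - (prefix p (pos (swap x)) - weight p (swap x))) ∎
    where
    open ≡-Reasoning
    reverse : ∀ y → (pos (swap y) ≤ᵇ pos x) ≡ (pos (swap x) ≤ᵇ pos y)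
    reverse y = T-injective (λ t → ℕP.≤⇒≤ᵇ (flip (pos-swap y) (pos-swap′ x) (ℕP.≤ᵇ⇒≤ _ _ t)))
                    (λ t → ℕP.≤⇒≤ᵇ (flip (pos-swap x) (pos-swap′ y) (ℕP.≤ᵇ⇒≤ _ _ t)))
      where
      flip : ∀ {A a B b N} → A +ₙ suc a ≡ N → B +ₙ suc b ≡ N → A ≤ₙ B → b ≤ₙ a
      flip {A} {a} {B} {b} e₁ e₂ A≤B = ℕP.≤-pred (ℕP.+-cancelˡ-≤ B (suc b) (suc a)
        (subst (_≤ₙ B +ₙ suc a) (trans e₁ (sym e₂)) (ℕP.+-monoˡ-≤ (suc a) A≤B)))
    not-≤ : ∀ y → not (pos (swap x) ≤ᵇ pos y) ≡ (pos y <ᵇ pos (swap x))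
    not-≤ y with pos y ℕ.<? pos (swap x)
    ... | yes y<x rewrite ≤ᵇ-false y<x | <ᵇ-true y<x = refl
    ... | no y≮x rewrite ≤ᵇ-true (ℕP.≮⇒≥ y≮x) | <ᵇ-false (ℕP.≮⇒≥ y≮x) = refl

  height-q : ∀ x → height q x ≡ height p (swap x) - Σp p
  height-q x = begin
    prefix q (pos x) - whiteIndicator (ncol q x)
      ≡⟨ cong₂ _-_ (prefix-q x) (cong whiteIndicator (ncol-q x)) ⟩
    - (Σp p - (prefix p (pos (swap x)) - weight p (swap x))) - whiteIndicator (invert (ncol p (swap x)))
      ≡⟨ cong (λ u → - (Σp p - (prefix p (pos (swap x)) - u)) - whiteIndicator (invert (ncol p (swap x)))) (weight≡colourWeight p (swap x)) ⟩
    - (Σp p - (prefix p (pos (swap x)) - colourWeight (ncol p (swap x)))) - whiteIndicator (invert (ncol p (swap x)))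
      ≡⟨ by-colour (ncol p (swap x)) (Σp p) (prefix p (pos (swap x))) ⟩
    prefix p (pos (swap x)) - whiteIndicator (ncol p (swap x)) - Σp p ∎
    where
    open ≡-Reasoning
    by-colour : ∀ c s u → - (s - (u - colourWeight c)) - whiteIndicator (invert c) ≡ u - whiteIndicator c - s
    by-colour white s u = lemma s u
      where
      lemma : ∀ s u → - (s - (u - 1ℤ)) - 0ℤ ≡ u - 1ℤ - s
      lemma = solve-∀
    by-colour black s u = lemma s u
      where
      lemma : ∀ s u → - (s - (u - -1ℤ)) - 1ℤ ≡ u - 0ℤ - s
      lemma = solve-∀

Balanced-involution : ∀ m {k l} (p : Part k l) (q : Part l k) → IsInvolution p q → Balanced m p → Balanced m q
Balanced-involution m p q inv bal = record
  { Σ-mult = mult-resp (sym Σp-q) (mult-neg Σ-mult)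
  ; height-mult = λ x y x~y → mult-resp (shift x y) (height-mult (swap x) (swap y) (label-q x y x~y))
  }
  where
  open Involution p q inv
  open Balanced bal
  open Multiples m
  shift : ∀ x y → height p (swap y) - height p (swap x) ≡ height q y - height q x
  shift x y = sym (trans (cong₂ _-_ (height-q y) (height-q x)) (lemma (height p (swap y)) (height p (swap x)) (Σp p)))
    where
    lemma : ∀ a b s → a - s - (b - s) ≡ a - b
    lemma = solve-∀

isUpper : ∀ {k l} → Pt k l → Bool
isUpper (inj₁ _) = false
isUpper (inj₂ _) = true

isLower : ∀ {k l} → Pt k l → Bool
isLower (inj₁ _) = true
isLower (inj₂ _) = false

module Tensor {k₁ l₁ k₂ l₂ : ℕ} (p : Part k₁ l₁) (p′ : Part k₂ l₂) (q : Part (k₁ +ₙ k₂) (l₁ +ₙ l₂))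
              (ten : IsTensor p p′ q) where

  left : Pt k₁ l₁ → Pt (k₁ +ₙ k₂) (l₁ +ₙ l₂)
  left (inj₁ i) = inj₁ (i ↑ˡ k₂)
  left (inj₂ j) = inj₂ (j ↑ˡ l₂)

  right : Pt k₂ l₂ → Pt (k₁ +ₙ k₂) (l₁ +ₙ l₂)
  right (inj₁ i) = inj₁ (k₁ ↑ʳ i)
  right (inj₂ j) = inj₂ (l₁ ↑ʳ j)

  left-or-right : ∀ x → (∃ λ a → left a ≡ x) ⊎ (∃ λ b → right b ≡ x)
  left-or-right (inj₁ i) with splitAt k₁ i in eq
  ... | inj₁ a = inj₁ (inj₁ a , cong inj₁ (trans (cong (Fin.join k₁ k₂) (sym eq)) (FinP.join-splitAt k₁ k₂ i)))
  ... | inj₂ b = inj₂ (inj₁ b , cong inj₁ (trans (cong (Fin.join k₁ k₂) (sym eq)) (FinP.join-splitAt k₁ k₂ i)))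
  left-or-right (inj₂ j) with splitAt l₁ j in eq
  ... | inj₁ a = inj₁ (inj₂ a , cong inj₂ (trans (cong (Fin.join l₁ l₂) (sym eq)) (FinP.join-splitAt l₁ l₂ j)))
  ... | inj₂ b = inj₂ (inj₂ b , cong inj₂ (trans (cong (Fin.join l₁ l₂) (sym eq)) (FinP.join-splitAt l₁ l₂ j)))

  ncol-left : ∀ a → ncol q (left a) ≡ ncol p a
  ncol-left (inj₁ i) = trans (proj₁ ten (i ↑ˡ k₂)) (cong [ lowerCol p , lowerCol p′ ] (FinP.splitAt-↑ˡ k₁ i k₂))
  ncol-left (inj₂ j) = cong invert (trans (proj₁ (proj₂ ten) (j ↑ˡ l₂)) (cong [ upperCol p , upperCol p′ ] (FinP.splitAt-↑ˡ l₁ j l₂)))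

  ncol-right : ∀ b → ncol q (right b) ≡ ncol p′ b
  ncol-right (inj₁ i) = trans (proj₁ ten (k₁ ↑ʳ i)) (cong [ lowerCol p , lowerCol p′ ] (FinP.splitAt-↑ʳ k₁ k₂ i))
  ncol-right (inj₂ j) = cong invert (trans (proj₁ (proj₂ ten) (l₁ ↑ʳ j)) (cong [ upperCol p , upperCol p′ ] (FinP.splitAt-↑ʳ l₁ l₂ j)))

  private
    labels : ∀ x y → label q x ≡ label q y → _
    labels x y = Equivalence.to (proj₂ (proj₂ ten) x y)

  label-left : ∀ a b → label q (left a) ≡ label q (left b) → label p a ≡ label p b
  label-left (inj₁ i) (inj₁ j) e
    with splitAt k₁ (i ↑ˡ k₂) | FinP.splitAt-↑ˡ k₁ i k₂ | splitAt k₁ (j ↑ˡ k₂) | FinP.splitAt-↑ˡ k₁ j k₂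
       | labels (left (inj₁ i)) (left (inj₁ j)) e
  ... | _ | refl | _ | refl | r = r
  label-left (inj₁ i) (inj₂ j) e
    with splitAt k₁ (i ↑ˡ k₂) | FinP.splitAt-↑ˡ k₁ i k₂ | splitAt l₁ (j ↑ˡ l₂) | FinP.splitAt-↑ˡ l₁ j l₂
       | labels (left (inj₁ i)) (left (inj₂ j)) e
  ... | _ | refl | _ | refl | r = r
  label-left (inj₂ i) (inj₁ j) e
    with splitAt l₁ (i ↑ˡ l₂) | FinP.splitAt-↑ˡ l₁ i l₂ | splitAt k₁ (j ↑ˡ k₂) | FinP.splitAt-↑ˡ k₁ j k₂
       | labels (left (inj₂ i)) (left (inj₁ j)) e
  ... | _ | refl | _ | refl | r = r
  label-left (inj₂ i) (inj₂ j) e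
    with splitAt l₁ (i ↑ˡ l₂) | FinP.splitAt-↑ˡ l₁ i l₂ | splitAt l₁ (j ↑ˡ l₂) | FinP.splitAt-↑ˡ l₁ j l₂
       | labels (left (inj₂ i)) (left (inj₂ j)) e
  ... | _ | refl | _ | refl | r = r

  label-right : ∀ a b → label q (right a) ≡ label q (right b) → label p′ a ≡ label p′ b
  label-right (inj₁ i) (inj₁ j) e
    with splitAt k₁ (k₁ ↑ʳ i) | FinP.splitAt-↑ʳ k₁ k₂ i | splitAt k₁ (k₁ ↑ʳ j) | FinP.splitAt-↑ʳ k₁ k₂ j
       | labels (right (inj₁ i)) (right (inj₁ j)) e
  ... | _ | refl | _ | refl | r = r
  label-right (inj₁ i) (inj₂ j) e
    with splitAt k₁ (k₁ ↑ʳ i) | FinP.splitAt-↑ʳ k₁ k₂ i | splitAt l₁ (l₁ ↑ʳ j) | FinP.splitAt-↑ʳ l₁ l₂ j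
       | labels (right (inj₁ i)) (right (inj₂ j)) e
  ... | _ | refl | _ | refl | r = r
  label-right (inj₂ i) (inj₁ j) e
    with splitAt l₁ (l₁ ↑ʳ i) | FinP.splitAt-↑ʳ l₁ l₂ i | splitAt k₁ (k₁ ↑ʳ j) | FinP.splitAt-↑ʳ k₁ k₂ j
       | labels (right (inj₂ i)) (right (inj₁ j)) e
  ... | _ | refl | _ | refl | r = r
  label-right (inj₂ i) (inj₂ j) e
    with splitAt l₁ (l₁ ↑ʳ i) | FinP.splitAt-↑ʳ l₁ l₂ i | splitAt l₁ (l₁ ↑ʳ j) | FinP.splitAt-↑ʳ l₁ l₂ j
       | labels (right (inj₂ i)) (right (inj₂ j)) e
  ... | _ | refl | _ | refl | r = r

  label-left≢right : ∀ a b → label q (left a) ≢ label q (right b)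
  label-left≢right (inj₁ i) (inj₁ j) e
    with splitAt k₁ (i ↑ˡ k₂) | FinP.splitAt-↑ˡ k₁ i k₂ | splitAt k₁ (k₁ ↑ʳ j) | FinP.splitAt-↑ʳ k₁ k₂ j
       | labels (left (inj₁ i)) (right (inj₁ j)) e
  ... | _ | refl | _ | refl | ()
  label-left≢right (inj₁ i) (inj₂ j) e
    with splitAt k₁ (i ↑ˡ k₂) | FinP.splitAt-↑ˡ k₁ i k₂ | splitAt l₁ (l₁ ↑ʳ j) | FinP.splitAt-↑ʳ l₁ l₂ j
       | labels (left (inj₁ i)) (right (inj₂ j)) e
  ... | _ | refl | _ | refl | ()
  label-left≢right (inj₂ i) (inj₁ j) e
    with splitAt l₁ (i ↑ˡ l₂) | FinP.splitAt-↑ˡ l₁ i l₂ | splitAt k₁ (k₁ ↑ʳ j) | FinP.splitAt-↑ʳ k₁ k₂ j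
       | labels (left (inj₂ i)) (right (inj₁ j)) e
  ... | _ | refl | _ | refl | ()
  label-left≢right (inj₂ i) (inj₂ j) e
    with splitAt l₁ (i ↑ˡ l₂) | FinP.splitAt-↑ˡ l₁ i l₂ | splitAt l₁ (l₁ ↑ʳ j) | FinP.splitAt-↑ʳ l₁ l₂ j
       | labels (left (inj₂ i)) (right (inj₂ j)) e
  ... | _ | refl | _ | refl | ()

  data SameFactor (x y : Pt (k₁ +ₙ k₂) (l₁ +ₙ l₂)) : Set where
    in-left  : ∀ a b → left a ≡ x → left b ≡ y → label p a ≡ label p b → SameFactor x y
    in-right : ∀ a b → right a ≡ x → right b ≡ y → label p′ a ≡ label p′ b → SameFactor x y

  sameFactor : ∀ x y → label q x ≡ label q y → SameFactor x y
  sameFactor x y e with left-or-right x | left-or-right y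
  ... | inj₁ (a , refl) | inj₁ (b , refl) = in-left a b refl refl (label-left a b e)
  ... | inj₂ (a , refl) | inj₂ (b , refl) = in-right a b refl refl (label-right a b e)
  ... | inj₁ (a , refl) | inj₂ (b , refl) = ⊥-elim (label-left≢right a b e)
  ... | inj₂ (a , refl) | inj₁ (b , refl) = ⊥-elim (label-left≢right b a (sym e))

  σ-q : ∀ S → σ q S ≡ σ p (S ∘ left) + σ p′ (S ∘ right)
  σ-q S = begin
    σ q S                                 ≡⟨ σ≡sumPt q S ⟩
    sumPt (k₁ +ₙ k₂) (l₁ +ₙ l₂) f         ≡⟨ cong₂ _+_ (sum-↑ k₁ k₂ (λ i → f (inj₁ i))) (sum-↑ l₁ l₂ (λ j → f (inj₂ j))) ⟩
    (sum (λ i → f (left (inj₁ i))) + sum (λ i → f (right (inj₁ i)))) + (sum (λ j → f (left (inj₂ j))) + sum (λ j → f (right (inj₂ j))))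
      ≡⟨ interchange (sum (λ i → f (left (inj₁ i)))) (sum (λ i → f (right (inj₁ i)))) (sum (λ j → f (left (inj₂ j)))) (sum (λ j → f (right (inj₂ j)))) ⟩
    sumPt k₁ l₁ (f ∘ left) + sumPt k₂ l₂ (f ∘ right)
      ≡⟨ cong₂ _+_ (sumPt-cong (λ a → cong (when (S (left a))) (weight-left a))) (sumPt-cong (λ b → cong (when (S (right b))) (weight-right b))) ⟩
    sumPt k₁ l₁ (λ a → when (S (left a)) (weight p a)) + sumPt k₂ l₂ (λ b → when (S (right b)) (weight p′ b))
      ≡⟨ cong₂ _+_ (σ≡sumPt p (S ∘ left)) (σ≡sumPt p′ (S ∘ right)) ⟨
    σ p (S ∘ left) + σ p′ (S ∘ right) ∎
    where
    open ≡-Reasoning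
    f = λ x → when (S x) (weight q x)
    interchange : ∀ a b c d → (a + b) + (c + d) ≡ (a + c) + (b + d)
    interchange = solve-∀
    weight-left : ∀ a → weight q (left a) ≡ weight p a
    weight-left a = trans (weight≡colourWeight q (left a)) (trans (cong colourWeight (ncol-left a)) (sym (weight≡colourWeight p a)))
    weight-right : ∀ b → weight q (right b) ≡ weight p′ b
    weight-right b = trans (weight≡colourWeight q (right b)) (trans (cong colourWeight (ncol-right b)) (sym (weight≡colourWeight p′ b)))

  Σp-q : Σp q ≡ Σp p + Σp p′
  Σp-q = σ-q (λ _ → true)

  -- On the cycle of q the points of p′ form an arc between the lower and the
  -- upper points of p, so the upper points of p move on by s = k₂ + l₂.
  private
    s = k₂ +ₙ l₂

    pos-left-lower : ∀ i → pos (left (inj₁ i)) ≡ pos {k₁} {l₁} (inj₁ i)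
    pos-left-lower i = FinP.toℕ-↑ˡ i k₂

    pos-left-upper : ∀ j → pos (left (inj₂ j)) ≡ pos {k₁} {l₁} (inj₂ j) +ₙ s
    pos-left-upper j = begin
      (k₁ +ₙ k₂) +ₙ ((l₁ +ₙ l₂) ∸ suc (toℕ (j ↑ˡ l₂))) ≡⟨ cong (λ u → (k₁ +ₙ k₂) +ₙ ((l₁ +ₙ l₂) ∸ suc u)) (FinP.toℕ-↑ˡ j l₂) ⟩
      (k₁ +ₙ k₂) +ₙ ((l₁ +ₙ l₂) ∸ suc (toℕ j))        ≡⟨ cong ((k₁ +ₙ k₂) +ₙ_) (ℕP.+-∸-comm l₂ (FinP.toℕ<n j)) ⟩
      (k₁ +ₙ k₂) +ₙ ((l₁ ∸ suc (toℕ j)) +ₙ l₂)        ≡⟨ lemma k₁ k₂ l₂ (l₁ ∸ suc (toℕ j)) ⟩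
      k₁ +ₙ (l₁ ∸ suc (toℕ j)) +ₙ s                  ∎
      where
      open ≡-Reasoning
      lemma : ∀ a b c d → a +ₙ b +ₙ (d +ₙ c) ≡ a +ₙ d +ₙ (b +ₙ c)
      lemma = ℕSolver.solve-∀

    pos-right : ∀ b → pos (right b) ≡ k₁ +ₙ pos b
    pos-right (inj₁ i) = FinP.toℕ-↑ʳ k₁ i
    pos-right (inj₂ j) = begin
      (k₁ +ₙ k₂) +ₙ ((l₁ +ₙ l₂) ∸ suc (toℕ (l₁ ↑ʳ j))) ≡⟨ cong (λ u → (k₁ +ₙ k₂) +ₙ ((l₁ +ₙ l₂) ∸ suc u)) (FinP.toℕ-↑ʳ l₁ j) ⟩
      (k₁ +ₙ k₂) +ₙ ((l₁ +ₙ l₂) ∸ suc (l₁ +ₙ toℕ j))   ≡⟨ cong (λ u → (k₁ +ₙ k₂) +ₙ ((l₁ +ₙ l₂) ∸ u)) (sym (ℕP.+-suc l₁ (toℕ j))) ⟩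
      (k₁ +ₙ k₂) +ₙ ((l₁ +ₙ l₂) ∸ (l₁ +ₙ suc (toℕ j))) ≡⟨ cong ((k₁ +ₙ k₂) +ₙ_) (ℕP.[m+n]∸[m+o]≡n∸o l₁ l₂ (suc (toℕ j))) ⟩
      (k₁ +ₙ k₂) +ₙ (l₂ ∸ suc (toℕ j))                ≡⟨ ℕP.+-assoc k₁ k₂ _ ⟩
      k₁ +ₙ (k₂ +ₙ (l₂ ∸ suc (toℕ j)))                ∎
      where open ≡-Reasoning

    lower<k₁ : ∀ i → pos {k₁} {l₁} (inj₁ i) <ₙ k₁
    lower<k₁ = FinP.toℕ<n

    k₁≤upper : ∀ j → k₁ ≤ₙ pos {k₁} {l₁} (inj₂ j)
    k₁≤upper j = ℕP.m≤m+n k₁ _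

    left≤left : ∀ γ x → (pos (left γ) ≤ᵇ pos (left x)) ≡ (pos γ ≤ᵇ pos x)
    left≤left (inj₁ i) (inj₁ j) rewrite pos-left-lower i | pos-left-lower j = refl
    left≤left (inj₁ i) (inj₂ j) rewrite pos-left-lower i | pos-left-upper j =
      trans (≤ᵇ-true (ℕP.≤-trans (ℕP.<⇒≤ (lower<k₁ i)) (ℕP.≤-trans (k₁≤upper j) (ℕP.m≤m+n _ s))))
            (sym (≤ᵇ-true (ℕP.≤-trans (ℕP.<⇒≤ (lower<k₁ i)) (k₁≤upper j))))
    left≤left (inj₂ i) (inj₁ j) rewrite pos-left-lower j | pos-left-upper i =
      trans (≤ᵇ-false (ℕP.<-≤-trans (lower<k₁ j) (ℕP.≤-trans (k₁≤upper i) (ℕP.m≤m+n _ s))))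
            (sym (≤ᵇ-false (ℕP.<-≤-trans (lower<k₁ j) (k₁≤upper i))))
    left≤left (inj₂ i) (inj₂ j) rewrite pos-left-upper i | pos-left-upper j = ≤ᵇ-+-cancelʳ (pos {k₁} {l₁} (inj₂ i)) (pos {k₁} {l₁} (inj₂ j)) s

    right≤right : ∀ γ x → (pos (right γ) ≤ᵇ pos (right x)) ≡ (pos γ ≤ᵇ pos x)
    right≤right γ x rewrite pos-right γ | pos-right x = ≤ᵇ-+-cancelˡ (pos γ) (pos x) k₁

    right≤left : ∀ γ x → (pos (right γ) ≤ᵇ pos (left x)) ≡ isUpper x
    right≤left γ (inj₁ j) rewrite pos-left-lower j | pos-right γ = ≤ᵇ-false (ℕP.<-≤-trans (lower<k₁ j) (ℕP.m≤m+n k₁ _))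
    right≤left γ (inj₂ j) rewrite pos-left-upper j | pos-right γ =
      ≤ᵇ-true (ℕP.≤-trans (ℕP.<⇒≤ (ℕP.+-monoʳ-< k₁ (pos<k+l γ))) (ℕP.+-monoˡ-≤ s (k₁≤upper j)))

    left≤right : ∀ γ x → (pos (left γ) ≤ᵇ pos (right x)) ≡ isLower γ
    left≤right (inj₁ i) x rewrite pos-left-lower i | pos-right x = ≤ᵇ-true (ℕP.≤-trans (ℕP.<⇒≤ (lower<k₁ i)) (ℕP.m≤m+n k₁ _))
    left≤right (inj₂ i) x rewrite pos-left-upper i | pos-right x =
      ≤ᵇ-false (ℕP.<-≤-trans (ℕP.+-monoʳ-< k₁ (pos<k+l x)) (ℕP.+-monoˡ-≤ s (k₁≤upper i)))

    σ-const : ∀ {k l} (r : Part k l) b → σ r (λ _ → b) ≡ when b (Σp r)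
    σ-const r true  = refl
    σ-const r false = σ-∅ r

  lowerΣ : ℤ
  lowerΣ = σ p isLower

  height-left : ∀ a → height q (left a) ≡ height p a + when (isUpper a) (Σp p′)
  height-left a = begin
    prefix q (pos (left a)) - whiteIndicator (ncol q (left a))
      ≡⟨ cong₂ _-_ (σ-q (λ γ → pos γ ≤ᵇ pos (left a))) (cong whiteIndicator (ncol-left a)) ⟩
    σ p (λ γ → pos (left γ) ≤ᵇ pos (left a)) + σ p′ (λ γ → pos (right γ) ≤ᵇ pos (left a)) - whiteIndicator (ncol p a)
      ≡⟨ cong (_- whiteIndicator (ncol p a)) (cong₂ _+_ (σ-cong p (λ γ → left≤left γ a)) (trans (σ-cong p′ (λ γ → right≤left γ a)) (σ-const p′ (isUpper a)))) ⟩
    prefix p (pos a) + when (isUpper a) (Σp p′) - whiteIndicator (ncol p a)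
      ≡⟨ lemma (prefix p (pos a)) (whiteIndicator (ncol p a)) (when (isUpper a) (Σp p′)) ⟩
    height p a + when (isUpper a) (Σp p′) ∎
    where
    open ≡-Reasoning
    lemma : ∀ u w c → u + c - w ≡ u - w + c
    lemma = solve-∀

  height-right : ∀ b → height q (right b) ≡ height p′ b + lowerΣ
  height-right b = begin
    prefix q (pos (right b)) - whiteIndicator (ncol q (right b))
      ≡⟨ cong₂ _-_ (σ-q (λ γ → pos γ ≤ᵇ pos (right b))) (cong whiteIndicator (ncol-right b)) ⟩
    σ p (λ γ → pos (left γ) ≤ᵇ pos (right b)) + σ p′ (λ γ → pos (right γ) ≤ᵇ pos (right b)) - whiteIndicator (ncol p′ b)
      ≡⟨ cong (_- whiteIndicator (ncol p′ b)) (cong₂ _+_ (σ-cong p (λ γ → left≤right γ b)) (σ-cong p′ (λ γ → right≤right γ b))) ⟩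
    lowerΣ + prefix p′ (pos b) - whiteIndicator (ncol p′ b)
      ≡⟨ lemma (prefix p′ (pos b)) (whiteIndicator (ncol p′ b)) lowerΣ ⟩
    height p′ b + lowerΣ ∎
    where
    open ≡-Reasoning
    lemma : ∀ u w c → c + u - w ≡ u - w + c
    lemma = solve-∀

Balanced-tensor : ∀ m {k₁ l₁ k₂ l₂} (p : Part k₁ l₁) (p′ : Part k₂ l₂) q →
                  IsTensor p p′ q → Balanced m p → Balanced m p′ → Balanced m q
Balanced-tensor m p p′ q ten bal bal′ = record
  { Σ-mult = mult-resp (sym Σp-q) (mult-+ (Balanced.Σ-mult bal) (Balanced.Σ-mult bal′))
  ; height-mult = height-mult-q
  }
  where
  open Tensor p p′ q ten
  open Multiples m
  when-mult : ∀ c → mult m (when c (Σp p′))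
  when-mult true  = Balanced.Σ-mult bal′
  when-mult false = mult-0
  height-mult-q : ∀ x y → label q x ≡ label q y → mult m (height q y - height q x)
  height-mult-q x y x~y with sameFactor x y x~y
  ... | in-left a₁ a₂ refl refl a₁~a₂ =
    mult-resp (sym (trans (cong₂ _-_ (height-left a₂) (height-left a₁)) (lemma (height p a₂) (height p a₁) (when (isUpper a₂) (Σp p′)) (when (isUpper a₁) (Σp p′)))))
      (mult-+ (Balanced.height-mult bal a₁ a₂ a₁~a₂) (mult-- (when-mult (isUpper a₂)) (when-mult (isUpper a₁))))
    where
    lemma : ∀ u v c d → u + c - (v + d) ≡ u - v + (c - d)
    lemma = solve-∀
  ... | in-right b₁ b₂ refl refl b₁~b₂ =
    mult-resp (sym (trans (cong₂ _-_ (height-right b₂) (height-right b₁)) (lemma (height p′ b₂) (height p′ b₁) lowerΣ)))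
      (Balanced.height-mult bal′ b₁ b₂ b₁~b₂)
    where
    lemma : ∀ u v c → u + c - (v + c) ≡ u - v
    lemma = solve-∀

sumWhen : ∀ n → (Fin n → Bool) → (Fin n → ℤ) → ℤ
sumWhen n b w = sum (λ i → when (b i) (w i))

sumWhen-cong : ∀ n {b c : Fin n → Bool} {v w : Fin n → ℤ} → (∀ i → b i ≡ c i) → (∀ i → v i ≡ w i) →
               sumWhen n b v ≡ sumWhen n c w
sumWhen-cong n b≗c v≗w = sum-cong-≗ (λ i → cong₂ when (b≗c i) (v≗w i))

sumWhen-false : ∀ n (b : Fin n → Bool) w → (∀ i → b i ≡ false) → sumWhen n b w ≡ 0ℤ
sumWhen-false n b w b≗false = trans (sum-cong-≗ (λ i → cong (λ c → when c (w i)) (b≗false i))) (sum-replicate-zero n)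

sumWhen-neg : ∀ n b (w : Fin n → ℤ) → sumWhen n b (λ i → - w i) ≡ - sumWhen n b w
sumWhen-neg n b w = trans (sum-cong-≗ (λ i → when-neg (b i) (w i))) (sum-neg n (λ i → when (b i) (w i)))

sumWhen-∪ : ∀ n (b b₁ b₂ : Fin n → Bool) w → (∀ i → b i ≡ (b₁ i ∨ b₂ i)) → (∀ i → (b₁ i ∧ b₂ i) ≡ false) →
            sumWhen n b w ≡ sumWhen n b₁ w + sumWhen n b₂ w
sumWhen-∪ n b b₁ b₂ w b≗b₁∪b₂ disjoint = begin
  sumWhen n b w                                          ≡⟨ ℤP.+-identityʳ _ ⟨
  sumWhen n b w + 0ℤ                                     ≡⟨ cong (_+_ (sumWhen n b w)) (sumWhen-false n _ w disjoint) ⟨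
  sumWhen n b w + sumWhen n (λ i → b₁ i ∧ b₂ i) w        ≡⟨ ∑-distrib-+ (λ i → when (b i) (w i)) (λ i → when (b₁ i ∧ b₂ i) (w i)) ⟨
  sum (λ i → when (b i) (w i) + when (b₁ i ∧ b₂ i) (w i))
    ≡⟨ sum-cong-≗ (λ i → trans (cong (λ c → when c (w i) + when (b₁ i ∧ b₂ i) (w i)) (b≗b₁∪b₂ i)) (when-∨+when-∧ (b₁ i) (b₂ i) (w i))) ⟩
  sum (λ i → when (b₁ i) (w i) + when (b₂ i) (w i))      ≡⟨ ∑-distrib-+ (λ i → when (b₁ i) (w i)) (λ i → when (b₂ i) (w i)) ⟩
  sumWhen n b₁ w + sumWhen n b₂ w                        ∎
  where open ≡-Reasoning

mult-EqClosure : ∀ {V : Set} (E : V → V → Set) (f : V → ℤ) d → (∀ u v → E u v → mult d (f v - f u)) →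
                 ∀ u v → EqClosure E u v → mult d (f v - f u)
mult-EqClosure E f d step u .u ε = Multiples.mult-resp d (sym (ℤP.+-inverseʳ (f u))) (Multiples.mult-0 d)
mult-EqClosure E f d step u v (_◅_ {j = w} (fwd e) rest) =
  Multiples.mult-resp d (lemma (f u) (f w) (f v)) (Multiples.mult-+ d (mult-EqClosure E f d step w v rest) (step u w e))
  where
  lemma : ∀ a b c → c - b + (b - a) ≡ c - a
  lemma = solve-∀
mult-EqClosure E f d step u v (_◅_ {j = w} (bwd e) rest) =
  Multiples.mult-resp d (lemma (f u) (f w) (f v)) (Multiples.mult-- d (mult-EqClosure E f d step w v rest) (step w u e))
  where
  lemma : ∀ a b c → c - b - (a - b) ≡ c - a
  lemma = solve-∀

module Composition {k n l : ℕ} (p : Part k n) (p′ : Part n l) (q : Part k l)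
                   (composable : Composable p p′) (comp : IsComposition p p′ q) where

  lowerWeight : ∀ {a b} → Part a b → Fin a → ℤ
  lowerWeight r i = weight r (inj₁ i)

  upperWeight : ∀ {a b} → Part a b → Fin b → ℤ
  upperWeight r j = weight r (inj₂ j)

  ncol-q-lower : ∀ i → ncol q (inj₁ i) ≡ ncol p (inj₁ i)
  ncol-q-lower = proj₁ comp

  ncol-q-upper : ∀ j → ncol q (inj₂ j) ≡ ncol p′ (inj₂ j)
  ncol-q-upper j = cong invert (proj₁ (proj₂ comp) j)

  ncol-middle : ∀ j → ncol p (inj₂ j) ≡ invert (ncol p′ (inj₁ j))
  ncol-middle j = cong invert (composable j)

  label-q : ∀ x y → label q x ≡ label q y → EqClosure (CEdge p p′) (fromQ {k} {n} {l} x) (fromQ y)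
  label-q x y = Equivalence.to (proj₂ (proj₂ comp) x y)

  private
    weight-q-lower : ∀ i → lowerWeight q i ≡ lowerWeight p i
    weight-q-lower i = trans (weight≡colourWeight q (inj₁ i)) (trans (cong colourWeight (ncol-q-lower i)) (sym (weight≡colourWeight p (inj₁ i))))

    weight-q-upper : ∀ j → upperWeight q j ≡ upperWeight p′ j
    weight-q-upper j = trans (weight≡colourWeight q (inj₂ j)) (trans (cong colourWeight (ncol-q-upper j)) (sym (weight≡colourWeight p′ (inj₂ j))))

    weight-middle : ∀ j → upperWeight p j ≡ - lowerWeight p′ j
    weight-middle j = trans (weight≡colourWeight p (inj₂ j))
      (trans (cong colourWeight (ncol-middle j)) (trans (colourWeight-invert _) (cong -_ (sym (weight≡colourWeight p′ (inj₁ j))))))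

    middle : ∀ b → sumWhen n b (upperWeight p) ≡ - sumWhen n b (lowerWeight p′)
    middle b = trans (sumWhen-cong n (λ _ → refl) weight-middle) (sumWhen-neg n b (lowerWeight p′))

    lowerAll = sum (lowerWeight p)

    -- the middle row cancels: it is counted once in p and once, inverted, in p′
    cancel : ∀ a b c → a + c ≡ (a + - b) + (b + c)
    cancel = solve-∀

  private
    prefix-rows : ∀ {a b} (r : Part a b) t →
                  prefix r t ≡ sumWhen a (λ i → pos {a} {b} (inj₁ i) ≤ᵇ t) (lowerWeight r) + sumWhen b (λ j → pos {a} {b} (inj₂ j) ≤ᵇ t) (upperWeight r)
    prefix-rows r t = σ≡sumPt r (λ γ → pos γ ≤ᵇ t)

    Σp-rows : ∀ {a b} (r : Part a b) → Σp r ≡ sum (lowerWeight r) + sum (upperWeight r)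
    Σp-rows r = σ≡sumPt r (λ _ → true)

  Σp-q : Σp q ≡ Σp p + Σp p′
  Σp-q = begin
    Σp q                                                ≡⟨ Σp-rows q ⟩
    sum (lowerWeight q) + sum (upperWeight q)           ≡⟨ cong₂ _+_ (sum-cong-≗ weight-q-lower) (sum-cong-≗ weight-q-upper) ⟩
    lowerAll + sum (upperWeight p′)                     ≡⟨ cancel lowerAll (sum (lowerWeight p′)) (sum (upperWeight p′)) ⟩
    (lowerAll + - sum (lowerWeight p′)) + (sum (lowerWeight p′) + sum (upperWeight p′))
      ≡⟨ cong₂ _+_ (cong (_+_ lowerAll) (middle (λ _ → true))) (Σp-rows p′) ⟨
    (lowerAll + sum (upperWeight p)) + Σp p′            ≡⟨ cong (_+ Σp p′) (Σp-rows p) ⟨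
    Σp p + Σp p′                                        ∎
    where open ≡-Reasoning

  private
    reverse : ∀ N (j j′ : Fin N) → ((N ∸ suc (toℕ j′)) ≤ᵇ (N ∸ suc (toℕ j))) ≡ (toℕ j ≤ᵇ toℕ j′)
    reverse N j j′ = T-injective (λ t → ℕP.≤⇒≤ᵇ (ℕP.≤-pred (ℕP.∸-cancelʳ-≤ (FinP.toℕ<n j) (ℕP.≤ᵇ⇒≤ _ _ t))))
                         (λ t → ℕP.≤⇒≤ᵇ (ℕP.∸-monoʳ-≤ N (s≤s (ℕP.≤ᵇ⇒≤ (toℕ j) _ t))))

    lower≤ : ∀ {a} b (i : Fin a) t → a ≤ₙ t → (pos {a} {b} (inj₁ i) ≤ᵇ t) ≡ true
    lower≤ b i t a≤t = ≤ᵇ-true (ℕP.≤-trans (ℕP.<⇒≤ (FinP.toℕ<n i)) a≤t)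

  prefix-q-lower : ∀ i → prefix q (toℕ i) ≡ prefix p (toℕ i)
  prefix-q-lower i = begin
    prefix q (toℕ i)
      ≡⟨ prefix-rows q (toℕ i) ⟩
    sumWhen k (λ i′ → toℕ i′ ≤ᵇ toℕ i) (lowerWeight q) + sumWhen l (λ j → pos {k} {l} (inj₂ j) ≤ᵇ toℕ i) (upperWeight q)
      ≡⟨ cong₂ _+_ (sumWhen-cong k (λ _ → refl) weight-q-lower)
                   (trans (sumWhen-false l _ _ (λ j → ≤ᵇ-false (beyond j))) (sym (sumWhen-false n _ _ (λ j → ≤ᵇ-false (beyond j))))) ⟩
    sumWhen k (λ i′ → toℕ i′ ≤ᵇ toℕ i) (lowerWeight p) + sumWhen n (λ j → pos {k} {n} (inj₂ j) ≤ᵇ toℕ i) (upperWeight p)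
      ≡⟨ prefix-rows p (toℕ i) ⟨
    prefix p (toℕ i) ∎
    where
    open ≡-Reasoning
    beyond : ∀ {b} j → toℕ i <ₙ pos {k} {b} (inj₂ j)
    beyond j = ℕP.<-≤-trans (FinP.toℕ<n i) (ℕP.m≤m+n k _)

  prefix-q-upper : ∀ j → prefix q (pos {k} {l} (inj₂ j)) ≡ Σp p + prefix p′ (pos {n} {l} (inj₂ j))
  prefix-q-upper j = begin
    prefix q P
      ≡⟨ prefix-rows q P ⟩
    sumWhen k (λ i → toℕ i ≤ᵇ P) (lowerWeight q) + sumWhen l (λ j′ → pos {k} {l} (inj₂ j′) ≤ᵇ P) (upperWeight q)
      ≡⟨ cong₂ _+_ (sumWhen-cong k (λ i → lower≤ l i P (ℕP.m≤m+n k _)) weight-q-lower) (sumWhen-cong l (λ j′ → ≤ᵇ-+-cancelˡ _ _ k) weight-q-upper) ⟩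
    lowerAll + sumWhen l U (upperWeight p′)
      ≡⟨ cancel lowerAll (sum (lowerWeight p′)) (sumWhen l U (upperWeight p′)) ⟩
    (lowerAll + - sum (lowerWeight p′)) + (sum (lowerWeight p′) + sumWhen l U (upperWeight p′))
      ≡⟨ cong₂ _+_ (cong (_+_ lowerAll) (middle (λ _ → true)))
                   (cong₂ _+_ (sumWhen-cong n (λ i → lower≤ l i P′ (ℕP.m≤m+n n _)) (λ _ → refl)) (sumWhen-cong l (λ j′ → ≤ᵇ-+-cancelˡ _ _ n) (λ _ → refl))) ⟨
    (lowerAll + sum (upperWeight p)) + (sumWhen n (λ i → toℕ i ≤ᵇ P′) (lowerWeight p′) + sumWhen l (λ j′ → pos {n} {l} (inj₂ j′) ≤ᵇ P′) (upperWeight p′))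
      ≡⟨ cong₂ _+_ (Σp-rows p) (prefix-rows p′ P′) ⟨
    Σp p + prefix p′ P′ ∎
    where
    open ≡-Reasoning
    P = pos {k} {l} (inj₂ j)
    P′ = pos {n} {l} (inj₂ j)
    U = λ (j′ : Fin l) → (l ∸ suc (toℕ j′)) ≤ᵇ (l ∸ suc (toℕ j))

  prefix-middle : ∀ j → prefix p (pos {k} {n} (inj₂ j)) ≡ Σp p + prefix< p′ (toℕ j)
  prefix-middle j = begin
    prefix p P
      ≡⟨ prefix-rows p P ⟩
    sumWhen k (λ i → toℕ i ≤ᵇ P) (lowerWeight p) + sumWhen n (λ j′ → pos {k} {n} (inj₂ j′) ≤ᵇ P) (upperWeight p)
      ≡⟨ cong₂ _+_ (sumWhen-cong k (λ i → lower≤ n i P (ℕP.m≤m+n k _)) (λ _ → refl))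
                   (sumWhen-cong n (λ j′ → trans (≤ᵇ-+-cancelˡ _ _ k) (reverse n j j′)) (λ _ → refl)) ⟩
    lowerAll + sumWhen n Ge (upperWeight p)
      ≡⟨ cong (_+_ lowerAll) (middle Ge) ⟩
    lowerAll + - sumWhen n Ge (lowerWeight p′)
      ≡⟨ lemma lowerAll (sumWhen n Ge (lowerWeight p′)) (sumWhen n Lt (lowerWeight p′)) ⟩
    (lowerAll + - (sumWhen n Ge (lowerWeight p′) + sumWhen n Lt (lowerWeight p′))) + (sumWhen n Lt (lowerWeight p′) + 0ℤ)
      ≡⟨ cong₂ _+_ (cong (λ u → lowerAll + - u) (sumWhen-∪ n (λ _ → true) Ge Lt (lowerWeight p′) cover disjoint))
                   (cong (_+_ (sumWhen n Lt (lowerWeight p′)))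
                         (sumWhen-false l _ (upperWeight p′) (λ j′ → <ᵇ-false (ℕP.≤-trans (ℕP.<⇒≤ (FinP.toℕ<n j)) (ℕP.m≤m+n n _))))) ⟨
    (lowerAll + - sum (lowerWeight p′)) + (sumWhen n Lt (lowerWeight p′) + sumWhen l (λ j′ → pos {n} {l} (inj₂ j′) <ᵇ toℕ j) (upperWeight p′))
      ≡⟨ cong₂ _+_ (trans (Σp-rows p) (cong (_+_ lowerAll) (middle (λ _ → true)))) (σ≡sumPt p′ (λ γ → pos γ <ᵇ toℕ j)) ⟨
    Σp p + prefix< p′ (toℕ j) ∎
    where
    open ≡-Reasoning
    P = pos {k} {n} (inj₂ j)
    Ge = λ (j′ : Fin n) → toℕ j ≤ᵇ toℕ j′
    Lt = λ (j′ : Fin n) → toℕ j′ <ᵇ toℕ j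
    cover : ∀ j′ → true ≡ (Ge j′ ∨ Lt j′)
    cover j′ with toℕ j′ ℕ.<? toℕ j
    ... | yes j′<j rewrite <ᵇ-true j′<j | ≤ᵇ-false j′<j = refl
    ... | no j′≮j rewrite ≤ᵇ-true (ℕP.≮⇒≥ j′≮j) = refl
    disjoint : ∀ j′ → (Ge j′ ∧ Lt j′) ≡ false
    disjoint j′ with toℕ j′ ℕ.<? toℕ j
    ... | yes j′<j rewrite ≤ᵇ-false j′<j = refl
    ... | no j′≮j rewrite ≤ᵇ-true (ℕP.≮⇒≥ j′≮j) | <ᵇ-false (ℕP.≮⇒≥ j′≮j) = refl
    lemma : ∀ a b c → a + - b ≡ (a + - (b + c)) + (c + 0ℤ)
    lemma = solve-∀

  height-middle : ∀ j → height p (inj₂ j) ≡ height p′ (inj₁ j) + Σp p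
  height-middle j = begin
    prefix p (pos {k} {n} (inj₂ j)) - whiteIndicator (ncol p (inj₂ j))
      ≡⟨ cong₂ _-_ (prefix-middle j) (cong whiteIndicator (ncol-middle j)) ⟩
    Σp p + prefix< p′ (toℕ j) - whiteIndicator (invert c)
      ≡⟨ by-colour c (Σp p) (prefix< p′ (toℕ j)) ⟩
    prefix< p′ (toℕ j) + colourWeight c - whiteIndicator c + Σp p
      ≡⟨ cong (λ u → u - whiteIndicator c + Σp p) (trans (prefix≡prefix<+weight p′ (inj₁ j)) (cong (_+_ (prefix< p′ (toℕ j))) (weight≡colourWeight p′ (inj₁ j)))) ⟨
    prefix p′ (toℕ j) - whiteIndicator c + Σp p ∎
    where
    open ≡-Reasoning
    c = ncol p′ (inj₁ j)
    by-colour : ∀ c s u → s + u - whiteIndicator (invert c) ≡ u + colourWeight c - whiteIndicator c + s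
    by-colour white s u = lemma s u
      where
      lemma : ∀ s u → s + u - 0ℤ ≡ u + 1ℤ - 1ℤ + s
      lemma = solve-∀
    by-colour black s u = lemma s u
      where
      lemma : ∀ s u → s + u - 1ℤ ≡ u + -1ℤ - 0ℤ + s
      lemma = solve-∀

  -- On the middle row the descriptions through p and through p′ agree by height-middle.
  joinedHeight : CPt k n l → ℤ
  joinedHeight (inj₁ i) = height p (inj₁ i)
  joinedHeight (inj₂ (inj₁ j)) = height p′ (inj₁ j)
  joinedHeight (inj₂ (inj₂ j)) = height p′ (inj₂ j) + Σp p

  joinedHeight-fromP : ∀ a → joinedHeight (fromP {k} {n} {l} a) ≡ height p a - when (isUpper a) (Σp p)
  joinedHeight-fromP (inj₁ i) = sym (ℤP.+-identityʳ _)
  joinedHeight-fromP (inj₂ j) = trans (lemma (height p′ (inj₁ j)) (Σp p)) (cong (_- Σp p) (sym (height-middle j)))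
    where
    lemma : ∀ a s → a ≡ a + s - s
    lemma = solve-∀

  joinedHeight-fromP′ : ∀ a → joinedHeight (fromP' {k} {n} {l} a) ≡ height p′ a + when (isUpper a) (Σp p)
  joinedHeight-fromP′ (inj₁ i) = sym (ℤP.+-identityʳ _)
  joinedHeight-fromP′ (inj₂ j) = refl

  joinedHeight-fromQ : ∀ x → joinedHeight (fromQ {k} {n} {l} x) ≡ height q x
  joinedHeight-fromQ (inj₁ i) = sym (cong₂ _-_ (prefix-q-lower i) (cong whiteIndicator (ncol-q-lower i)))
  joinedHeight-fromQ (inj₂ j) = sym (trans (cong₂ _-_ (prefix-q-upper j) (cong whiteIndicator (ncol-q-upper j)))
                                           (lemma (Σp p) (prefix p′ (pos {n} {l} (inj₂ j))) (whiteIndicator (ncol p′ (inj₂ j)))))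
    where
    lemma : ∀ s c b → s + c - b ≡ c - b + s
    lemma = solve-∀

Balanced-composition : ∀ m {k n l} (p : Part k n) (p′ : Part n l) q → Composable p p′ →
                       IsComposition p p′ q → Balanced m p → Balanced m p′ → Balanced m q
Balanced-composition m p p′ q composable comp bal bal′ = record
  { Σ-mult = mult-resp (sym Σp-q) (mult-+ (Balanced.Σ-mult bal) (Balanced.Σ-mult bal′))
  ; height-mult = λ x y x~y → mult-resp (cong₂ _-_ (joinedHeight-fromQ y) (joinedHeight-fromQ x))
                                        (mult-EqClosure (CEdge p p′) joinedHeight m edge _ _ (label-q x y x~y))
  }
  where
  open Composition p p′ q composable comp
  open Multiples m
  when-mult : ∀ c → mult m (when c (Σp p))
  when-mult true  = Balanced.Σ-mult bal
  when-mult false = mult-0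
  edge : ∀ u v → CEdge p p′ u v → mult m (joinedHeight v - joinedHeight u)
  edge u v (inj₁ (a₁ , a₂ , refl , refl , a₁~a₂)) =
    mult-resp (sym (trans (cong₂ _-_ (joinedHeight-fromP a₂) (joinedHeight-fromP a₁))
                          (lemma (height p a₂) (height p a₁) (when (isUpper a₂) (Σp p)) (when (isUpper a₁) (Σp p)))))
      (mult-- (Balanced.height-mult bal a₁ a₂ a₁~a₂) (mult-- (when-mult (isUpper a₂)) (when-mult (isUpper a₁))))
    where
    lemma : ∀ u v c d → u - c - (v - d) ≡ u - v - (c - d)
    lemma = solve-∀
  edge u v (inj₂ (b₁ , b₂ , refl , refl , b₁~b₂)) =
    mult-resp (sym (trans (cong₂ _-_ (joinedHeight-fromP′ b₂) (joinedHeight-fromP′ b₁))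
                          (lemma (height p′ b₂) (height p′ b₁) (when (isUpper b₂) (Σp p)) (when (isUpper b₁) (Σp p)))))
      (mult-+ (Balanced.height-mult bal′ b₁ b₂ b₁~b₂) (mult-- (when-mult (isUpper b₂)) (when-mult (isUpper b₁))))
    where
    lemma : ∀ u v c d → u + c - (v + d) ≡ u - v + (c - d)
    lemma = solve-∀

Flat : ∀ {k l} → Part k l → Set
Flat p = Σp p ≡ 0ℤ × (∀ x y → height p x ≡ height p y)

flat-empty : (q : Part 0 0) → Flat q
flat-empty q = refl , λ { (inj₁ ()) ; (inj₂ ()) }

flat-identity : ∀ c (q : Part 1 1) → lowerCol q Fin.zero ≡ c → upperCol q Fin.zero ≡ c → Flat q
flat-identity c q lc uc = Σ≡0 c lc uc , constant
  where
  Σ≡0 : ∀ c → lowerCol q Fin.zero ≡ c → upperCol q Fin.zero ≡ c → Σp q ≡ 0ℤ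
  Σ≡0 white lc uc rewrite weight≡colourWeight q (inj₁ Fin.zero) | weight≡colourWeight q (inj₂ Fin.zero) | lc | uc = refl
  Σ≡0 black lc uc rewrite weight≡colourWeight q (inj₁ Fin.zero) | weight≡colourWeight q (inj₂ Fin.zero) | lc | uc = refl
  lower≡upper : ∀ c → lowerCol q Fin.zero ≡ c → upperCol q Fin.zero ≡ c → height q (inj₁ Fin.zero) ≡ height q (inj₂ Fin.zero)
  lower≡upper white lc uc rewrite weight≡colourWeight q (inj₁ Fin.zero) | weight≡colourWeight q (inj₂ Fin.zero) | lc | uc = refl
  lower≡upper black lc uc rewrite weight≡colourWeight q (inj₁ Fin.zero) | weight≡colourWeight q (inj₂ Fin.zero) | lc | uc = refl
  constant : ∀ x y → height q x ≡ height q y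
  constant (inj₁ Fin.zero) (inj₁ Fin.zero) = refl
  constant (inj₁ Fin.zero) (inj₂ Fin.zero) = lower≡upper c lc uc
  constant (inj₂ Fin.zero) (inj₁ Fin.zero) = sym (lower≡upper c lc uc)
  constant (inj₂ Fin.zero) (inj₂ Fin.zero) = refl

flat-pair : ∀ c (q : Part 2 0) → lowerCol q Fin.zero ≡ c → lowerCol q (Fin.suc Fin.zero) ≡ invert c → Flat q
flat-pair c q l₀ l₁ = Σ≡0 c l₀ l₁ , constant
  where
  Σ≡0 : ∀ c → lowerCol q Fin.zero ≡ c → lowerCol q (Fin.suc Fin.zero) ≡ invert c → Σp q ≡ 0ℤ
  Σ≡0 white l₀ l₁ rewrite weight≡colourWeight q (inj₁ Fin.zero) | weight≡colourWeight q (inj₁ (Fin.suc Fin.zero)) | l₀ | l₁ = refl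
  Σ≡0 black l₀ l₁ rewrite weight≡colourWeight q (inj₁ Fin.zero) | weight≡colourWeight q (inj₁ (Fin.suc Fin.zero)) | l₀ | l₁ = refl
  first≡second : ∀ c → lowerCol q Fin.zero ≡ c → lowerCol q (Fin.suc Fin.zero) ≡ invert c →
                 height q (inj₁ Fin.zero) ≡ height q (inj₁ (Fin.suc Fin.zero))
  first≡second white l₀ l₁ rewrite weight≡colourWeight q (inj₁ Fin.zero) | weight≡colourWeight q (inj₁ (Fin.suc Fin.zero)) | l₀ | l₁ = refl
  first≡second black l₀ l₁ rewrite weight≡colourWeight q (inj₁ Fin.zero) | weight≡colourWeight q (inj₁ (Fin.suc Fin.zero)) | l₀ | l₁ = refl
  constant : ∀ x y → height q x ≡ height q y
  constant (inj₁ Fin.zero) (inj₁ Fin.zero) = refl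
  constant (inj₁ Fin.zero) (inj₁ (Fin.suc Fin.zero)) = first≡second c l₀ l₁
  constant (inj₁ (Fin.suc Fin.zero)) (inj₁ Fin.zero) = sym (first≡second c l₀ l₁)
  constant (inj₁ (Fin.suc Fin.zero)) (inj₁ (Fin.suc Fin.zero)) = refl

Flat⇒Balanced : ∀ m {k l} (p : Part k l) → Flat p → Balanced m p
Flat⇒Balanced m p (Σ≡0 , constant) = record
  { Σ-mult = mult-resp (sym Σ≡0) mult-0
  ; height-mult = λ x y _ → mult-resp (sym (trans (cong (_- height p x) (constant y x)) (ℤP.+-inverseʳ (height p x)))) mult-0
  }
  where open Multiples m

category-Qa : ∀ m → IsCategory (R (Qa m))
category-Qa m = record
  { hasEmpty    = λ q → Balanced⇒R m q (Flat⇒Balanced m q (flat-empty q))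
  ; hasId       = λ c q lc uc _ → Balanced⇒R m q (Flat⇒Balanced m q (flat-identity c q (lc Fin.zero) (uc Fin.zero)))
  ; hasPairBW   = λ q l₀ l₁ _ → Balanced⇒R m q (Flat⇒Balanced m q (flat-pair black q l₀ l₁))
  ; hasPairWB   = λ q l₀ l₁ _ → Balanced⇒R m q (Flat⇒Balanced m q (flat-pair white q l₀ l₁))
  ; tensor      = λ p p′ q rp rp′ ten → Balanced⇒R m q (Balanced-tensor m p p′ q ten (R⇒Balanced m p rp) (R⇒Balanced m p′ rp′))
  ; involution  = λ p q rp inv → Balanced⇒R m q (Balanced-involution m p q inv (R⇒Balanced m p rp))
  ; composition = λ p p′ q rp rp′ composable comp →
      Balanced⇒R m q (Balanced-composition m p p′ q composable comp (R⇒Balanced m p rp) (R⇒Balanced m p′ rp′))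
  }

AtMostTwoPerBlock : ∀ {k l} → Part k l → Set
AtMostTwoPerBlock p = ∀ a b c → a ≢ b → a ≢ c → b ≢ c → label p a ≡ label p b → label p a ≡ label p c → ⊥

data BlockShape {k l} (p : Part k l) (x : Pt k l) : Set where
  singleton : (∀ γ → ¬ T (block p x γ ∧ not (eqPt γ x))) → BlockShape p x
  doubleton : ∀ a → a ≢ x → label p a ≡ label p x →
              (∀ γ → ¬ T ((block p x γ ∧ not (eqPt γ x)) ∧ not (eqPt γ a))) → BlockShape p x

blockShape : ∀ {k l} (p : Part k l) → AtMostTwoPerBlock p → ∀ x → BlockShape p x
blockShape p small x with search (λ γ → block p x γ ∧ not (eqPt γ x))
... | inj₂ none = singleton none
... | inj₁ (a , a∈) with search (λ γ → (block p x γ ∧ not (eqPt γ x)) ∧ not (eqPt γ a))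
...   | inj₂ none = doubleton a a≢x a~x none
  where
  a≢x = T-not-eqPt⇒≢ (T-∧-proj₂ {block p x a} a∈)
  a~x = ℕP.≡ᵇ⇒≡ _ _ (T-∧-proj₁ {block p x a} a∈)
...   | inj₁ (b , b∈) = ⊥-elim (small x a b (≢-sym a≢x) (≢-sym b≢x) (≢-sym b≢a) (sym a~x) (sym b~x))
  where
  a≢x = T-not-eqPt⇒≢ (T-∧-proj₂ {block p x a} a∈)
  a~x = ℕP.≡ᵇ⇒≡ _ _ (T-∧-proj₁ {block p x a} a∈)
  b∈′ = T-∧-proj₁ {block p x b ∧ not (eqPt b x)} b∈
  b≢x = T-not-eqPt⇒≢ (T-∧-proj₂ {block p x b} b∈′)
  b~x = ℕP.≡ᵇ⇒≡ _ _ (T-∧-proj₁ {block p x b} b∈′)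
  b≢a = T-not-eqPt⇒≢ (T-∧-proj₂ {block p x b ∧ not (eqPt b x)} b∈)

σ-block-singleton : ∀ {k l} (p r : Part k l) x → (∀ γ → ¬ T (block p x γ ∧ not (eqPt γ x))) →
                    σ r (block p x) ≡ weight r x
σ-block-singleton p r x none = begin
  σ r (block p x)                                       ≡⟨ σ-remove r (block p x) x (block-refl p x) ⟩
  weight r x + σ r (λ γ → block p x γ ∧ not (eqPt γ x)) ≡⟨ cong (_+_ (weight r x)) (σ-empty r _ none) ⟩
  weight r x + 0ℤ                                       ≡⟨ ℤP.+-identityʳ _ ⟩
  weight r x                                            ∎
  where open ≡-Reasoning

σ-block-doubleton : ∀ {k l} (p r : Part k l) x a → a ≢ x → label p a ≡ label p x →
                    (∀ γ → ¬ T ((block p x γ ∧ not (eqPt γ x)) ∧ not (eqPt γ a))) →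
                    σ r (block p x) ≡ weight r x + weight r a
σ-block-doubleton p r x a a≢x a~x none = begin
  σ r (block p x)                              ≡⟨ σ-remove r (block p x) x (block-refl p x) ⟩
  weight r x + σ r block∖x                     ≡⟨ cong (_+_ (weight r x)) (σ-remove r block∖x a a∈) ⟩
  weight r x + (weight r a + σ r (λ γ → block∖x γ ∧ not (eqPt γ a)))
    ≡⟨ cong (λ u → weight r x + (weight r a + u)) (σ-empty r _ none) ⟩
  weight r x + (weight r a + 0ℤ)               ≡⟨ cong (_+_ (weight r x)) (ℤP.+-identityʳ _) ⟩
  weight r x + weight r a                      ∎
  where
  open ≡-Reasoning
  block∖x = λ γ → block p x γ ∧ not (eqPt γ x)
  a∈ : block∖x a ≡ true
  a∈ rewrite block-≡ p (sym a~x) | eqPt-≢ a≢x = refl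

colourShift : ℕ → Color → Color → ℤ
colourShift m a b = if eqCol a b then + m else 0ℤ

sameColourShift : ℕ → ∀ {k l} → Part k l → Pt k l → Pt k l → ℤ
sameColourShift m p x y = colourShift m (ncol p x) (ncol p y)

∣colourWeight∣≤2 : ∀ c → ∣ colourWeight c ∣ ≤ₙ 2
∣colourWeight∣≤2 white = s≤s z≤n
∣colourWeight∣≤2 black = s≤s z≤n

∣colourWeight+colourWeight∣≤2 : ∀ c d → ∣ colourWeight c + colourWeight d ∣ ≤ₙ 2
∣colourWeight+colourWeight∣≤2 white white = ℕP.≤-refl
∣colourWeight+colourWeight∣≤2 white black = z≤n
∣colourWeight+colourWeight∣≤2 black white = z≤n
∣colourWeight+colourWeight∣≤2 black black = ℕP.≤-refl

colourWeight+colourWeight≡0 : ∀ c d → colourWeight c + colourWeight d ≡ 0ℤ → eqCol c d ≡ false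
colourWeight+colourWeight≡0 white black _ = refl
colourWeight+colourWeight≡0 black white _ = refl

colourWeight+colourWeight≢0 : ∀ c d → colourWeight c + colourWeight d ≢ 0ℤ → eqCol c d ≡ true
colourWeight+colourWeight≢0 white white _ = refl
colourWeight+colourWeight≢0 white black ≢0 = ⊥-elim (≢0 refl)
colourWeight+colourWeight≢0 black white ≢0 = ⊥-elim (≢0 refl)
colourWeight+colourWeight≢0 black black _ = refl

record PairBalanced (m : ℕ) {k l : ℕ} (p : Part k l) : Set where
  field
    atMostTwo   : AtMostTwoPerBlock p
    Σ-mult      : mult (2 *ₙ m) (Σp p)
    height-mult : ∀ x y → x ≢ y → label p x ≡ label p y →
                  mult (2 *ₙ m) (height p y - height p x - sameColourShift m p x y)

module _ (m : ℕ) {k l : ℕ} (p : Part k l) where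
  open Multiples (2 *ₙ m)

  private
    δ-decomposition : ∀ α β → α ≢ β →
                      δ p α β ≡ sameColourShift m p α β + ((height p β - height p α - sameColourShift m p α β) + winding p α β)
    δ-decomposition α β α≢β = trans (δ≡height-difference p α β α≢β) (lemma (height p β) (height p α) (sameColourShift m p α β) (winding p α β))
      where
      lemma : ∀ u v c w → u - v + w ≡ c + ((u - v - c) + w)
      lemma = solve-∀

    δ-mult⇔height-mult : mult (2 *ₙ m) (Σp p) → ∀ α β → α ≢ β →
      mult (2 *ₙ m) (δ p α β - sameColourShift m p α β) ⇔ mult (2 *ₙ m) (height p β - height p α - sameColourShift m p α β)
    δ-mult⇔height-mult 2m∣Σ α β α≢β = mk⇔
      (λ 2m∣δ → mult-resp (lemma₁ _ _) (mult-- (mult-resp δ≡ 2m∣δ) (mult-winding p (2 *ₙ m) 2m∣Σ α β)))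
      (λ 2m∣h → mult-resp (sym δ≡) (mult-+ 2m∣h (mult-winding p (2 *ₙ m) 2m∣Σ α β)))
      where
      δ≡ : δ p α β - sameColourShift m p α β ≡ (height p β - height p α - sameColourShift m p α β) + winding p α β
      δ≡ = trans (cong (_- sameColourShift m p α β) (δ-decomposition α β α≢β)) (lemma₂ (sameColourShift m p α β) _)
        where
        lemma₂ : ∀ c r → c + r - c ≡ r
        lemma₂ = solve-∀
      lemma₁ : ∀ u w → u + w - w ≡ u
      lemma₁ = solve-∀

    σ-pair-sameColour : ∀ a b → a ≢ b → σ p (pair p a b) ≢ 0ℤ → sameColourShift m p a b ≡ + m
    σ-pair-sameColour a b a≢b ≢0
      rewrite colourWeight+colourWeight≢0 (ncol p a) (ncol p b) (≢0 ∘ trans (σ-pair p a b a≢b)) = refl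

    σ-pair-differentColour : ∀ a b → a ≢ b → σ p (pair p a b) ≡ 0ℤ → sameColourShift m p a b ≡ 0ℤ
    σ-pair-differentColour a b a≢b ≡0
      rewrite colourWeight+colourWeight≡0 (ncol p a) (ncol p b) (trans (sym (σ-pair p a b a≢b)) ≡0) = refl

    shifted-mult⇒m+2mℤ : ∀ {x} → mult (2 *ₙ m) (x - + m) → ∃ λ z → x ≡ + m + + (2 *ₙ m) * z
    shifted-mult⇒m+2mℤ {x} (z , e) = z , trans (lemma x (+ m)) (cong (_+_ (+ m)) e)
      where
      lemma : ∀ x c → x ≡ c + (x - c)
      lemma = solve-∀

    m+2mℤ⇒shifted-mult : ∀ {x} → (∃ λ z → x ≡ + m + + (2 *ₙ m) * z) → mult (2 *ₙ m) (x - + m)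
    m+2mℤ⇒shifted-mult {x} (z , refl) = z , lemma (+ m) (+ (2 *ₙ m) * z)
      where
      lemma : ∀ c r → c + r - c ≡ r
      lemma = solve-∀

    mult-minus-0 : ∀ {x} → mult (2 *ₙ m) x → mult (2 *ₙ m) (x - 0ℤ)
    mult-minus-0 {x} = mult-resp (sym (ℤP.+-identityʳ x))

    mult-minus-0⁻¹ : ∀ {x} → mult (2 *ₙ m) (x - 0ℤ) → mult (2 *ₙ m) x
    mult-minus-0⁻¹ {x} = mult-resp (ℤP.+-identityʳ x)

  PairBalanced⇒R : PairBalanced m p → R (Qb m) p
  PairBalanced⇒R b = record
    { zF = size
    ; zV = value
    ; zΣ = Σ-mult
    ; zL = λ a₁ a₂ a₁≢a₂ a₁~a₂ _ ≢0 →
        shifted-mult⇒m+2mℤ (subst (λ s → mult (2 *ₙ m) (δ p a₁ a₂ - s)) (σ-pair-sameColour a₁ a₂ a₁≢a₂ ≢0) (δ-mult a₁ a₂ a₁≢a₂ a₁~a₂))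
    ; zK = λ a₁ a₂ a₁≢a₂ a₁~a₂ _ ≡0 →
        mult-minus-0⁻¹ (subst (λ s → mult (2 *ₙ m) (δ p a₁ a₂ - s)) (σ-pair-differentColour a₁ a₂ a₁≢a₂ ≡0) (δ-mult a₁ a₂ a₁≢a₂ a₁~a₂))
    ; zX = λ _ _ _ → tt
    }
    where
    open PairBalanced b
    δ-mult : ∀ a₁ a₂ → a₁ ≢ a₂ → label p a₁ ≡ label p a₂ → mult (2 *ₙ m) (δ p a₁ a₂ - sameColourShift m p a₁ a₂)
    δ-mult a₁ a₂ a₁≢a₂ a₁~a₂ = Equivalence.from (δ-mult⇔height-mult Σ-mult a₁ a₂ a₁≢a₂) (height-mult a₁ a₂ a₁≢a₂ a₁~a₂)
    size : ∀ x → (card p (block p x) ≡ 1) ⊎ (card p (block p x) ≡ 2)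
    size x with blockShape p atMostTwo x
    ... | singleton none = inj₁ (ℤP.+-injective (trans (card≡σ-allWhite p _) (trans (σ-block-singleton p allWhite x none) (weight-allWhite x))))
    ... | doubleton a a≢x a~x none = inj₂ (ℤP.+-injective (trans (card≡σ-allWhite p _)
            (trans (σ-block-doubleton p allWhite x a a≢x a~x none) (cong₂ _+_ (weight-allWhite x) (weight-allWhite a)))))
    value : ∀ x → ∣ σ p (block p x) ∣ ≤ₙ 2
    value x with blockShape p atMostTwo x
    ... | singleton none rewrite σ-block-singleton p p x none | weight≡colourWeight p x = ∣colourWeight∣≤2 (ncol p x)
    ... | doubleton a a≢x a~x none rewrite σ-block-doubleton p p x a a≢x a~x none | weight≡colourWeight p x | weight≡colourWeight p a =
      ∣colourWeight+colourWeight∣≤2 (ncol p x) (ncol p a)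

  R⇒PairBalanced : R (Qb m) p → PairBalanced m p
  R⇒PairBalanced r = record
    { atMostTwo = atMostTwo
    ; Σ-mult = zΣ
    ; height-mult = λ x y x≢y x~y → Equivalence.to (δ-mult⇔height-mult zΣ x y x≢y) (δ-mult x y x≢y x~y)
    }
    where
    open Z≤ r
    atMostTwo : AtMostTwoPerBlock p
    atMostTwo a b c a≢b a≢c b≢c a~b a~c = too-big (zF a)
      where
      S₁ = λ γ → block p a γ ∧ not (eqPt γ a)
      S₂ = λ γ → S₁ γ ∧ not (eqPt γ b)
      b∈ : S₁ b ≡ true
      b∈ rewrite block-≡ p a~b | eqPt-≢ (≢-sym a≢b) = refl
      c∈ : S₂ c ≡ true
      c∈ rewrite block-≡ p a~c | eqPt-≢ (≢-sym a≢c) | eqPt-≢ (≢-sym b≢c) = refl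
      three : + card p (block p a) ≡ + (3 +ₙ card p (λ γ → S₂ γ ∧ not (eqPt γ c)))
      three = begin
        + card p (block p a)                        ≡⟨ card-remove p (block p a) a (block-refl p a) ⟩
        1ℤ + + card p S₁                            ≡⟨ cong (_+_ 1ℤ) (card-remove p S₁ b b∈) ⟩
        1ℤ + (1ℤ + + card p S₂)                     ≡⟨ cong (λ u → 1ℤ + (1ℤ + u)) (card-remove p S₂ c c∈) ⟩
        + (3 +ₙ card p (λ γ → S₂ γ ∧ not (eqPt γ c))) ∎
        where open ≡-Reasoning
      too-big : (card p (block p a) ≡ 1) ⊎ (card p (block p a) ≡ 2) → ⊥
      too-big (inj₁ ≡1) with trans (sym ≡1) (ℤP.+-injective three)
      ... | ()
      too-big (inj₂ ≡2) with trans (sym ≡2) (ℤP.+-injective three)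
      ... | ()
    nothing-between : ∀ x y → x ≢ y → label p x ≡ label p y → ∀ γ → label p γ ≡ label p x → ¬ T (inOpen x y γ)
    nothing-between x y x≢y x~y γ γ~x γ∈ =
      atMostTwo x y γ x≢y (≢-sym (inOpen⇒≢left x y γ γ∈)) (≢-sym (inOpen⇒≢right x y γ γ∈)) x~y (sym γ~x)
    δ-mult : ∀ x y → x ≢ y → label p x ≡ label p y → mult (2 *ₙ m) (δ p x y - sameColourShift m p x y)
    δ-mult x y x≢y x~y with σ p (pair p x y) ℤ.≟ 0ℤ
    ... | yes ≡0 = subst (λ s → mult (2 *ₙ m) (δ p x y - s)) (sym (σ-pair-differentColour x y x≢y ≡0))
                         (mult-minus-0 (zK x y x≢y x~y (nothing-between x y x≢y x~y) ≡0))
    ... | no ≢0 = subst (λ s → mult (2 *ₙ m) (δ p x y - s)) (sym (σ-pair-sameColour x y x≢y ≢0))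
                        (m+2mℤ⇒shifted-mult (zL x y x≢y x~y (nothing-between x y x≢y x~y) ≢0))

even : ℕ → Bool
even zero = true
even (suc zero) = false
even (suc (suc n)) = even n

even-suc : ∀ n → even (suc n) ≡ not (even n)
even-suc zero = refl
even-suc (suc zero) = refl
even-suc (suc (suc n)) = even-suc n

even⇒double : ∀ n → even n ≡ true → ∃ λ t → n ≡ t +ₙ t
even⇒double zero _ = 0 , refl
even⇒double (suc (suc n)) e with even⇒double n e
... | t , refl = suc t , cong suc (sym (ℕP.+-suc t t))

odd⇒suc-double : ∀ n → even n ≡ false → ∃ λ t → n ≡ suc (t +ₙ t)
odd⇒suc-double (suc zero) _ = 0 , refl
odd⇒suc-double (suc (suc n)) e with odd⇒suc-double n e
... | t , refl = suc t , cong (λ u → suc (suc u)) (sym (ℕP.+-suc t t))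

-- Starting at a fixed point x of B and applying A, B, A, B, … in turn, the
-- walk runs through the orbit of x under the group generated by A and B.
module AlternatingWalk {V : Set} (A B : V → V) (A-involutive : ∀ v → A (A v) ≡ v) (B-involutive : ∀ v → B (B v) ≡ v)
                       (_≟_ : ∀ (a b : V) → Dec (a ≡ b)) (x : V) (Bx≡x : B x ≡ x) where

  move : ℕ → V → V
  move j v = if even j then A v else B v

  move-involutive : ∀ j v → move j (move j v) ≡ v
  move-involutive j v with even j
  ... | true  = A-involutive v
  ... | false = B-involutive v

  move-even : ∀ j v → even j ≡ true → move j v ≡ A v
  move-even j v e rewrite e = refl

  move-odd : ∀ j v → even j ≡ false → move j v ≡ B v
  move-odd j v e rewrite e = refl

  move-cases : ∀ j → ((∀ v → move j v ≡ A v) × (∀ v → move (suc j) v ≡ B v)) ⊎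
                     ((∀ v → move j v ≡ B v) × (∀ v → move (suc j) v ≡ A v))
  move-cases j with even j in e
  ... | true  = inj₁ ((λ v → refl) , (λ v → move-odd (suc j) v (trans (even-suc j) (cong not e))))
  ... | false = inj₂ ((λ v → refl) , (λ v → move-even (suc j) v (trans (even-suc j) (cong not e))))

  walk : ℕ → V
  walk zero = x
  walk (suc j) = move j (walk j)

  Genuine : ℕ → Set
  Genuine J = ∀ i → i <ₙ J → walk (suc i) ≢ walk i

  Stops : ℕ → Set
  Stops J = walk (suc J) ≡ walk J

  move-back : ∀ i → move (suc i) (walk i) ≡ walk (ℕ.pred i)
  move-back zero = Bx≡x
  move-back (suc i) = move-involutive i (walk i)

  OnWalk : V → Set
  OnWalk v = ∃ λ i → walk i ≡ v

  OnWalkUpTo : ℕ → V → Set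
  OnWalkUpTo J v = ∃ λ i → i ≤ₙ J × walk i ≡ v

  onWalk-closed : ∀ v → OnWalk v → OnWalk (A v) × OnWalk (B v)
  onWalk-closed v (i , refl) with move-cases i
  ... | inj₁ (A≗ , B≗) = (suc i , A≗ (walk i)) , (ℕ.pred i , trans (sym (move-back i)) (B≗ (walk i)))
  ... | inj₂ (B≗ , A≗) = (ℕ.pred i , trans (sym (move-back i)) (A≗ (walk i))) , (suc i , B≗ (walk i))

  private
    forward : ∀ J → Stops J → ∀ i → i ≤ₙ J → OnWalkUpTo J (move i (walk i))
    forward J stop i i≤J with ℕP.m≤n⇒m<n∨m≡n i≤J
    ... | inj₁ i<J = suc i , i<J , refl
    ... | inj₂ refl = i , i≤J , sym stop

    backward : ∀ J i → i ≤ₙ J → OnWalkUpTo J (move (suc i) (walk i))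
    backward J i i≤J = ℕ.pred i , ℕP.≤-trans ℕP.pred[n]≤n i≤J , sym (move-back i)

  onWalkUpTo-closed : ∀ J → Stops J → ∀ v → OnWalkUpTo J v → OnWalkUpTo J (A v) × OnWalkUpTo J (B v)
  onWalkUpTo-closed J stop v (i , i≤J , refl) with move-cases i
  ... | inj₁ (A≗ , B≗) = subst (OnWalkUpTo J) (A≗ (walk i)) (forward J stop i i≤J) , subst (OnWalkUpTo J) (B≗ (walk i)) (backward J i i≤J)
  ... | inj₂ (B≗ , A≗) = subst (OnWalkUpTo J) (A≗ (walk i)) (backward J i i≤J) , subst (OnWalkUpTo J) (B≗ (walk i)) (forward J stop i i≤J)

  firstStop : ∀ i → (∃ λ J → J ≤ₙ i × Stops J × Genuine J) ⊎ Genuine (suc i)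
  firstStop zero with walk 1 ≟ walk 0
  ... | yes e = inj₁ (0 , z≤n , e , λ _ ())
  ... | no ne = inj₂ λ { zero _ → ne ; (suc i) (s≤s ()) }
  firstStop (suc i) with firstStop i
  ... | inj₁ (J , J≤i , stop , genuine) = inj₁ (J , ℕP.m≤n⇒m≤1+n J≤i , stop , genuine)
  ... | inj₂ genuine with walk (suc (suc i)) ≟ walk (suc i)
  ...   | yes e = inj₁ (suc i , ℕP.≤-refl , e , genuine)
  ...   | no ne = inj₂ λ j j<2+i → [ genuine j , (λ { refl → ne }) ] (ℕP.m≤n⇒m<n∨m≡n (ℕP.≤-pred j<2+i))

  -- A genuine step never ends at a fixed point of the involution it applied.
  fixedB⇒odd : ∀ j → walk (suc j) ≢ walk j → B (walk (suc j)) ≡ walk (suc j) → even (suc j) ≡ false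
  fixedB⇒odd j genuine fixed = by-parity (even j) refl
    where
    by-parity : ∀ b → even j ≡ b → even (suc j) ≡ false
    by-parity true  e = trans (even-suc j) (cong not e)
    by-parity false e = ⊥-elim (genuine (sym (trans (sym (B-involutive (walk j))) (trans (cong B (sym (move-odd j (walk j) e))) fixed))))

  fixedA⇒even : ∀ j → walk (suc j) ≢ walk j → A (walk (suc j)) ≡ walk (suc j) → even (suc j) ≡ true
  fixedA⇒even j genuine fixed = by-parity (even j) refl
    where
    by-parity : ∀ b → even j ≡ b → even (suc j) ≡ true
    by-parity true  e = ⊥-elim (genuine (sym (trans (sym (A-involutive (walk j))) (trans (cong A (sym (move-even j (walk j) e))) fixed))))
    by-parity false e = trans (even-suc j) (cong not e)

  fixed⇒stops : ∀ j → walk (suc j) ≢ walk j → (A (walk (suc j)) ≡ walk (suc j)) ⊎ (B (walk (suc j)) ≡ walk (suc j)) →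
                Stops (suc j)
  fixed⇒stops j genuine (inj₁ fixed) = trans (move-even (suc j) _ (fixedA⇒even j genuine fixed)) fixed
  fixed⇒stops j genuine (inj₂ fixed) = trans (move-odd (suc j) _ (fixedB⇒odd j genuine fixed)) fixed

  module _ (E : V → V → Set) (edge : ∀ a b → E a b → (b ≡ a) ⊎ (b ≡ A a) ⊎ (b ≡ B a)) where

    EqClosure-closed : ∀ (S : V → Set) → (∀ v → S v → S (A v) × S (B v)) → ∀ a b → S a → EqClosure E a b → S b
    EqClosure-closed S closed a .a Sa ε = Sa
    EqClosure-closed S closed a b Sa (_◅_ {j = w} e rest) = EqClosure-closed S closed w b (one-step e) rest
      where
      one-step : SymClosure E a w → S w
      one-step (fwd e) with edge a w e
      ... | inj₁ refl = Sa
      ... | inj₂ (inj₁ refl) = proj₁ (closed a Sa)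
      ... | inj₂ (inj₂ refl) = proj₂ (closed a Sa)
      one-step (bwd e) with edge w a e
      ... | inj₁ refl = Sa
      ... | inj₂ (inj₁ refl) = subst S (A-involutive w) (proj₁ (closed (A w) Sa))
      ... | inj₂ (inj₂ refl) = subst S (B-involutive w) (proj₂ (closed (B w) Sa))

    fixedPoint-onWalk : ∀ y → EqClosure E x y → y ≢ x → (A y ≡ y) ⊎ (B y ≡ y) →
                        ∃ λ j → Genuine (suc j) × Stops (suc j) × walk (suc j) ≡ y
    fixedPoint-onWalk y x~y y≢x fixed with EqClosure-closed OnWalk onWalk-closed x y (0 , refl) x~y
    ... | zero , e = ⊥-elim (y≢x (sym e))
    ... | suc i , e with firstStop (suc i)
    ...   | inj₂ genuine = ⊥-elim (genuine (suc i) (ℕP.n<1+n (suc i))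
                             (fixed⇒stops i (genuine i (ℕP.<-trans (ℕP.n<1+n i) (ℕP.n<1+n (suc i))))
                                          (subst (λ w → (A w ≡ w) ⊎ (B w ≡ w)) (sym e) fixed)))
    ...   | inj₁ (J , _ , stop , genuine) with EqClosure-closed (OnWalkUpTo J) (onWalkUpTo-closed J stop) x y (0 , z≤n , refl) x~y
    ...     | zero , _ , e′ = ⊥-elim (y≢x (sym e′))
    ...     | suc i′ , i′<J , e′ with ℕP.m≤n⇒m<n∨m≡n i′<J
    ...       | inj₁ 1+i′<J = ⊥-elim (genuine (suc i′) 1+i′<J
                                 (fixed⇒stops i′ (genuine i′ (ℕP.<-trans (ℕP.n<1+n i′) 1+i′<J))
                                              (subst (λ w → (A w ≡ w) ⊎ (B w ≡ w)) (sym e′) fixed)))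
    ...       | inj₂ refl = i′ , genuine , stop , e′

module Partner {k l : ℕ} (r : Part k l) (atMostTwo : AtMostTwoPerBlock r) where

  private
    IsPartner : Pt k l → Pt k l → Set
    IsPartner a b = (b ≡ a × (∀ c → label r c ≡ label r a → c ≡ a)) ⊎
                    (b ≢ a × label r b ≡ label r a × (∀ c → label r c ≡ label r a → (c ≡ a) ⊎ (c ≡ b)))

    findPartner : ∀ a → ∃ (IsPartner a)
    findPartner a with search (λ b → (label r b ≡ᵇ label r a) ∧ not (eqPt b a))
    ... | inj₂ none = a , inj₁ (refl , alone)
      where
      alone : ∀ c → label r c ≡ label r a → c ≡ a
      alone c c~a with c ≟ₚ a
      ... | yes c≡a = c≡a
      ... | no c≢a = ⊥-elim (none c (T-∧-intro (ℕP.≡⇒≡ᵇ _ _ c~a) (subst (T ∘ not) (sym (eqPt-≢ c≢a)) tt)))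
    ... | inj₁ (b , t) = b , inj₂ (b≢a , b~a , two)
      where
      b≢a = T-not-eqPt⇒≢ (T-∧-proj₂ {label r b ≡ᵇ label r a} t)
      b~a = ℕP.≡ᵇ⇒≡ _ _ (T-∧-proj₁ {label r b ≡ᵇ label r a} t)
      two : ∀ c → label r c ≡ label r a → (c ≡ a) ⊎ (c ≡ b)
      two c c~a with c ≟ₚ a | c ≟ₚ b
      ... | yes c≡a | _ = inj₁ c≡a
      ... | no _ | yes c≡b = inj₂ c≡b
      ... | no c≢a | no c≢b = ⊥-elim (atMostTwo a b c (≢-sym b≢a) (≢-sym c≢a) (≢-sym c≢b) (sym b~a) (sym c~a))

  partner : Pt k l → Pt k l
  partner a = proj₁ (findPartner a)

  partner-label : ∀ a → label r (partner a) ≡ label r a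
  partner-label a with proj₂ (findPartner a)
  ... | inj₁ (e , _) = cong (label r) e
  ... | inj₂ (_ , b~a , _) = b~a

  sameBlock⇒partner : ∀ a b → label r a ≡ label r b → (b ≡ a) ⊎ (b ≡ partner a)
  sameBlock⇒partner a b a~b with proj₂ (findPartner a)
  ... | inj₁ (_ , alone) = inj₁ (alone b (sym a~b))
  ... | inj₂ (_ , _ , two) = two b (sym a~b)

  partner-involutive : ∀ a → partner (partner a) ≡ a
  partner-involutive a with proj₂ (findPartner a)
  ... | inj₁ (e , _) rewrite e = e
  ... | inj₂ (b≢a , b~a , two) with proj₂ (findPartner (partner a))
  ...   | inj₁ (_ , alone) = ⊥-elim (b≢a (sym (alone a (sym b~a))))
  ...   | inj₂ (b′≢b , b′~b , _) with two (partner (partner a)) (trans b′~b b~a)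
  ...     | inj₁ e = e
  ...     | inj₂ e = ⊥-elim (b′≢b e)

mismatch : Bool → Bool → ℤ
mismatch true  true  = 0ℤ
mismatch false false = 0ℤ
mismatch _     _     = 1ℤ

mismatch-refl : ∀ a → mismatch a a ≡ 0ℤ
mismatch-refl true  = refl
mismatch-refl false = refl

mismatch-≢ : ∀ a b → a ≢ b → mismatch a b ≡ 1ℤ
mismatch-≢ true  true  a≢b = ⊥-elim (a≢b refl)
mismatch-≢ true  false _   = refl
mismatch-≢ false true  _   = refl
mismatch-≢ false false a≢b = ⊥-elim (a≢b refl)

mismatch-triangle : ∀ x b c → ∃ λ t → mismatch b x + mismatch b c - mismatch c x ≡ + 2 * t
mismatch-triangle true  true  true  = 0ℤ , refl
mismatch-triangle true  true  false = 0ℤ , refl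
mismatch-triangle true  false true  = 1ℤ , refl
mismatch-triangle true  false false = 0ℤ , refl
mismatch-triangle false true  true  = 0ℤ , refl
mismatch-triangle false true  false = 1ℤ , refl
mismatch-triangle false false true  = 0ℤ , refl
mismatch-triangle false false false = 0ℤ , refl

isBlack : Color → Bool
isBlack white = false
isBlack black = true

colourMismatch : Color → Color → ℤ
colourMismatch a b = mismatch (isBlack a) (isBlack b)

colourMismatch-sym : ∀ a b → colourMismatch a b ≡ colourMismatch b a
colourMismatch-sym white white = refl
colourMismatch-sym white black = refl
colourMismatch-sym black white = refl
colourMismatch-sym black black = refl

colourShift≡ : ∀ m a b → colourShift m a b ≡ + m * (1ℤ - colourMismatch a b)
colourShift≡ m white white = sym (ℤP.*-identityʳ (+ m))
colourShift≡ m black black = sym (ℤP.*-identityʳ (+ m))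
colourShift≡ m white black = sym (ℤP.*-zeroʳ (+ m))
colourShift≡ m black white = sym (ℤP.*-zeroʳ (+ m))

invertUnless : Bool → Color → Color
invertUnless u c = if u then c else invert c

-- Inverting a colour changes the mismatch by one; so does changing the row.
mismatch-invertUnless : ∀ ua ub ca cb →
  ∃ λ t → - colourMismatch ca cb - (colourMismatch (invertUnless ua ca) (invertUnless ub cb) + mismatch ua ub) ≡ + 2 * t
mismatch-invertUnless true  true  white white = 0ℤ , refl
mismatch-invertUnless true  true  white black = -1ℤ , refl
mismatch-invertUnless true  true  black white = -1ℤ , refl
mismatch-invertUnless true  true  black black = 0ℤ , refl
mismatch-invertUnless true  false white white = -1ℤ , refl
mismatch-invertUnless true  false white black = -1ℤ , refl
mismatch-invertUnless true  false black white = -1ℤ , refl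
mismatch-invertUnless true  false black black = -1ℤ , refl
mismatch-invertUnless false true  white white = -1ℤ , refl
mismatch-invertUnless false true  white black = -1ℤ , refl
mismatch-invertUnless false true  black white = -1ℤ , refl
mismatch-invertUnless false true  black black = -1ℤ , refl
mismatch-invertUnless false false white white = 0ℤ , refl
mismatch-invertUnless false false white black = -1ℤ , refl
mismatch-invertUnless false false black white = -1ℤ , refl
mismatch-invertUnless false false black black = 0ℤ , refl

colourShift-mult : ∀ m ua ub ca cb →
  mult (2 *ₙ m) (colourShift m ca cb - + m * (1ℤ + colourMismatch (invertUnless ua ca) (invertUnless ub cb) + mismatch ua ub))
colourShift-mult m ua ub ca cb with t , e ← mismatch-invertUnless ua ub ca cb =
  Multiples.mult-resp (2 *ₙ m) (sym (begin
    colourShift m ca cb - + m * (1ℤ + d′ + mismatch ua ub)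
      ≡⟨ cong (_- + m * (1ℤ + d′ + mismatch ua ub)) (colourShift≡ m ca cb) ⟩
    + m * (1ℤ - colourMismatch ca cb) - + m * (1ℤ + d′ + mismatch ua ub)
      ≡⟨ lemma (+ m) (colourMismatch ca cb) d′ (mismatch ua ub) ⟩
    + m * (- colourMismatch ca cb - (d′ + mismatch ua ub))
      ≡⟨ cong (+ m *_) e ⟩
    + m * (+ 2 * t) ∎)) (m*even m t)
  where
  open ≡-Reasoning
  d′ = colourMismatch (invertUnless ua ca) (invertUnless ub cb)
  lemma : ∀ a d e f → a * (1ℤ - d) - a * (1ℤ + e + f) ≡ a * (- d - (e + f))
  lemma = solve-∀

fromQ-injective : ∀ {k n l} {a b : Pt k l} → fromQ {k} {n} {l} a ≡ fromQ b → a ≡ b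
fromQ-injective {a = inj₁ i} {inj₁ .i} refl = refl
fromQ-injective {a = inj₂ j} {inj₂ .j} refl = refl

module PairComposition {k n l : ℕ} (p : Part k n) (p′ : Part n l) (q : Part k l)
                       (composable : Composable p p′) (comp : IsComposition p p′ q)
                       (m : ℕ) (bal : PairBalanced m p) (bal′ : PairBalanced m p′) where

  open Composition p p′ q composable comp
  open Multiples (2 *ₙ m)
  private
    module P  = Partner p  (PairBalanced.atMostTwo bal)
    module P′ = Partner p′ (PairBalanced.atMostTwo bal′)

  -- the partner involutions of p and of p′, extended by the identity to the
  -- points of the combined rows that they do not see
  moveP : CPt k n l → CPt k n l
  moveP (inj₁ i) = fromP (P.partner (inj₁ i))
  moveP (inj₂ (inj₁ j)) = fromP (P.partner (inj₂ j))
  moveP (inj₂ (inj₂ j)) = inj₂ (inj₂ j)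

  moveP′ : CPt k n l → CPt k n l
  moveP′ (inj₁ i) = inj₁ i
  moveP′ (inj₂ (inj₁ j)) = fromP' (P′.partner (inj₁ j))
  moveP′ (inj₂ (inj₂ j)) = fromP' (P′.partner (inj₂ j))

  moveP-fromP : ∀ a → moveP (fromP {k} {n} {l} a) ≡ fromP (P.partner a)
  moveP-fromP (inj₁ i) = refl
  moveP-fromP (inj₂ j) = refl

  moveP′-fromP′ : ∀ a → moveP′ (fromP' {k} {n} {l} a) ≡ fromP' (P′.partner a)
  moveP′-fromP′ (inj₁ i) = refl
  moveP′-fromP′ (inj₂ j) = refl

  moveP-involutive : ∀ v → moveP (moveP v) ≡ v
  moveP-involutive (inj₁ i) = trans (moveP-fromP (P.partner (inj₁ i))) (cong fromP (P.partner-involutive (inj₁ i)))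
  moveP-involutive (inj₂ (inj₁ j)) = trans (moveP-fromP (P.partner (inj₂ j))) (cong fromP (P.partner-involutive (inj₂ j)))
  moveP-involutive (inj₂ (inj₂ j)) = refl

  moveP′-involutive : ∀ v → moveP′ (moveP′ v) ≡ v
  moveP′-involutive (inj₁ i) = refl
  moveP′-involutive (inj₂ (inj₁ j)) = trans (moveP′-fromP′ (P′.partner (inj₁ j))) (cong fromP' (P′.partner-involutive (inj₁ j)))
  moveP′-involutive (inj₂ (inj₂ j)) = trans (moveP′-fromP′ (P′.partner (inj₂ j))) (cong fromP' (P′.partner-involutive (inj₂ j)))

  edge⇒move : ∀ u v → CEdge p p′ u v → (v ≡ u) ⊎ (v ≡ moveP u) ⊎ (v ≡ moveP′ u)
  edge⇒move u v (inj₁ (a , b , refl , refl , a~b)) with P.sameBlock⇒partner a b a~b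
  ... | inj₁ refl = inj₁ refl
  ... | inj₂ refl = inj₂ (inj₁ (sym (moveP-fromP a)))
  edge⇒move u v (inj₂ (a , b , refl , refl , a~b)) with P′.sameBlock⇒partner a b a~b
  ... | inj₁ refl = inj₁ refl
  ... | inj₂ refl = inj₂ (inj₂ (sym (moveP′-fromP′ a)))

  _≟ᶜ_ : ∀ (u v : CPt k n l) → Dec (u ≡ v)
  _≟ᶜ_ = ≡-dec Fin._≟_ (≡-dec Fin._≟_ Fin._≟_)

  colour : CPt k n l → Color
  colour (inj₁ i) = ncol p (inj₁ i)
  colour (inj₂ (inj₁ j)) = ncol p (inj₂ j)
  colour (inj₂ (inj₂ j)) = ncol p′ (inj₂ j)

  isTop : CPt k n l → Bool
  isTop (inj₂ (inj₂ _)) = true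
  isTop _ = false

  colour-fromP : ∀ a → colour (fromP {k} {n} {l} a) ≡ ncol p a
  colour-fromP (inj₁ i) = refl
  colour-fromP (inj₂ j) = refl

  colour-fromP′ : ∀ a → colour (fromP' {k} {n} {l} a) ≡ invertUnless (isUpper a) (ncol p′ a)
  colour-fromP′ (inj₁ j) = ncol-middle j
  colour-fromP′ (inj₂ j) = refl

  colour-fromQ : ∀ x → colour (fromQ {k} {n} {l} x) ≡ ncol q x
  colour-fromQ (inj₁ i) = sym (ncol-q-lower i)
  colour-fromQ (inj₂ j) = sym (ncol-q-upper j)

  isTop-fromP : ∀ a → isTop (fromP {k} {n} {l} a) ≡ false
  isTop-fromP (inj₁ i) = refl
  isTop-fromP (inj₂ j) = refl

  isTop-fromP′ : ∀ a → isTop (fromP' {k} {n} {l} a) ≡ isUpper a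
  isTop-fromP′ (inj₁ j) = refl
  isTop-fromP′ (inj₂ j) = refl

  isTop-fromQ : ∀ x → isTop (fromQ {k} {n} {l} x) ≡ isUpper x
  isTop-fromQ (inj₁ i) = refl
  isTop-fromQ (inj₂ j) = refl

  Step : CPt k n l → CPt k n l → Set
  Step v w = mult (2 *ₙ m) (joinedHeight w - joinedHeight v - + m * (1ℤ + colourMismatch (colour v) (colour w) + mismatch (isTop v) (isTop w)))

  private
    when-mult : ∀ c → mult (2 *ₙ m) (when c (Σp p))
    when-mult true  = PairBalanced.Σ-mult bal
    when-mult false = mult-0

  step-fromP : ∀ a → fromP {k} {n} {l} (P.partner a) ≢ fromP a → Step (fromP a) (fromP (P.partner a))
  step-fromP a moved rewrite joinedHeight-fromP a | joinedHeight-fromP (P.partner a) | colour-fromP a | colour-fromP (P.partner a)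
                           | isTop-fromP a | isTop-fromP (P.partner a) =
    mult-resp (sym (lemma (height p b) (height p a) (colourShift m (ncol p a) (ncol p b)) (when (isUpper b) (Σp p)) (when (isUpper a) (Σp p))
                          (+ m * (1ℤ + colourMismatch (ncol p a) (ncol p b) + 0ℤ))))
      (mult-+ (mult-- (PairBalanced.height-mult bal a b (moved ∘ cong fromP ∘ sym) (sym (P.partner-label a)))
                      (mult-- (when-mult (isUpper b)) (when-mult (isUpper a))))
              (colourShift-mult m true true (ncol p a) (ncol p b)))
    where
    b = P.partner a
    lemma : ∀ hb ha c sb sa z → hb - sb - (ha - sa) - z ≡ hb - ha - c - (sb - sa) + (c - z)
    lemma = solve-∀

  step-fromP′ : ∀ a → fromP' {k} {n} {l} (P′.partner a) ≢ fromP' a → Step (fromP' a) (fromP' (P′.partner a))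
  step-fromP′ a moved rewrite joinedHeight-fromP′ a | joinedHeight-fromP′ (P′.partner a) | colour-fromP′ a | colour-fromP′ (P′.partner a)
                            | isTop-fromP′ a | isTop-fromP′ (P′.partner a) =
    mult-resp (sym (lemma (height p′ b) (height p′ a) (colourShift m (ncol p′ a) (ncol p′ b)) (when (isUpper b) (Σp p)) (when (isUpper a) (Σp p))
                          (+ m * (1ℤ + colourMismatch (invertUnless (isUpper a) (ncol p′ a)) (invertUnless (isUpper b) (ncol p′ b)) + mismatch (isUpper a) (isUpper b)))))
      (mult-+ (mult-+ (PairBalanced.height-mult bal′ a b (moved ∘ cong fromP' ∘ sym) (sym (P′.partner-label a)))
                      (mult-- (when-mult (isUpper b)) (when-mult (isUpper a))))
              (colourShift-mult m (isUpper a) (isUpper b) (ncol p′ a) (ncol p′ b)))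
    where
    b = P′.partner a
    lemma : ∀ hb ha c sb sa z → hb + sb - (ha + sa) - z ≡ hb - ha - c + (sb - sa) + (c - z)
    lemma = solve-∀

  step-moveP : ∀ v → moveP v ≢ v → Step v (moveP v)
  step-moveP (inj₁ i) moved = step-fromP (inj₁ i) moved
  step-moveP (inj₂ (inj₁ j)) moved = step-fromP (inj₂ j) moved
  step-moveP (inj₂ (inj₂ j)) moved = ⊥-elim (moved refl)

  step-moveP′ : ∀ v → moveP′ v ≢ v → Step v (moveP′ v)
  step-moveP′ (inj₁ i) moved = ⊥-elim (moved refl)
  step-moveP′ (inj₂ (inj₁ j)) moved = step-fromP′ (inj₁ j) moved
  step-moveP′ (inj₂ (inj₂ j)) moved = step-fromP′ (inj₂ j) moved

  private
    -- Adding one step to the walk: the colour and row mismatches with the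
    -- starting point change by the mismatches of the step, up to even numbers.
    invariant-step : ∀ h′ h hx a i c₁ b₁ c₂ b₂ c₃ b₃ tC tB → c₁ + c₂ - c₃ ≡ + 2 * tC → b₁ + b₂ - b₃ ≡ + 2 * tB →
                     h′ - hx - a * (1ℤ + i + c₃ + b₃) ≡
                     (h - hx - a * (i + c₁ + b₁)) + (h′ - h - a * (1ℤ + c₂ + b₂)) + (a * (+ 2 * tC) + a * (+ 2 * tB))
    invariant-step h′ h hx a i c₁ b₁ c₂ b₂ c₃ b₃ tC tB eC eB rewrite sym eC | sym eB = lemma h′ h hx a i c₁ b₁ c₂ b₂ c₃ b₃
      where
      lemma : ∀ h′ h hx a i c₁ b₁ c₂ b₂ c₃ b₃ →
              h′ - hx - a * (1ℤ + i + c₃ + b₃) ≡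
              (h - hx - a * (i + c₁ + b₁)) + (h′ - h - a * (1ℤ + c₂ + b₂)) + (a * (c₁ + c₂ - c₃) + a * (b₁ + b₂ - b₃))
      lemma = solve-∀

  module WalkFrom (A B : CPt k n l → CPt k n l) (A-involutive : ∀ v → A (A v) ≡ v) (B-involutive : ∀ v → B (B v) ≡ v)
                  (step-A : ∀ v → A v ≢ v → Step v (A v)) (step-B : ∀ v → B v ≢ v → Step v (B v))
                  (edge⇒AB : ∀ u v → CEdge p p′ u v → (v ≡ u) ⊎ (v ≡ A u) ⊎ (v ≡ B u))
                  (s : Pt k l) (B-fixes-s : B (fromQ s) ≡ fromQ s)
                  (A-fixes-other-row : ∀ y → isUpper y ≢ isUpper s → A (fromQ y) ≡ fromQ y)
                  (B-fixes-same-row : ∀ y → isUpper y ≡ isUpper s → B (fromQ y) ≡ fromQ y) where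

    x : CPt k n l
    x = fromQ s

    open AlternatingWalk A B A-involutive B-involutive _≟ᶜ_ x B-fixes-s

    step-walk : ∀ i → walk (suc i) ≢ walk i → Step (walk i) (walk (suc i))
    step-walk i moved with move-cases i
    ... | inj₁ (A≗ , _) = subst (Step (walk i)) (sym (A≗ (walk i))) (step-A (walk i) (moved ∘ trans (A≗ (walk i))))
    ... | inj₂ (B≗ , _) = subst (Step (walk i)) (sym (B≗ (walk i))) (step-B (walk i) (moved ∘ trans (B≗ (walk i))))

    Invariant : ℕ → Set
    Invariant i = mult (2 *ₙ m) (joinedHeight (walk i) - joinedHeight x
                                 - + m * (+ i + colourMismatch (colour (walk i)) (colour x) + mismatch (isTop (walk i)) (isTop x)))

    invariant : ∀ i → Genuine i → Invariant i
    invariant zero _ rewrite mismatch-refl (isBlack (colour x)) | mismatch-refl (isTop x) =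
      mult-resp (sym (lemma (joinedHeight x) (+ m))) mult-0
      where
      lemma : ∀ h a → h - h - a * (0ℤ + 0ℤ + 0ℤ) ≡ 0ℤ
      lemma = solve-∀
    invariant (suc i) genuine
      with mismatch-triangle (isBlack (colour x)) (isBlack (colour (walk i))) (isBlack (colour (walk (suc i))))
         | mismatch-triangle (isTop x) (isTop (walk i)) (isTop (walk (suc i)))
    ... | tC , eC | tB , eB =
      mult-resp (sym (invariant-step (joinedHeight (walk (suc i))) (joinedHeight (walk i)) (joinedHeight x) (+ m) (+ i)
                                     (colourMismatch (colour (walk i)) (colour x)) (mismatch (isTop (walk i)) (isTop x))
                                     (colourMismatch (colour (walk i)) (colour (walk (suc i)))) (mismatch (isTop (walk i)) (isTop (walk (suc i))))
                                     (colourMismatch (colour (walk (suc i))) (colour x)) (mismatch (isTop (walk (suc i))) (isTop x))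
                                     tC tB eC eB))
        (mult-+ (mult-+ (invariant i (λ j j<i → genuine j (ℕP.<-trans j<i (ℕP.n<1+n i)))) (step-walk i (genuine i (ℕP.n<1+n i))))
                (mult-+ (m*even m tC) (m*even m tB)))

    fixed : ∀ y → (A (fromQ y) ≡ fromQ y) ⊎ (B (fromQ y) ≡ fromQ y)
    fixed y with isUpper y Data.Bool.≟ isUpper s
    ... | yes same = inj₂ (B-fixes-same-row y same)
    ... | no other = inj₁ (A-fixes-other-row y other)

    reach : ∀ y → y ≢ s → label q s ≡ label q y → ∃ λ j → Genuine (suc j) × Stops (suc j) × walk (suc j) ≡ fromQ y
    reach y y≢s s~y = fixedPoint-onWalk (CEdge p p′) edge⇒AB (fromQ y) (label-q s y s~y) (y≢s ∘ fromQ-injective) (fixed y)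

    unique : ∀ y z → y ≢ s → z ≢ s → label q s ≡ label q y → label q s ≡ label q z → y ≡ z
    unique y z y≢s z≢s s~y s~z with reach y y≢s s~y | reach z z≢s s~z
    ... | j₁ , genuine₁ , stop₁ , e₁ | j₂ , genuine₂ , stop₂ , e₂ with ℕ.<-cmp j₁ j₂
    ...   | tri< j₁<j₂ _ _ = ⊥-elim (genuine₂ (suc j₁) (s≤s j₁<j₂) stop₁)
    ...   | tri≈ _ refl _ = fromQ-injective (trans (sym e₁) e₂)
    ...   | tri> _ _ j₁>j₂ = ⊥-elim (genuine₁ (suc j₂) (s≤s j₁>j₂) stop₂)

    private
      -- The walk from s to y has odd length exactly when y lies in the same row as s.
      row-parity : ∀ y j → Genuine (suc j) → walk (suc j) ≡ fromQ y →
                   ∃ λ t → + suc j + mismatch (isUpper y) (isUpper s) - 1ℤ ≡ + 2 * t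
      row-parity y j genuine e with isUpper y Data.Bool.≟ isUpper s
      ... | yes same with odd⇒suc-double (suc j) (fixedB⇒odd j (genuine j (ℕP.n<1+n j)) (subst (λ w → B w ≡ w) (sym e) (B-fixes-same-row y same)))
      ...   | t , 1+j≡1+2t = + t , (begin
              + suc j + mismatch (isUpper y) (isUpper s) - 1ℤ
                ≡⟨ cong₂ (λ a b → + a + b - 1ℤ) 1+j≡1+2t (trans (cong (λ u → mismatch u (isUpper s)) same) (mismatch-refl (isUpper s))) ⟩
              + suc (t +ₙ t) + 0ℤ - 1ℤ                        ≡⟨ cong (λ u → 1ℤ + u + 0ℤ - 1ℤ) (ℤP.pos-+ t t) ⟩
              1ℤ + (+ t + + t) + 0ℤ - 1ℤ                      ≡⟨ lemma (+ t) ⟩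
              + 2 * + t                                       ∎)
        where
        open ≡-Reasoning
        lemma : ∀ a → 1ℤ + (a + a) + 0ℤ - 1ℤ ≡ + 2 * a
        lemma = solve-∀
      row-parity y j genuine e | no other with even⇒double (suc j) (fixedA⇒even j (genuine j (ℕP.n<1+n j)) (subst (λ w → A w ≡ w) (sym e) (A-fixes-other-row y other)))
      ...   | t , 1+j≡2t = + t , (begin
              + suc j + mismatch (isUpper y) (isUpper s) - 1ℤ ≡⟨ cong₂ (λ a b → + a + b - 1ℤ) 1+j≡2t (mismatch-≢ (isUpper y) (isUpper s) other) ⟩
              + (t +ₙ t) + 1ℤ - 1ℤ                            ≡⟨ cong (λ u → u + 1ℤ - 1ℤ) (ℤP.pos-+ t t) ⟩
              (+ t + + t) + 1ℤ - 1ℤ                           ≡⟨ lemma (+ t) ⟩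
              + 2 * + t                                       ∎)
        where
        open ≡-Reasoning
        lemma : ∀ a → (a + a) + 1ℤ - 1ℤ ≡ + 2 * a
        lemma = solve-∀

      shift-parity : ∀ a b c d J e t → J + e - 1ℤ ≡ + 2 * t →
                     a - b - c * (1ℤ - d) ≡ a - b - c * (J + d + e) + c * (+ 2 * t) + c * (+ 2 * d)
      shift-parity a b c d J e t eq rewrite sym eq = lemma a b c d J e
        where
        lemma : ∀ a b c d J e → a - b - c * (1ℤ - d) ≡ a - b - c * (J + d + e) + c * (J + e - 1ℤ) + c * (+ 2 * d)
        lemma = solve-∀

    pair-mult : ∀ y → y ≢ s → label q s ≡ label q y → mult (2 *ₙ m) (height q y - height q s - sameColourShift m q s y)
    pair-mult y y≢s s~y with reach y y≢s s~y
    ... | j , genuine , _ , e with row-parity y j genuine e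
    ...   | t , parity = mult-resp (sym (begin
            height q y - height q s - sameColourShift m q s y
              ≡⟨ cong (λ u → height q y - height q s - u) (trans (colourShift≡ m (ncol q s) (ncol q y)) (cong (λ u → + m * (1ℤ - u)) (colourMismatch-sym (ncol q s) (ncol q y)))) ⟩
            height q y - height q s - + m * (1ℤ - d)
              ≡⟨ shift-parity (height q y) (height q s) (+ m) d (+ suc j) (mismatch (isUpper y) (isUpper s)) t parity ⟩
            height q y - height q s - + m * (+ suc j + d + mismatch (isUpper y) (isUpper s)) + + m * (+ 2 * t) + + m * (+ 2 * d) ∎))
          (mult-+ (mult-+ walked (m*even m t)) (m*even m d))
      where
      open ≡-Reasoning
      d = colourMismatch (ncol q y) (ncol q s)
      walked : mult (2 *ₙ m) (height q y - height q s - + m * (+ suc j + d + mismatch (isUpper y) (isUpper s)))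
      walked = subst (mult (2 *ₙ m)) to-q
        (subst (λ w → mult (2 *ₙ m) (joinedHeight w - joinedHeight x - + m * (+ suc j + colourMismatch (colour w) (colour x) + mismatch (isTop w) (isTop x)))) e
               (invariant (suc j) genuine))
        where
        to-q : joinedHeight (fromQ y) - joinedHeight x - + m * (+ suc j + colourMismatch (colour (fromQ y)) (colour x) + mismatch (isTop (fromQ y)) (isTop x)) ≡
               height q y - height q s - + m * (+ suc j + d + mismatch (isUpper y) (isUpper s))
        to-q = cong₂ (λ u v → u - v) (cong₂ _-_ (joinedHeight-fromQ y) (joinedHeight-fromQ s))
                 (cong (λ u → + m * u) (cong₂ (λ c b → + suc j + c + b) (cong₂ colourMismatch (colour-fromQ y) (colour-fromQ s)) (cong₂ mismatch (isTop-fromQ y) (isTop-fromQ s))))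

  private
    moveP-fixes-upper : ∀ i₀ y → isUpper y ≢ isUpper {k} {l} (inj₁ i₀) → moveP (fromQ y) ≡ fromQ y
    moveP-fixes-upper i₀ (inj₁ i) lower = ⊥-elim (lower refl)
    moveP-fixes-upper i₀ (inj₂ j) _ = refl

    moveP′-fixes-lower : ∀ i₀ y → isUpper y ≡ isUpper {k} {l} (inj₁ i₀) → moveP′ (fromQ y) ≡ fromQ y
    moveP′-fixes-lower i₀ (inj₁ i) _ = refl

    moveP′-fixes-lower′ : ∀ j₀ y → isUpper y ≢ isUpper {k} {l} (inj₂ j₀) → moveP′ (fromQ y) ≡ fromQ y
    moveP′-fixes-lower′ j₀ (inj₁ i) _ = refl
    moveP′-fixes-lower′ j₀ (inj₂ j) upper = ⊥-elim (upper refl)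

    moveP-fixes-upper′ : ∀ j₀ y → isUpper y ≡ isUpper {k} {l} (inj₂ j₀) → moveP (fromQ y) ≡ fromQ y
    moveP-fixes-upper′ j₀ (inj₂ j) _ = refl

    edge⇒move′ : ∀ u v → CEdge p p′ u v → (v ≡ u) ⊎ (v ≡ moveP′ u) ⊎ (v ≡ moveP u)
    edge⇒move′ u v e = [ inj₁ , inj₂ ∘ [ inj₂ , inj₁ ] ] (edge⇒move u v e)

  module FromLower (i₀ : Fin k) = WalkFrom moveP moveP′ moveP-involutive moveP′-involutive step-moveP step-moveP′ edge⇒move
                                           (inj₁ i₀) refl (moveP-fixes-upper i₀) (moveP′-fixes-lower i₀)
  module FromUpper (j₀ : Fin l) = WalkFrom moveP′ moveP moveP′-involutive moveP-involutive step-moveP′ step-moveP edge⇒move′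
                                           (inj₂ j₀) refl (moveP′-fixes-lower′ j₀) (moveP-fixes-upper′ j₀)

PairBalanced-composition : ∀ m {k n l} (p : Part k n) (p′ : Part n l) q → Composable p p′ →
                           IsComposition p p′ q → PairBalanced m p → PairBalanced m p′ → PairBalanced m q
PairBalanced-composition m p p′ q composable comp bal bal′ = record
  { atMostTwo = atMostTwo
  ; Σ-mult = mult-resp (sym Σp-q) (mult-+ (PairBalanced.Σ-mult bal) (PairBalanced.Σ-mult bal′))
  ; height-mult = height-mult
  }
  where
  open PairComposition p p′ q composable comp m bal bal′
  open Composition p p′ q composable comp using (Σp-q)
  open Multiples (2 *ₙ m)
  atMostTwo : AtMostTwoPerBlock q
  atMostTwo (inj₁ i₀) b c a≢b a≢c b≢c a~b a~c = b≢c (FromLower.unique i₀ b c (≢-sym a≢b) (≢-sym a≢c) a~b a~c)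
  atMostTwo (inj₂ j₀) b c a≢b a≢c b≢c a~b a~c = b≢c (FromUpper.unique j₀ b c (≢-sym a≢b) (≢-sym a≢c) a~b a~c)
  height-mult : ∀ x y → x ≢ y → label q x ≡ label q y → mult (2 *ₙ m) (height q y - height q x - sameColourShift m q x y)
  height-mult (inj₁ i₀) y x≢y x~y = FromLower.pair-mult i₀ y (≢-sym x≢y) x~y
  height-mult (inj₂ j₀) y x≢y x~y = FromUpper.pair-mult j₀ y (≢-sym x≢y) x~y

swap-injective : ∀ {A B : Set} {x y : A ⊎ B} → swap x ≡ swap y → x ≡ y
swap-injective {x = x} {y} e = trans (sym (swap-involutive x)) (trans (cong swap e) (swap-involutive y))

PairBalanced-involution : ∀ m {k l} (p : Part k l) (q : Part l k) → IsInvolution p q → PairBalanced m p → PairBalanced m q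
PairBalanced-involution m p q inv bal = record
  { atMostTwo = λ a b c a≢b a≢c b≢c a~b a~c →
      atMostTwo (swap a) (swap b) (swap c) (a≢b ∘ swap-injective) (a≢c ∘ swap-injective) (b≢c ∘ swap-injective)
                (label-q a b a~b) (label-q a c a~c)
  ; Σ-mult = mult-resp (sym Σp-q) (mult-neg Σ-mult)
  ; height-mult = λ x y x≢y x~y → mult-resp (shift x y) (height-mult (swap x) (swap y) (x≢y ∘ swap-injective) (label-q x y x~y))
  }
  where
  open Involution p q inv
  open PairBalanced bal
  open Multiples (2 *ₙ m)
  shift-q : ∀ x y → sameColourShift m q x y ≡ sameColourShift m p (swap x) (swap y)
  shift-q x y rewrite ncol-q x | ncol-q y | eqCol-invert (ncol p (swap x)) (ncol p (swap y)) = refl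
  shift : ∀ x y → height p (swap y) - height p (swap x) - sameColourShift m p (swap x) (swap y) ≡ height q y - height q x - sameColourShift m q x y
  shift x y = sym (begin
    height q y - height q x - sameColourShift m q x y
      ≡⟨ cong₂ (λ u v → u - v - sameColourShift m q x y) (height-q y) (height-q x) ⟩
    height p (swap y) - Σp p - (height p (swap x) - Σp p) - sameColourShift m q x y
      ≡⟨ cong (λ u → height p (swap y) - Σp p - (height p (swap x) - Σp p) - u) (shift-q x y) ⟩
    height p (swap y) - Σp p - (height p (swap x) - Σp p) - sameColourShift m p (swap x) (swap y)
      ≡⟨ lemma (height p (swap y)) (height p (swap x)) (Σp p) (sameColourShift m p (swap x) (swap y)) ⟩
    height p (swap y) - height p (swap x) - sameColourShift m p (swap x) (swap y) ∎)
    where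
    open ≡-Reasoning
    lemma : ∀ a b s c → a - s - (b - s) - c ≡ a - b - c
    lemma = solve-∀

PairBalanced-tensor : ∀ m {k₁ l₁ k₂ l₂} (p : Part k₁ l₁) (p′ : Part k₂ l₂) q →
                      IsTensor p p′ q → PairBalanced m p → PairBalanced m p′ → PairBalanced m q
PairBalanced-tensor m p p′ q ten bal bal′ = record
  { atMostTwo = atMostTwo-q
  ; Σ-mult = mult-resp (sym Σp-q) (mult-+ (PairBalanced.Σ-mult bal) (PairBalanced.Σ-mult bal′))
  ; height-mult = height-mult-q
  }
  where
  open Tensor p p′ q ten
  open Multiples (2 *ₙ m)
  atMostTwo-q : AtMostTwoPerBlock q
  atMostTwo-q x y z x≢y x≢z y≢z x~y x~z with left-or-right x | left-or-right y | left-or-right z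
  ... | inj₁ (a , refl) | inj₁ (b , refl) | inj₁ (c , refl) =
    PairBalanced.atMostTwo bal a b c (x≢y ∘ cong left) (x≢z ∘ cong left) (y≢z ∘ cong left) (label-left a b x~y) (label-left a c x~z)
  ... | inj₂ (a , refl) | inj₂ (b , refl) | inj₂ (c , refl) =
    PairBalanced.atMostTwo bal′ a b c (x≢y ∘ cong right) (x≢z ∘ cong right) (y≢z ∘ cong right) (label-right a b x~y) (label-right a c x~z)
  ... | inj₁ (a , refl) | inj₂ (b , refl) | _ = label-left≢right a b x~y
  ... | inj₂ (a , refl) | inj₁ (b , refl) | _ = label-left≢right b a (sym x~y)
  ... | inj₁ (a , refl) | inj₁ _ | inj₂ (c , refl) = label-left≢right a c x~z
  ... | inj₂ (a , refl) | inj₂ _ | inj₁ (c , refl) = label-left≢right c a (sym x~z)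
  when-mult : ∀ c → mult (2 *ₙ m) (when c (Σp p′))
  when-mult true  = PairBalanced.Σ-mult bal′
  when-mult false = mult-0
  height-mult-q : ∀ x y → x ≢ y → label q x ≡ label q y → mult (2 *ₙ m) (height q y - height q x - sameColourShift m q x y)
  height-mult-q x y x≢y x~y with sameFactor x y x~y
  ... | in-left a₁ a₂ refl refl a₁~a₂ =
    mult-resp (sym (begin
        height q (left a₂) - height q (left a₁) - sameColourShift m q (left a₁) (left a₂)
          ≡⟨ cong₂ (λ u v → u - v - sameColourShift m q (left a₁) (left a₂)) (height-left a₂) (height-left a₁) ⟩
        height p a₂ + c₂ - (height p a₁ + c₁) - sameColourShift m q (left a₁) (left a₂)
          ≡⟨ cong (λ u → height p a₂ + c₂ - (height p a₁ + c₁) - u) shift-left ⟩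
        height p a₂ + c₂ - (height p a₁ + c₁) - sameColourShift m p a₁ a₂
          ≡⟨ lemma (height p a₂) (height p a₁) c₂ c₁ (sameColourShift m p a₁ a₂) ⟩
        height p a₂ - height p a₁ - sameColourShift m p a₁ a₂ + (c₂ - c₁) ∎))
      (mult-+ (PairBalanced.height-mult bal a₁ a₂ (x≢y ∘ cong left) a₁~a₂) (mult-- (when-mult (isUpper a₂)) (when-mult (isUpper a₁))))
    where
    open ≡-Reasoning
    c₁ = when (isUpper a₁) (Σp p′)
    c₂ = when (isUpper a₂) (Σp p′)
    shift-left : sameColourShift m q (left a₁) (left a₂) ≡ sameColourShift m p a₁ a₂
    shift-left rewrite ncol-left a₁ | ncol-left a₂ = refl
    lemma : ∀ u v c d w → u + c - (v + d) - w ≡ u - v - w + (c - d)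
    lemma = solve-∀
  ... | in-right b₁ b₂ refl refl b₁~b₂ =
    mult-resp (sym (begin
        height q (right b₂) - height q (right b₁) - sameColourShift m q (right b₁) (right b₂)
          ≡⟨ cong₂ (λ u v → u - v - sameColourShift m q (right b₁) (right b₂)) (height-right b₂) (height-right b₁) ⟩
        height p′ b₂ + lowerΣ - (height p′ b₁ + lowerΣ) - sameColourShift m q (right b₁) (right b₂)
          ≡⟨ cong (λ u → height p′ b₂ + lowerΣ - (height p′ b₁ + lowerΣ) - u) shift-right ⟩
        height p′ b₂ + lowerΣ - (height p′ b₁ + lowerΣ) - sameColourShift m p′ b₁ b₂
          ≡⟨ lemma (height p′ b₂) (height p′ b₁) lowerΣ (sameColourShift m p′ b₁ b₂) ⟩
        height p′ b₂ - height p′ b₁ - sameColourShift m p′ b₁ b₂ ∎))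
      (PairBalanced.height-mult bal′ b₁ b₂ (x≢y ∘ cong right) b₁~b₂)
    where
    open ≡-Reasoning
    shift-right : sameColourShift m q (right b₁) (right b₂) ≡ sameColourShift m p′ b₁ b₂
    shift-right rewrite ncol-right b₁ | ncol-right b₂ = refl
    lemma : ∀ u v c w → u + c - (v + c) - w ≡ u - v - w
    lemma = solve-∀

Flat⇒PairBalanced : ∀ m {k l} (p : Part k l) → Flat p → AtMostTwoPerBlock p →
                    (∀ x y → x ≢ y → eqCol (ncol p x) (ncol p y) ≡ false) → PairBalanced m p
Flat⇒PairBalanced m p (Σ≡0 , constant) atMostTwo distinct = record
  { atMostTwo = atMostTwo
  ; Σ-mult = mult-resp (sym Σ≡0) mult-0
  ; height-mult = λ x y x≢y _ → mult-resp (sym (vanishes x y x≢y)) mult-0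
  }
  where
  open Multiples (2 *ₙ m)
  vanishes : ∀ x y → x ≢ y → height p y - height p x - sameColourShift m p x y ≡ 0ℤ
  vanishes x y x≢y rewrite constant y x | distinct x y x≢y = trans (ℤP.+-identityʳ _) (ℤP.+-inverseʳ (height p x))

atMostTwo-1+1 : (q : Part 1 1) → AtMostTwoPerBlock q
atMostTwo-1+1 q (inj₁ Fin.zero) (inj₁ Fin.zero) _ a≢b _ _ _ _ = a≢b refl
atMostTwo-1+1 q (inj₁ Fin.zero) (inj₂ Fin.zero) (inj₁ Fin.zero) _ a≢c _ _ _ = a≢c refl
atMostTwo-1+1 q (inj₁ Fin.zero) (inj₂ Fin.zero) (inj₂ Fin.zero) _ _ b≢c _ _ = b≢c refl
atMostTwo-1+1 q (inj₂ Fin.zero) (inj₂ Fin.zero) _ a≢b _ _ _ _ = a≢b refl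
atMostTwo-1+1 q (inj₂ Fin.zero) (inj₁ Fin.zero) (inj₂ Fin.zero) _ a≢c _ _ _ = a≢c refl
atMostTwo-1+1 q (inj₂ Fin.zero) (inj₁ Fin.zero) (inj₁ Fin.zero) _ _ b≢c _ _ = b≢c refl

atMostTwo-2+0 : (q : Part 2 0) → AtMostTwoPerBlock q
atMostTwo-2+0 q (inj₁ Fin.zero) (inj₁ Fin.zero) _ a≢b _ _ _ _ = a≢b refl
atMostTwo-2+0 q (inj₁ Fin.zero) (inj₁ (Fin.suc Fin.zero)) (inj₁ Fin.zero) _ a≢c _ _ _ = a≢c refl
atMostTwo-2+0 q (inj₁ Fin.zero) (inj₁ (Fin.suc Fin.zero)) (inj₁ (Fin.suc Fin.zero)) _ _ b≢c _ _ = b≢c refl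
atMostTwo-2+0 q (inj₁ (Fin.suc Fin.zero)) (inj₁ (Fin.suc Fin.zero)) _ a≢b _ _ _ _ = a≢b refl
atMostTwo-2+0 q (inj₁ (Fin.suc Fin.zero)) (inj₁ Fin.zero) (inj₁ (Fin.suc Fin.zero)) _ a≢c _ _ _ = a≢c refl
atMostTwo-2+0 q (inj₁ (Fin.suc Fin.zero)) (inj₁ Fin.zero) (inj₁ Fin.zero) _ _ b≢c _ _ = b≢c refl

eqCol-invertʳ : ∀ c → eqCol c (invert c) ≡ false
eqCol-invertʳ white = refl
eqCol-invertʳ black = refl

eqCol-invertˡ : ∀ c → eqCol (invert c) c ≡ false
eqCol-invertˡ white = refl
eqCol-invertˡ black = refl

distinct-identity : ∀ c (q : Part 1 1) → lowerCol q Fin.zero ≡ c → upperCol q Fin.zero ≡ c →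
                    ∀ x y → x ≢ y → eqCol (ncol q x) (ncol q y) ≡ false
distinct-identity c q lc uc (inj₁ Fin.zero) (inj₁ Fin.zero) x≢y = ⊥-elim (x≢y refl)
distinct-identity c q lc uc (inj₁ Fin.zero) (inj₂ Fin.zero) _ rewrite lc | uc = eqCol-invertʳ c
distinct-identity c q lc uc (inj₂ Fin.zero) (inj₁ Fin.zero) _ rewrite lc | uc = eqCol-invertˡ c
distinct-identity c q lc uc (inj₂ Fin.zero) (inj₂ Fin.zero) x≢y = ⊥-elim (x≢y refl)

distinct-pair : ∀ c (q : Part 2 0) → lowerCol q Fin.zero ≡ c → lowerCol q (Fin.suc Fin.zero) ≡ invert c →
                ∀ x y → x ≢ y → eqCol (ncol q x) (ncol q y) ≡ false
distinct-pair c q l₀ l₁ (inj₁ Fin.zero) (inj₁ Fin.zero) x≢y = ⊥-elim (x≢y refl)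
distinct-pair c q l₀ l₁ (inj₁ Fin.zero) (inj₁ (Fin.suc Fin.zero)) _ rewrite l₀ | l₁ = eqCol-invertʳ c
distinct-pair c q l₀ l₁ (inj₁ (Fin.suc Fin.zero)) (inj₁ Fin.zero) _ rewrite l₀ | l₁ = eqCol-invertˡ c
distinct-pair c q l₀ l₁ (inj₁ (Fin.suc Fin.zero)) (inj₁ (Fin.suc Fin.zero)) x≢y = ⊥-elim (x≢y refl)

category-Qb : ∀ m → IsCategory (R (Qb m))
category-Qb m = record
  { hasEmpty    = λ q → PairBalanced⇒R m q (Flat⇒PairBalanced m q (flat-empty q) (λ { (inj₁ ()) ; (inj₂ ()) }) (λ { (inj₁ ()) ; (inj₂ ()) }))
  ; hasId       = λ c q lc uc _ → PairBalanced⇒R m q (Flat⇒PairBalanced m q (flat-identity c q (lc Fin.zero) (uc Fin.zero))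
                                                        (atMostTwo-1+1 q) (distinct-identity c q (lc Fin.zero) (uc Fin.zero)))
  ; hasPairBW   = λ q l₀ l₁ _ → PairBalanced⇒R m q (Flat⇒PairBalanced m q (flat-pair black q l₀ l₁) (atMostTwo-2+0 q) (distinct-pair black q l₀ l₁))
  ; hasPairWB   = λ q l₀ l₁ _ → PairBalanced⇒R m q (Flat⇒PairBalanced m q (flat-pair white q l₀ l₁) (atMostTwo-2+0 q) (distinct-pair white q l₀ l₁))
  ; tensor      = λ p p′ q rp rp′ ten →
      PairBalanced⇒R m q (PairBalanced-tensor m p p′ q ten (R⇒PairBalanced m p rp) (R⇒PairBalanced m p′ rp′))
  ; involution  = λ p q rp inv → PairBalanced⇒R m q (PairBalanced-involution m p q inv (R⇒PairBalanced m p rp))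
  ; composition = λ p p′ q rp rp′ composable comp →
      PairBalanced⇒R m q (PairBalanced-composition m p p′ q composable comp (R⇒PairBalanced m p rp) (R⇒PairBalanced m p′ rp′))
  }

lemma6p13 : ∀ (m : ℕ) → IsCategory (R (Qa m)) × IsCategory (R (Qb m))
lemma6p13 m = category-Qa m , category-Qb m
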